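{- Let $\alpha:=1+1/\sqrt{2}$ and $\gamma:=1+\sqrt{2}$. Let $k\geq 1$ and $\Delta\geq 1$ be integers, and let $G$ be a graph with tree-width at most $k$ and maximum degree at most $\Delta$. Then $$\mathrm{tpw}(G)\leq\gamma(k+1)(3\gamma\Delta-1).$$ Moreover, for each set $S\subseteq V(G)$ such that $$(\gamma+1)(k+1)\leq|S|\leq 3(\gamma+1)(k+1)\Delta,$$ there is a tree-partition of $G$ with width at most $\gamma(k+1)(3\gamma\Delta-1)$ such that $S$ is contained in a single bag, and this bag contains at most $\alpha|S|-\gamma(k+1)$ vertices.
   Context: All graphs are finite, simple and undirected. A graph $H$ is a partition of a graph $G$ if each vertex of $H$ (called a bag) is a set of vertices of $G$, every vertex of $G$ lies in exactly one bag, and distinct bags $A,B$ are adjacent in $H$ if and only if some edge of $G$ has one endpoint in $A$ and the other in $B$. The width of a partition is the maximum number of vertices in a bag. If a forest $T$ is a partition of $G$, then $T$ is a tree-partition of $G$. The tree-partition-width $\mathrm{tpw}(G)$ is the minimum width of a tree-partition of $G$. -}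

module Defs where

open import Data.Nat as ℕ using (ℕ; zero; suc)
open import Data.Integer using (+_)
open import Data.Rational as ℚ using (ℚ; _/_; 0ℚ; 1ℚ; ½)
open import Data.Fin as Fin using (Fin; zero; suc; inject₁; fromℕ)
open import Data.Fin.Subset using (Subset; _∈_; _⊆_; ∣_∣)
open import Data.Vec using (tabulate)
open import Data.Bool using (Bool; true; false)
open import Data.Unit using (⊤)
open import Data.Product using (Σ; ∃; ∃-syntax; _×_; _,_)
open import Data.Sum using (_⊎_)
open import Function.Definitions using (Injective)
open import Relation.Nullary using (¬_; does)
open import Relation.Binary.PropositionalEquality using (_≡_; _≢_)

-- The ordered field ℚ(√2): a number a + b√2 is represented by (a , b).

record ℚ√2 : Set where
  constructor _+_√2
  field
    re : ℚ
    im : ℚ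
open ℚ√2 public

infixl 6 _⊕_ _⊖_
infixl 7 _⊗_

_⊕_ : ℚ√2 → ℚ√2 → ℚ√2
(a + b √2) ⊕ (c + d √2) = (a ℚ.+ c) + (b ℚ.+ d) √2

_⊖_ : ℚ√2 → ℚ√2 → ℚ√2
(a + b √2) ⊖ (c + d √2) = (a ℚ.- c) + (b ℚ.- d) √2

_⊗_ : ℚ√2 → ℚ√2 → ℚ√2
(a + b √2) ⊗ (c + d √2) =
  ((a ℚ.* c) ℚ.+ ((+ 2 / 1) ℚ.* (b ℚ.* d))) + ((a ℚ.* d) ℚ.+ (b ℚ.* c)) √2

nat : ℕ → ℚ√2
nat n = (+ n / 1) + 0ℚ √2

√2 : ℚ√2
√2 = 0ℚ + 1ℚ √2

-- a + b√2 ≥ 0  (with √2 the positive square root of 2)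
NonNeg : ℚ√2 → Set
NonNeg (a + b √2) =
    (0ℚ ℚ.≤ a × 0ℚ ℚ.≤ b)
  ⊎ (0ℚ ℚ.≤ a × b ℚ.< 0ℚ × (+ 2 / 1) ℚ.* (b ℚ.* b) ℚ.≤ a ℚ.* a)
  ⊎ (a ℚ.< 0ℚ × 0ℚ ℚ.< b × a ℚ.* a ℚ.≤ (+ 2 / 1) ℚ.* (b ℚ.* b))

infix 4 _≤√_
_≤√_ : ℚ√2 → ℚ√2 → Set
x ≤√ y = NonNeg (y ⊖ x)

-- α = 1 + 1/√2 = 1 + (1/2)√2 ,  γ = 1 + √2
α : ℚ√2
α = 1ℚ + ½ √2

γ : ℚ√2
γ = 1ℚ + 1ℚ √2

record Graph (n : ℕ) : Set where
  field
    adj    : Fin n → Fin n → Bool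
    sym    : ∀ u v → adj u v ≡ adj v u
    irrefl : ∀ v → adj v v ≡ false
open Graph public

N : ∀ {n} → Graph n → Fin n → Subset n
N G v = tabulate (λ u → adj G v u)

MaxDegree≤ : ∀ {n} → Graph n → ℕ → Set
MaxDegree≤ G Δ = ∀ v → ∣ N G v ∣ ℕ.≤ Δ

data WalkIn {m : ℕ} (R : Fin m → Fin m → Set) (P : Fin m → Set)
            : Fin m → Fin m → Set where
  here : ∀ {x} → P x → WalkIn R P x x
  step : ∀ {x y z} → P x → R x y → WalkIn R P y z → WalkIn R P x z

Connected : ∀ {m} → (Fin m → Fin m → Set) → Set
Connected R = ∀ x y → WalkIn R (λ _ → ⊤) x y

-- a cycle c₀ c₁ … c_{l+2} c₀ of length l+3 ≥ 3 with distinct vertices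
HasCycle : ∀ {m} → (Fin m → Fin m → Set) → Set
HasCycle {m} R =
  Σ ℕ λ l → Σ (Fin (3 ℕ.+ l) → Fin m) λ c →
      Injective _≡_ _≡_ c
    × (∀ (i : Fin (2 ℕ.+ l)) → R (c (inject₁ i)) (c (suc i)))
    × R (c (fromℕ (2 ℕ.+ l))) (c zero)

Acyclic : ∀ {m} → (Fin m → Fin m → Set) → Set
Acyclic R = ¬ HasCycle R

-- Tree decompositions; G has tree-width at most k iff it has a tree
-- decomposition all of whose bags have at most k+1 vertices.

record TreeDecomposition {n : ℕ} (G : Graph n) (k : ℕ) : Set₁ where
  field
    m        : ℕ
    T        : Fin m → Fin m → Set
    T-sym    : ∀ s t → T s t → T t s
    T-irrefl : ∀ t → ¬ T t t
    T-conn   : Connected T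
    T-acyc   : Acyclic T
    bag      : Fin m → Subset n
    cover-v  : ∀ v → ∃ λ t → v ∈ bag t
    cover-e  : ∀ u v → adj G u v ≡ true → ∃ λ t → u ∈ bag t × v ∈ bag t
    subtree  : ∀ v s t → v ∈ bag s → v ∈ bag t → WalkIn T (λ r → v ∈ bag r) s t
    width    : ∀ t → ∣ bag t ∣ ℕ.≤ suc k

TreeWidth≤ : ∀ {n} → Graph n → ℕ → Set₁
TreeWidth≤ G k = TreeDecomposition G k

-- A partition of G with bags indexed
-- by Fin m is given by the map f sending each vertex to its bag; two
-- distinct bags i, j are adjacent iff some edge of G goes between them.

QuotAdj : ∀ {n m} → Graph n → (Fin n → Fin m) → Fin m → Fin m → Set
QuotAdj G f i j = i ≢ j × ∃ λ u → ∃ λ v → adj G u v ≡ true × f u ≡ i × f v ≡ j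

record TreePartition {n : ℕ} (G : Graph n) : Set where
  field
    m      : ℕ
    f      : Fin n → Fin m
    forest : Acyclic (QuotAdj G f)

  Bag : Fin m → Subset n
  Bag i = tabulate (λ u → does (f u Fin.≟ i))
open TreePartition public

-- By induction on |U| we build a rooted tree-partition
-- of G[U] whose root bag contains a prescribed set S with (γ+1)(k+1) ≤ |S| ≤ 3(γ+1)(k+1)Δ.
-- If |S| < 3(γ+1)(k+1), S itself is the root bag and the at most |S|Δ neighbours of S,
-- padded up to (γ+1)(k+1) vertices if necessary, are prescribed for the rest of U.
-- Otherwise a bag X of the decomposition splits S ∖ X into parts holding at most half of S
-- each; grouping the parts into two sides with between a third and two thirds of S ∖ X,
-- both sides plus X are partitioned recursively and the two root bags, which both contain X,
-- are glued.  The irrational bounds become integer inequalities about ⌊√2 x⌋ and ⌈√2 x⌉.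
module Submission where

module Counting where

  open import Data.Nat.Base using (ℕ; zero; suc; _+_; _*_; _≤_; _<_; z≤n; s≤s)
  open import Data.Nat using (_≤?_)
  open import Data.Nat.Properties
  open import Data.Bool.Base using (Bool; true; false; _∧_; _∨_; not; T)
  open import Data.Bool.Properties using (T-∧; T-∨; T?)
  open import Data.Fin.Base using (Fin; zero; suc)
  open import Data.Fin.Properties using (any?)
  open import Data.Fin.Subset using (Subset; _∈_; ∣_∣)
  open import Data.Vec.Base using (tabulate; lookup)
  open import Data.Vec.Properties using (tabulate-cong; tabulate∘lookup; []=⇒lookup; lookup⇒[]=)
  open import Data.Product.Base using (Σ; ∃; _×_; _,_; proj₁; proj₂)
  open import Data.Sum.Base using (_⊎_; inj₁; inj₂)
  open import Data.Unit.Base using (tt)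
  open import Data.Empty using (⊥-elim)
  open import Function.Base using (_∘_)
  open import Data.Vec.Functional using (_∷_)
  open import Function.Bundles using (Equivalence)
  open import Relation.Nullary using (¬_; Dec; yes; no; does)
  open import Relation.Unary using (Decidable)
  open import Relation.Binary.PropositionalEquality using (_≡_; refl; sym; trans; cong; subst)

  -- T is not injective, so the Booleans of T-∧ and T-∨ can rarely be inferred; these
  -- versions take them explicitly.
  T-∨-elim : ∀ a b → T (a ∨ b) → T a ⊎ T b
  T-∨-elim a b = Equivalence.to (T-∨ {a} {b})

  T-∨-injˡ : ∀ a b → T a → T (a ∨ b)
  T-∨-injˡ a b h = Equivalence.from (T-∨ {a} {b}) (inj₁ h)

  T-∨-injʳ : ∀ a b → T b → T (a ∨ b)
  T-∨-injʳ a b h = Equivalence.from (T-∨ {a} {b}) (inj₂ h)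

  T-∧-intro : ∀ {a b} → T a → T b → T (a ∧ b)
  T-∧-intro {a} {b} ha hb = Equivalence.from (T-∧ {a} {b}) (ha , hb)

  T-∧-proj₁ : ∀ a b → T (a ∧ b) → T a
  T-∧-proj₁ a b = proj₁ ∘ Equivalence.to (T-∧ {a} {b})

  T-∧-proj₂ : ∀ a b → T (a ∧ b) → T b
  T-∧-proj₂ a b = proj₂ ∘ Equivalence.to (T-∧ {a} {b})

  T-not-intro : ∀ a → ¬ T a → T (not a)
  T-not-intro true h = h tt
  T-not-intro false h = tt

  T-not-elim : ∀ a → T (not a) → ¬ T a
  T-not-elim true ()
  T-not-elim false _ ()

  does-sound : ∀ {P : Set} (d : Dec P) → T (does d) → P
  does-sound (yes p) _ = p

  does-complete : ∀ {P : Set} (d : Dec P) → P → T (does d)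
  does-complete (yes _) _ = tt
  does-complete (no ¬p) p = ¬p p

  any : ∀ {m} → (Fin m → Bool) → Bool
  any P = does (any? (T? ∘ P))

  any-intro : ∀ {m} (P : Fin m → Bool) i → T (P i) → T (any P)
  any-intro P i h = does-complete (any? (T? ∘ P)) (i , h)

  any-elim : ∀ {m} (P : Fin m → Bool) → T (any P) → ∃ λ i → T (P i)
  any-elim P = does-sound (any? (T? ∘ P))

  least : {P : ℕ → Set} → Decidable P → ∀ L → P L → Σ ℕ λ i → P i × (∀ j → j < i → ¬ P j)
  least P? zero h = 0 , h , λ _ ()
  least P? (suc L) h with P? 0 | least (P? ∘ suc) L h
  ... | yes h0 | _ = 0 , h0 , λ _ ()
  ... | no ¬h0 | i , hi , below = suc i , hi , λ { zero _ → ¬h0 ; (suc j) (s≤s j<i) → below j j<i }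

  argmax : ∀ {m} {Q : Fin m → Set} → Decidable Q → (h : Fin m → ℕ) → ∃ Q →
    Σ (Fin m) λ t → Q t × (∀ t' → Q t' → h t' ≤ h t)
  argmax {suc m} Q? h (i , qi) with any? (Q? ∘ suc)
  argmax {suc m} Q? h (zero , q0) | no none = zero , q0 , λ { zero _ → ≤-refl ; (suc t) q → ⊥-elim (none (t , q)) }
  argmax {suc m} Q? h (suc i , qi) | no none = ⊥-elim (none (i , qi))
  ... | yes w with argmax (Q? ∘ suc) (h ∘ suc) w | Q? zero
  ... | t , qt , top | no ¬q0 = suc t , qt , λ { zero q → ⊥-elim (¬q0 q) ; (suc t') q → top t' q }
  ... | t , qt , top | yes q0 with h zero ≤? h (suc t)
  ... | yes le = suc t , qt , λ { zero _ → le ; (suc t') q → top t' q }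
  ... | no gt = zero , q0 , λ { zero _ → ≤-refl ; (suc t') q → ≤-trans (top t' q) (<⇒≤ (≰⇒> gt)) }

  ∈⇒T : ∀ {n} {x : Fin n} {p : Subset n} → x ∈ p → T (lookup p x)
  ∈⇒T x∈p = subst T (sym ([]=⇒lookup x∈p)) tt

  T⇒∈ : ∀ {n} {x : Fin n} {p : Subset n} → T (lookup p x) → x ∈ p
  T⇒∈ {x = x} {p} h = lookup⇒[]= x p (true-if-T h)
    where
    true-if-T : ∀ {b} → T b → b ≡ true
    true-if-T {true} _ = refl

  count : ∀ {n} → (Fin n → Bool) → ℕ
  count P = ∣ tabulate P ∣

  ∣∣≡count : ∀ {n} (S : Subset n) → ∣ S ∣ ≡ count (lookup S)
  ∣∣≡count S = cong ∣_∣ (sym (tabulate∘lookup S))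

  count-cong : ∀ {n} {P Q : Fin n → Bool} → (∀ i → P i ≡ Q i) → count P ≡ count Q
  count-cong e = cong ∣_∣ (tabulate-cong e)

  count-mono : ∀ {n} {P Q : Fin n → Bool} → (∀ i → T (P i) → T (Q i)) → count P ≤ count Q
  count-mono {zero} h = z≤n
  count-mono {suc n} {P} {Q} h with P zero | Q zero | h zero
  ... | false | false | _ = count-mono (h ∘ suc)
  ... | false | true | _ = m≤n⇒m≤1+n (count-mono (h ∘ suc))
  ... | true | false | h0 = ⊥-elim (h0 tt)
  ... | true | true | _ = s≤s (count-mono (h ∘ suc))

  count≤n : ∀ {n} (P : Fin n → Bool) → count P ≤ n
  count≤n {zero} P = z≤n
  count≤n {suc n} P with P zero
  ... | true = s≤s (count≤n (P ∘ suc))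
  ... | false = m≤n⇒m≤1+n (count≤n (P ∘ suc))

  count-false : ∀ {n} → count {n} (λ _ → false) ≡ 0
  count-false {zero} = refl
  count-false {suc n} = count-false {n}

  count-true : ∀ {n} → count {n} (λ _ → true) ≡ n
  count-true {zero} = refl
  count-true {suc n} = cong suc (count-true {n})

  count-∨-∧ : ∀ {n} (P Q : Fin n → Bool) →
    count (λ i → P i ∨ Q i) + count (λ i → P i ∧ Q i) ≡ count P + count Q
  count-∨-∧ {zero} P Q = refl
  count-∨-∧ {suc n} P Q with P zero | Q zero | count-∨-∧ (P ∘ suc) (Q ∘ suc)
  ... | true | true | ih = cong suc (trans (+-suc _ _) (trans (cong suc ih) (sym (+-suc _ _))))
  ... | true | false | ih = cong suc ih
  ... | false | true | ih = trans (cong suc ih) (sym (+-suc _ _))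
  ... | false | false | ih = ih

  count-∨ : ∀ {n} (P Q : Fin n → Bool) → count (λ i → P i ∨ Q i) ≤ count P + count Q
  count-∨ P Q = ≤-trans (m≤m+n _ _) (≤-reflexive (count-∨-∧ P Q))

  count-split : ∀ {n} (P Q : Fin n → Bool) →
    count P ≡ count (λ i → P i ∧ Q i) + count (λ i → P i ∧ not (Q i))
  count-split {zero} P Q = refl
  count-split {suc n} P Q with P zero | Q zero | count-split (P ∘ suc) (Q ∘ suc)
  ... | true | true | ih = cong suc ih
  ... | true | false | ih = trans (cong suc ih) (sym (+-suc _ _))
  ... | false | _ | ih = ih

  count-pos : ∀ {n} (P : Fin n → Bool) i → T (P i) → 0 < count P
  count-pos P zero h with P zero
  ... | true = s≤s z≤n
  ... | false = ⊥-elim h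
  count-pos P (suc i) h with P zero
  ... | true = s≤s z≤n
  ... | false = count-pos (P ∘ suc) i h

  count-witness : ∀ {n} (P : Fin n → Bool) → 0 < count P → ∃ λ i → T (P i)
  count-witness {suc n} P pos with P zero in p0
  ... | true = zero , subst T (sym p0) tt
  ... | false with count-witness (P ∘ suc) pos
  ...   | i , h = suc i , h

  count-strict-mono : ∀ {n} {P Q : Fin n → Bool} → (∀ i → T (P i) → T (Q i)) →
    ∀ j → T (Q j) → ¬ T (P j) → count P < count Q
  count-strict-mono {P = P} {Q} P⊆Q j qj ¬pj = begin-strict
    count P                                                 ≡⟨ +-identityʳ (count P) ⟨
    count P + 0                                             <⟨ +-mono-≤-< inter outside ⟩
    count (λ i → Q i ∧ P i) + count (λ i → Q i ∧ not (P i)) ≡⟨ count-split Q P ⟨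
    count Q                                                 ∎
    where
    open ≤-Reasoning
    inter : count P ≤ count (λ i → Q i ∧ P i)
    inter = count-mono λ i pi → T-∧-intro (P⊆Q i pi) pi
    outside : 0 < count (λ i → Q i ∧ not (P i))
    outside = count-pos _ j (T-∧-intro qj (T-not-intro (P j) ¬pj))

  count-neighbourhood : ∀ {m n} (S : Fin m → Bool) (A : Fin m → Fin n → Bool) Δ →
    (∀ u → count (A u) ≤ Δ) → count (λ v → any (λ u → S u ∧ A u v)) ≤ count S * Δ
  count-neighbourhood {zero} {n} S A Δ deg = ≤-reflexive (count-false {n})
  count-neighbourhood {suc m} S A Δ deg with S zero
  ... | true = begin
    count (λ v → A zero v ∨ any (λ u → S (suc u) ∧ A (suc u) v)) ≤⟨ count-∨ (A zero) _ ⟩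
    count (A zero) + count (λ v → any (λ u → S (suc u) ∧ A (suc u) v))
      ≤⟨ +-mono-≤ (deg zero) (count-neighbourhood (S ∘ suc) (A ∘ suc) Δ (deg ∘ suc)) ⟩
    Δ + count (S ∘ suc) * Δ ∎
    where open ≤-Reasoning
  ... | false = count-neighbourhood (S ∘ suc) (A ∘ suc) Δ (deg ∘ suc)

  private
    extend : ∀ {n t t'} {A U : Fin (suc n) → Bool} (b : Bool) →
      Σ (Fin n → Bool) (λ S → (∀ i → T (A (suc i)) → T (S i)) × (∀ i → T (S i) → T (U (suc i))) × count S ≡ t') →
      (T (A zero) → T b) → (T b → T (U zero)) → (∀ S → count S ≡ t' → count (b ∷ S) ≡ t) →
      Σ (Fin (suc n) → Bool) λ S → (∀ i → T (A i) → T (S i)) × (∀ i → T (S i) → T (U i)) × count S ≡ t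
    extend b (S , A⊆S , S⊆U , e) a0 u0 e0 =
      b ∷ S , (λ { zero → a0 ; (suc i) → A⊆S i }) , (λ { zero → u0 ; (suc i) → S⊆U i }) , e0 S e

  count-between : ∀ {n} (A U : Fin n → Bool) → (∀ i → T (A i) → T (U i)) →
    ∀ t → count A ≤ t → t ≤ count U →
    Σ (Fin n → Bool) λ S → (∀ i → T (A i) → T (S i)) × (∀ i → T (S i) → T (U i)) × count S ≡ t
  count-between {zero} A U A⊆U zero _ _ = (λ ()) , (λ ()) , (λ ()) , refl
  count-between {zero} A U A⊆U (suc t) _ ()
  count-between {suc n} A U A⊆U t A≤t t≤U with A zero in a0 | U zero in u0
  ... | true | false = ⊥-elim (subst T u0 (A⊆U zero (subst T (sym a0) tt)))
  ... | true | true with t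
  ...   | zero = ⊥-elim (n≮0 A≤t)
  ...   | suc t' = extend true (count-between (A ∘ suc) (U ∘ suc) (A⊆U ∘ suc) t' (≤-pred A≤t) (≤-pred t≤U))
                     (λ _ → tt) (λ _ → subst T (sym u0) tt) (λ _ → cong suc)
  count-between {suc n} A U A⊆U t A≤t t≤U | false | false =
    extend false (count-between (A ∘ suc) (U ∘ suc) (A⊆U ∘ suc) t A≤t t≤U)
      (λ a → ⊥-elim (subst T a0 a)) (λ ()) (λ _ e → e)
  count-between {suc n} A U A⊆U t A≤t t≤U | false | true with t ≤? count (U ∘ suc)
  ... | yes t≤U' = extend false (count-between (A ∘ suc) (U ∘ suc) (A⊆U ∘ suc) t A≤t t≤U')
                     (λ a → ⊥-elim (subst T a0 a)) (λ ()) (λ _ e → e)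
  ... | no t≰U' with t
  ...   | zero = ⊥-elim (t≰U' z≤n)
  ...   | suc t' = extend true (count-between (A ∘ suc) (U ∘ suc) (A⊆U ∘ suc) t' A≤t' (≤-reflexive t'≡U'))
                     (λ _ → tt) (λ _ → subst T (sym u0) tt) (λ _ → cong suc)
    where
    t'≡U' : t' ≡ count (U ∘ suc)
    t'≡U' = ≤-antisym (≤-pred t≤U) (≤-pred (≰⇒> t≰U'))
    A≤t' : count (A ∘ suc) ≤ t'
    A≤t' = ≤-trans (count-mono (A⊆U ∘ suc)) (≤-reflexive (sym t'≡U'))

module RootedTrees where

  open import Data.Nat.Base using (ℕ; zero; suc; _+_; _∸_; _≤_; _<_; s≤s)
  open import Data.Nat.Properties hiding (_≟_)
  open import Data.Bool.Base using (Bool; _∧_; _∨_; T)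
  open import Data.Bool.Properties using (T?)
  open import Data.Fin.Base using (Fin; zero; suc; inject₁; fromℕ)
  open import Data.Fin.Properties using (_≟_)
  open import Data.List.Base using (List; []; _∷_; length; lookup; _∷ʳ_)
  open import Data.List.Membership.Propositional.Properties using (∈-lookup)
  open import Data.List.Relation.Unary.All as All using (All; []; _∷_)
  open import Data.List.Relation.Unary.All.Properties using (∷ʳ⁺)
  open import Data.List.Relation.Unary.AllPairs using (AllPairs; []; _∷_)
  open import Data.List.Relation.Unary.Linked using (Linked; [-]; _∷_)
  open import Data.Product.Base using (Σ; _×_; _,_; proj₁; proj₂)
  open import Data.Sum.Base using (_⊎_; inj₁; inj₂)
  open import Data.Empty using (⊥-elim)
  open import Data.Unit.Base using (⊤)
  open import Relation.Binary.Definitions using (tri<; tri≈; tri>)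
  open import Relation.Nullary using (¬_; Dec; yes; no; does)
  open import Relation.Binary.PropositionalEquality using (_≡_; _≢_; refl; sym; trans; cong; subst)
  open import Defs using (WalkIn; here; step; HasCycle)
  open Counting

  module _ {A : Set} where

    last : A → List A → A
    last a [] = a
    last a (b ∷ bs) = last b bs

    last-∷ʳ : ∀ (x : A) p y → last x (p ∷ʳ y) ≡ y
    last-∷ʳ x [] y = refl
    last-∷ʳ x (b ∷ p) y = last-∷ʳ b p y

    lookup-last : ∀ (a : A) as → lookup (a ∷ as) (fromℕ (length as)) ≡ last a as
    lookup-last a [] = refl
    lookup-last a (b ∷ bs) = lookup-last b bs

    lookup-injective : ∀ {xs : List A} → AllPairs _≢_ xs → ∀ i j → lookup xs i ≡ lookup xs j → i ≡ j
    lookup-injective (_ ∷ _) zero zero _ = refl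
    lookup-injective (x≢ ∷ _) zero (suc j) e = ⊥-elim (All.lookup x≢ (∈-lookup j) e)
    lookup-injective (x≢ ∷ _) (suc i) zero e = ⊥-elim (All.lookup x≢ (∈-lookup i) (sym e))
    lookup-injective (_ ∷ ps) (suc i) (suc j) e = cong suc (lookup-injective ps i j e)

    Linked-lookup : ∀ {R : A → A → Set} {a b bs} → Linked R (a ∷ b ∷ bs) →
      ∀ (i : Fin (suc (length bs))) → R (lookup (a ∷ b ∷ bs) (inject₁ i)) (lookup (a ∷ b ∷ bs) (suc i))
    Linked-lookup (r ∷ _) zero = r
    Linked-lookup {bs = _ ∷ _} (_ ∷ l) (suc i) = Linked-lookup l i

    Linked-∷ʳ : ∀ {R : A → A → Set} {x} p {y} → Linked R (x ∷ p) → R (last x p) y → Linked R (x ∷ (p ∷ʳ y))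
    Linked-∷ʳ [] _ r = r ∷ [-]
    Linked-∷ʳ (_ ∷ p) (r ∷ l) r′ = r ∷ Linked-∷ʳ p l r′

    AllPairs-∷ʳ : ∀ p {y : A} → AllPairs _≢_ p → All (_≢ y) p → AllPairs _≢_ (p ∷ʳ y)
    AllPairs-∷ʳ [] _ _ = [] ∷ []
    AllPairs-∷ʳ (_ ∷ p) (x≢ ∷ ps) (x≢y ∷ p≢y) = ∷ʳ⁺ x≢ x≢y ∷ AllPairs-∷ʳ p ps p≢y

  cycle-from-path : ∀ {m} {R : Fin m → Fin m → Set} (x y z : Fin m) zs →
    AllPairs _≢_ (x ∷ y ∷ z ∷ zs) → Linked R (x ∷ y ∷ z ∷ zs) → R (last z zs) x → HasCycle R
  cycle-from-path {R = R} x y z zs distinct linked closing =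
    length zs , lookup (x ∷ y ∷ z ∷ zs) ,
    (λ {i} {j} → lookup-injective distinct i j) ,
    Linked-lookup linked ,
    subst (λ w → R w x) (sym (lookup-last y (z ∷ zs))) closing

  module BreadthFirst {m : ℕ} (R : Fin m → Fin m → Bool)
                      (R-sym : ∀ a b → T (R a b) → T (R b a))
                      (R-irrefl : ∀ a → ¬ T (R a a))
                      (root : Fin m)
                      (R-connected : ∀ x → WalkIn (λ a b → T (R a b)) (λ _ → ⊤) root x)
                      (R-acyclic : ¬ HasCycle (λ a b → T (R a b))) where

    Edge : Fin m → Fin m → Set
    Edge a b = T (R a b)

    reachable : ℕ → Fin m → Bool
    reachable zero x = does (x ≟ root)
    reachable (suc i) x = reachable i x ∨ any (λ y → reachable i y ∧ R y x)

    reachable-step : ∀ i y x → T (reachable i y) → Edge y x → T (reachable (suc i) x)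
    reachable-step i y x hy yx = T-∨-injʳ (reachable i x) _ (any-intro (λ z → reachable i z ∧ R z x) y (T-∧-intro hy yx))

    reachable-walk : ∀ {a y} → WalkIn Edge (λ _ → ⊤) a y → ∀ i → T (reachable i a) → Σ ℕ λ L → T (reachable L y)
    reachable-walk (here _) i h = i , h
    reachable-walk (step {x} {b} _ xb w) i h = reachable-walk w (suc i) (reachable-step i x b h xb)

    opaque
      depth-spec : ∀ x → Σ ℕ λ i → T (reachable i x) × (∀ j → j < i → ¬ T (reachable j x))
      depth-spec x with reachable-walk (R-connected x) 0 (does-complete (root ≟ root) refl)
      ... | L , h = least (λ i → T? (reachable i x)) L h

      depth : Fin m → ℕ
      depth x = proj₁ (depth-spec x)

      depth-reachable : ∀ x → T (reachable (depth x) x)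
      depth-reachable x = proj₁ (proj₂ (depth-spec x))

      depth-minimal : ∀ i x → T (reachable i x) → depth x ≤ i
      depth-minimal i x h with depth x ≤? i
      ... | yes le = le
      ... | no gt = ⊥-elim (proj₂ (proj₂ (depth-spec x)) i (≰⇒> gt) h)

    depth-root : depth root ≡ 0
    depth-root = n≤0⇒n≡0 (depth-minimal 0 root (does-complete (root ≟ root) refl))

    depth≡0⇒root : ∀ {x} → depth x ≡ 0 → x ≡ root
    depth≡0⇒root {x} e = does-sound (x ≟ root) (subst (λ i → T (reachable i x)) e (depth-reachable x))

    depth-edge : ∀ a b → Edge a b → depth b ≤ suc (depth a)
    depth-edge a b ab = depth-minimal (suc (depth a)) b (reachable-step (depth a) a b (depth-reachable a) ab)

    ParentSpec : Fin m → Fin m → Set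
    ParentSpec x y = (depth x ≡ 0 × y ≡ x) ⊎ (suc (depth y) ≡ depth x × Edge y x)

    opaque
      parent-exists : ∀ x → Σ (Fin m) (ParentSpec x)
      parent-exists x = from-depth (depth x) refl
        where
        from-depth : ∀ e → depth x ≡ e → Σ (Fin m) (ParentSpec x)
        from-depth zero dx = x , inj₁ (dx , refl)
        from-depth (suc e) dx with T-∨-elim (reachable e x) _ (subst (λ i → T (reachable i x)) dx (depth-reachable x))
        ... | inj₁ earlier = ⊥-elim (<-irrefl dx (s≤s (depth-minimal e x earlier)))
        ... | inj₂ h with any-elim (λ z → reachable e z ∧ R z x) h
        ...   | y , hy = y , inj₂ (≤-antisym (subst (suc (depth y) ≤_) (sym dx) (s≤s (depth-minimal e y (T-∧-proj₁ _ _ hy))))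
                                             (depth-edge y x (T-∧-proj₂ _ _ hy)) ,
                                   T-∧-proj₂ _ _ hy)

      parent : Fin m → Fin m
      parent x = proj₁ (parent-exists x)

      parent-spec : ∀ x → ParentSpec x (parent x)
      parent-spec x = proj₂ (parent-exists x)

    parent-of-root : ∀ {x} → depth x ≡ 0 → parent x ≡ x
    parent-of-root {x} dx with parent-spec x
    ... | inj₁ (_ , p) = p
    ... | inj₂ (p , _) = ⊥-elim (1+n≢0 (trans p dx))

    depth-parent : ∀ {x e} → depth x ≡ suc e → depth (parent x) ≡ e
    depth-parent {x} dx with parent-spec x
    ... | inj₁ (d0 , _) = ⊥-elim (1+n≢0 (trans (sym dx) d0))
    ... | inj₂ (p , _) = suc-injective (trans p dx)

    parent-edge : ∀ {x e} → depth x ≡ suc e → Edge (parent x) x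
    parent-edge {x} dx with parent-spec x
    ... | inj₁ (d0 , _) = ⊥-elim (1+n≢0 (trans (sym dx) d0))
    ... | inj₂ (_ , h) = h

    depth-parent-∸ : ∀ x → depth (parent x) ≡ depth x ∸ 1
    depth-parent-∸ x with depth x in dx
    ... | zero = trans (cong depth (parent-of-root dx)) dx
    ... | suc e = depth-parent dx

    shallower : ∀ {z w e} → depth z ≤ e → depth w ≡ suc e → z ≢ w
    shallower dz dw refl = <-irrefl dw (s≤s dz)

    record LevelPath (e : ℕ) (x y : Fin m) : Set where
      field
        a b : Fin m
        rest : List (Fin m)
        linked : Linked Edge (x ∷ a ∷ b ∷ rest)
        distinct : AllPairs _≢_ (x ∷ a ∷ b ∷ rest)
        ends : last b rest ≡ y
        shallow : All (λ z → depth z ≤ e) (x ∷ a ∷ b ∷ rest)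

    level-path : ∀ e x y → depth x ≡ e → depth y ≡ e → x ≢ y → LevelPath e x y
    level-path zero x y dx dy x≢y = ⊥-elim (x≢y (trans (depth≡0⇒root dx) (sym (depth≡0⇒root dy))))
    level-path (suc e) x y dx dy x≢y with parent x ≟ parent y
    ... | yes same = record
      { a = parent x ; b = y ; rest = []
      ; linked = R-sym _ _ (parent-edge dx) ∷ subst (λ w → Edge w y) (sym same) (parent-edge dy) ∷ [-]
      ; distinct = ((λ eq → shallower (≤-reflexive (depth-parent dx)) dx (sym eq)) ∷ x≢y ∷ [])
                 ∷ (shallower (≤-reflexive (depth-parent dx)) dy ∷ []) ∷ [] ∷ []
      ; ends = refl
      ; shallow = ≤-reflexive dx ∷ m≤n⇒m≤1+n (≤-reflexive (depth-parent dx)) ∷ ≤-reflexive dy ∷ [] }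
    ... | no differ = extend (level-path e (parent x) (parent y) (depth-parent dx) (depth-parent dy) differ)
      where
      extend : LevelPath e (parent x) (parent y) → LevelPath (suc e) x y
      extend P = record
        { a = parent x ; b = a ; rest = (b ∷ rest) ∷ʳ y
        ; linked = R-sym _ _ (parent-edge dx) ∷ Linked-∷ʳ (a ∷ b ∷ rest) linked (subst (λ w → Edge w y) (sym ends) (parent-edge dy))
        ; distinct = ∷ʳ⁺ (All.map (λ dz eq → shallower dz dx (sym eq)) shallow) x≢y
                   ∷ AllPairs-∷ʳ (parent x ∷ a ∷ b ∷ rest) distinct (All.map (λ dz → shallower dz dy) shallow)
        ; ends = last-∷ʳ b rest y
        ; shallow = ≤-reflexive dx ∷ ∷ʳ⁺ (All.map m≤n⇒m≤1+n shallow) (≤-reflexive dy) }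
        where open LevelPath P

    no-level-edge : ∀ a b → Edge a b → depth a ≢ depth b
    no-level-edge a b ab e with a ≟ b
    ... | yes refl = R-irrefl a ab
    ... | no a≢b = R-acyclic (cycle-from-path a P.a P.b P.rest P.distinct P.linked
                                (subst (λ w → Edge w a) (sym P.ends) (R-sym a b ab)))
      where module P = LevelPath (level-path (depth a) a b refl (sym e) a≢b)

    edge-to-parent : ∀ a b → Edge a b → suc (depth a) ≡ depth b → a ≡ parent b
    edge-to-parent a b ab e with a ≟ parent b
    ... | yes p = p
    ... | no a≢pb = ⊥-elim (R-acyclic (cycle-from-path a P.a P.b (P.rest ∷ʳ b)
            (AllPairs-∷ʳ (a ∷ P.a ∷ P.b ∷ P.rest) P.distinct (All.map (λ dz → shallower dz (sym e)) P.shallow))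
            (Linked-∷ʳ (P.a ∷ P.b ∷ P.rest) P.linked (subst (λ w → Edge w b) (sym P.ends) (parent-edge (sym e))))
            (subst (λ w → Edge w a) (sym (last-∷ʳ P.b P.rest b)) (R-sym a b ab))))
      where module P = LevelPath (level-path (depth a) a (parent b) refl (depth-parent (sym e)) a≢pb)

    edge-parent : ∀ a b → Edge a b →
      (a ≡ parent b × suc (depth a) ≡ depth b) ⊎ (b ≡ parent a × suc (depth b) ≡ depth a)
    edge-parent a b ab with <-cmp (depth a) (depth b)
    ... | tri≈ _ e _ = ⊥-elim (no-level-edge a b ab e)
    ... | tri< lt _ _ = inj₁ (edge-to-parent a b ab e , e)
      where e = ≤-antisym lt (depth-edge a b ab)
    ... | tri> _ _ gt = inj₂ (edge-to-parent b a ba e , e)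
      where
      ba = R-sym a b ab
      e = ≤-antisym gt (depth-edge b a ba)

    parent^ : ℕ → Fin m → Fin m
    parent^ zero x = x
    parent^ (suc k) x = parent^ k (parent x)

    parent^-suc : ∀ k x → parent^ (suc k) x ≡ parent (parent^ k x)
    parent^-suc zero x = refl
    parent^-suc (suc k) x = parent^-suc k (parent x)

    depth-parent^ : ∀ k x → depth (parent^ k x) ≡ depth x ∸ k
    depth-parent^ zero x = refl
    depth-parent^ (suc k) x =
      trans (depth-parent^ k (parent x)) (trans (cong (_∸ k) (depth-parent-∸ x)) (∸-+-assoc (depth x) 1 k))

    Ancestor : Fin m → Fin m → Set
    Ancestor t s = Σ ℕ λ k → depth t + k ≡ depth s × parent^ k s ≡ t

    ancestor? : ∀ t s → Dec (Ancestor t s)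
    ancestor? t s with depth t ≤? depth s
    ... | no t≰s = no λ (k , e , _) → t≰s (subst (depth t ≤_) e (m≤m+n (depth t) k))
    ... | yes t≤s with parent^ (depth s ∸ depth t) s ≟ t
    ...   | yes up = yes (depth s ∸ depth t , m+[n∸m]≡n t≤s , up)
    ...   | no ¬up = no λ (k , e , up) →
              ¬up (subst (λ j → parent^ j s ≡ t) (sym (trans (cong (_∸ depth t) (sym e)) (m+n∸m≡n (depth t) k))) up)

    root-ancestor : ∀ s → Ancestor root s
    root-ancestor s = depth s , cong (_+ depth s) depth-root ,
      depth≡0⇒root (trans (depth-parent^ (depth s) s) (n∸n≡0 (depth s)))

    ancestor-up : ∀ {c a} → Ancestor c a → a ≢ c → Ancestor c (parent a)
    ancestor-up (zero , _ , up) a≢c = ⊥-elim (a≢c up)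
    ancestor-up {c} {a} (suc k , e , up) _ = k , sym (depth-parent (trans (sym e) (+-suc (depth c) k))) , up

    ancestor-down : ∀ {c a b} → a ≡ parent b → suc (depth a) ≡ depth b → Ancestor c a → Ancestor c b
    ancestor-down {c} a≡pb e (k , e′ , up) =
      suc k , trans (+-suc (depth c) k) (trans (cong suc e′) e) , trans (cong (parent^ k) (sym a≡pb)) up

    ancestor-parent : ∀ {c s e} → Ancestor c s → depth c ≡ suc e → Ancestor (parent c) s
    ancestor-parent {c} {s} (k , e′ , up) dc =
      suc k , trans (+-suc (depth (parent c)) k) (trans (cong (λ d → suc d + k) (depth-parent dc)) (trans (cong (_+ k) (sym dc)) e′)) ,
      trans (parent^-suc k s) (cong parent up)

    ancestor-child : ∀ {t s} → Ancestor t s → s ≢ t →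
      Σ (Fin m) λ c → parent c ≡ t × suc (depth t) ≡ depth c × Ancestor c s
    ancestor-child (zero , _ , up) s≢t = ⊥-elim (s≢t up)
    ancestor-child {t} {s} (suc k , e , up) _ =
      parent^ k s , trans (sym (parent^-suc k s)) up , sym dc , k , trans (cong (_+ k) dc) e′ , refl
      where
      e′ : suc (depth t) + k ≡ depth s
      e′ = trans (sym (+-suc (depth t) k)) e
      dc : depth (parent^ k s) ≡ suc (depth t)
      dc = trans (depth-parent^ k s) (trans (cong (_∸ k) (sym e′)) (m+n∸n≡m (suc (depth t)) k))

    ancestor-unique : ∀ {c c′ s} → Ancestor c s → Ancestor c′ s → depth c ≡ depth c′ → c ≡ c′
    ancestor-unique {c} {s = s} (k , e , up) (k′ , e′ , up′) dd =
      trans (sym up) (trans (cong (λ j → parent^ j s) (+-cancelˡ-≡ (depth c) k k′ (trans e (sym (trans (cong (_+ k′) dd) e′))))) up′)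

    walk-exit : ∀ {P : Fin m → Set} {s s′} → WalkIn Edge P s s′ →
      ∀ c → Ancestor c s → ¬ Ancestor c s′ → P c × P (parent c)
    walk-exit (here _) c cs ¬cs′ = ⊥-elim (¬cs′ cs)
    walk-exit {P} (step {s} {y} ps sy w) c cs ¬cs′ with ancestor? c y
    ... | yes cy = walk-exit w c cy ¬cs′
    ... | no ¬cy with edge-parent s y sy
    ...   | inj₁ (s≡py , e) = ⊥-elim (¬cy (ancestor-down s≡py e cs))
    ...   | inj₂ (y≡ps , _) with s ≟ c
    ...     | yes refl = ps , subst P y≡ps (walk-head w)
      where
      walk-head : ∀ {x z} → WalkIn Edge P x z → P x
      walk-head (here p) = p
      walk-head (step p _ _) = p
    ...     | no s≢c = ⊥-elim (¬cy (subst (Ancestor c) (sym y≡ps) (ancestor-up cs s≢c)))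

module DecompositionSkeleton where

  open import Data.Nat.Base using (ℕ)
  open import Data.Bool.Base using (Bool; false; _∧_; _∨_; T)
  open import Data.Bool.Properties using (T?; T-irrelevant)
  open import Data.Fin.Base using (Fin)
  open import Data.Fin.Properties using (_≟_)
  open import Data.Fin.Subset using (_∈_)
  open import Data.Vec.Base using (lookup)
  open import Data.Product.Base using (_,_)
  open import Data.Sum.Base using (inj₁; inj₂)
  open import Data.Empty using (⊥-elim)
  open import Data.Unit.Base using (⊤)
  open import Relation.Nullary using (¬_; yes; no; does)
  open import Relation.Binary.PropositionalEquality using (refl)
  open import Defs hiding (sym; m)
  open Counting

  -- The tree of a decomposition is only a Set-valued relation.  Its skeleton keeps the tree
  -- edges traversed by the walks from the root and by the subtree walks: it is decidable,
  -- still acyclic, and still carries all of those walks.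
  module Skeleton {n : ℕ} {G : Graph n} {k : ℕ} (TD : TreeDecomposition G k)
                  (root : Fin (TreeDecomposition.m TD)) where

    open TreeDecomposition TD renaming (T to Tree)

    inBag : Fin n → Fin m → Bool
    inBag v s = lookup (bag s) v

    uses : ∀ {P : Fin m → Set} {x y} → Fin m → Fin m → WalkIn Tree P x y → Bool
    uses a b (here _) = false
    uses a b (step {x} {y} _ _ w) = (does (a ≟ x) ∧ does (b ≟ y)) ∨ uses a b w

    uses-sound : ∀ {P : Fin m → Set} {x y} a b (w : WalkIn Tree P x y) → T (uses a b w) → Tree a b
    uses-sound a b (step {x} {y} _ xy w) h with T-∨-elim (does (a ≟ x) ∧ does (b ≟ y)) _ h
    ... | inj₂ later = uses-sound a b w later
    ... | inj₁ now with a ≟ x | b ≟ y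
    ...   | yes refl | yes refl = xy
    ...   | yes _ | no _ = ⊥-elim now
    ...   | no _ | _ = ⊥-elim now

    subtree-uses : Fin m → Fin m → Fin n → Fin m → Fin m → Bool
    subtree-uses a b v s t with T? (inBag v s) | T? (inBag v t)
    ... | yes vs | yes vt = uses a b (subtree v s t (T⇒∈ vs) (T⇒∈ vt))
    ... | _ | _ = false

    subtree-uses-sound : ∀ a b v s t → T (subtree-uses a b v s t) → Tree a b
    subtree-uses-sound a b v s t h with T? (inBag v s) | T? (inBag v t)
    ... | yes vs | yes vt = uses-sound a b (subtree v s t (T⇒∈ vs) (T⇒∈ vt)) h
    ... | yes _ | no _ = ⊥-elim h
    ... | no _ | _ = ⊥-elim h

    subtree-uses-complete : ∀ a b v s t (vs : T (inBag v s)) (vt : T (inBag v t)) →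
      T (uses a b (subtree v s t (T⇒∈ vs) (T⇒∈ vt))) → T (subtree-uses a b v s t)
    subtree-uses-complete a b v s t vs vt h with T? (inBag v s) | T? (inBag v t)
    ... | yes vs′ | yes vt′ rewrite T-irrelevant vs vs′ | T-irrelevant vt vt′ = h
    ... | yes _ | no ¬vt = ⊥-elim (¬vt vt)
    ... | no ¬vs | _ = ⊥-elim (¬vs vs)

    opaque
      directed : Fin m → Fin m → Bool
      directed a b = any (λ x → uses a b (T-conn root x))
                   ∨ any (λ v → any (λ s → any (λ t → subtree-uses a b v s t)))

      skeleton : Fin m → Fin m → Bool
      skeleton a b = directed a b ∨ directed b a

      directed-sound : ∀ a b → T (directed a b) → Tree a b
      directed-sound a b h with T-∨-elim (any (λ x → uses a b (T-conn root x))) _ h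
      ... | inj₁ h₁ with any-elim _ h₁
      ...   | x , hx = uses-sound a b (T-conn root x) hx
      directed-sound a b h | inj₂ h₂ with any-elim _ h₂
      ... | v , hv with any-elim _ hv
      ...   | s , hs with any-elim _ hs
      ...     | t , ht = subtree-uses-sound a b v s t ht

      skeleton-sound : ∀ a b → T (skeleton a b) → Tree a b
      skeleton-sound a b h with T-∨-elim (directed a b) _ h
      ... | inj₁ ab = directed-sound a b ab
      ... | inj₂ ba = T-sym b a (directed-sound b a ba)

      skeleton-sym : ∀ a b → T (skeleton a b) → T (skeleton b a)
      skeleton-sym a b h with T-∨-elim (directed a b) _ h
      ... | inj₁ ab = T-∨-injʳ (directed b a) _ ab
      ... | inj₂ ba = T-∨-injˡ (directed b a) _ ba

      skeleton-walk : ∀ {P : Fin m → Set} {x y} (w : WalkIn Tree P x y) →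
        (∀ a b → T (uses a b w) → T (skeleton a b)) → WalkIn (λ a b → T (skeleton a b)) P x y
      skeleton-walk (here p) _ = here p
      skeleton-walk (step {x} {y} p _ w) used =
        step p (used x y (T-∨-injˡ _ _ (T-∧-intro (does-complete (x ≟ x) refl) (does-complete (y ≟ y) refl))))
               (skeleton-walk w λ a b h → used a b (T-∨-injʳ (does (a ≟ x) ∧ does (b ≟ y)) _ h))

      skeleton-connected : ∀ x → WalkIn (λ a b → T (skeleton a b)) (λ _ → ⊤) root x
      skeleton-connected x = skeleton-walk (T-conn root x)
        λ a b h → T-∨-injˡ (directed a b) _ (T-∨-injˡ _ _ (any-intro _ x h))

      skeleton-subtree : ∀ v s t → v ∈ bag s → v ∈ bag t → WalkIn (λ a b → T (skeleton a b)) (λ q → v ∈ bag q) s t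
      skeleton-subtree v s t vs vt = skeleton-walk (subtree v s t (T⇒∈ (∈⇒T vs)) (T⇒∈ (∈⇒T vt)))
        λ a b h → T-∨-injˡ (directed a b) _ (T-∨-injʳ _ _
          (any-intro _ v (any-intro _ s (any-intro _ t (subtree-uses-complete a b v s t (∈⇒T vs) (∈⇒T vt) h)))))

    skeleton-irrefl : ∀ a → ¬ T (skeleton a a)
    skeleton-irrefl a h = T-irrefl a (skeleton-sound a a h)

    skeleton-acyclic : ¬ HasCycle (λ a b → T (skeleton a b))
    skeleton-acyclic (l , c , c-inj , path , closing) =
      T-acyc (l , c , c-inj , (λ i → skeleton-sound _ _ (path i)) , skeleton-sound _ _ closing)

module Separation where

  open import Data.Nat.Base using (ℕ; zero; suc; _+_; _*_; _≤_; _<_; z≤n)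
  open import Data.Nat using (_<?_)
  open import Data.Nat.Properties hiding (_≟_)
  import Data.Nat.Properties as ℕ
  open import Data.Bool.Base using (Bool; true; _∧_; not; T)
  open import Data.Bool.Properties using (T?)
  open import Data.Fin.Base using (Fin; toℕ)
  open import Data.Fin.Properties using (_≟_; toℕ-injective; toℕ<n; any?)
  open import Data.Product.Base using (Σ; _×_; _,_; proj₁; proj₂)
  open import Data.Empty using (⊥-elim)
  open import Function.Base using (_∘_)
  open import Relation.Nullary using (¬_; Dec; yes; no; does)
  open import Relation.Nullary.Decidable using (_×-dec_)
  open import Relation.Binary.PropositionalEquality using (_≡_; refl; sym; trans; cong; subst)
  open import Defs hiding (sym; m; f)
  open Counting
  open RootedTrees
  open DecompositionSkeleton

  record BalancedSeparation {n : ℕ} (G : Graph n) (k : ℕ) (U S : Fin n → Bool) : Set where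
    field
      X : Fin n → Bool
      component : Fin n → ℕ
      X⊆U : ∀ v → T (X v) → T (U v)
      X-size : count X ≤ suc k
      component-edge : ∀ u v → T (U u) → T (U v) → ¬ T (X u) → ¬ T (X v) →
                       adj G u v ≡ true → component u ≡ component v
      components : ℕ
      component-bound : ∀ v → component v ≤ components
      balanced : ∀ j → 2 * count (λ v → S v ∧ not (X v) ∧ does (component v ℕ.≟ j)) ≤ count S

  module _ {n : ℕ} {G : Graph n} {k : ℕ} (TD : TreeDecomposition G k)
           (U S : Fin n → Bool) (S⊆U : ∀ v → T (S v) → T (U v)) (v₀ : Fin n) (v₀∈S : T (S v₀)) where

    open TreeDecomposition TD renaming (T to Tree)
    open Skeleton TD (proj₁ (cover-v v₀))
    r : Fin m
    r = proj₁ (cover-v v₀)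

    open BreadthFirst skeleton skeleton-sym skeleton-irrefl r skeleton-connected skeleton-acyclic

    below : Fin m → Fin n → Bool
    below t v = any (λ s → does (ancestor? t s) ∧ inBag v s)

    below-intro : ∀ t s v → Ancestor t s → T (inBag v s) → T (below t v)
    below-intro t s v ts vs = any-intro _ s (T-∧-intro (does-complete (ancestor? t s) ts) vs)

    below-elim : ∀ t v → T (below t v) → Σ (Fin m) λ s → Ancestor t s × T (inBag v s)
    below-elim t v h with any-elim _ h
    ... | s , hs = s , does-sound (ancestor? t s) (T-∧-proj₁ (does (ancestor? t s)) _ hs) ,
                   T-∧-proj₂ (does (ancestor? t s)) _ hs

    weight : Fin m → ℕ
    weight t = count (λ v → S v ∧ below t v)

    Heavy : Fin m → Set
    Heavy t = count S < 2 * weight t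

    root-heavy : Heavy r
    root-heavy = subst (λ w → count S < 2 * w) (sym weight-r) (subst (count S <_) (cong (count S +_) (sym (+-identityʳ (count S)))) (m<m+n (count S) (count-pos S v₀ v₀∈S)))
      where
      weight-r : weight r ≡ count S
      weight-r = ≤-antisym (count-mono λ v h → T-∧-proj₁ (S v) _ h)
        (count-mono λ v h → T-∧-intro h (below-intro r (proj₁ (cover-v v)) v (root-ancestor _) (∈⇒T (proj₂ (cover-v v)))))

    opaque
      deepest-heavy : Σ (Fin m) λ t → Heavy t × (∀ t′ → Heavy t′ → depth t′ ≤ depth t)
      deepest-heavy = argmax (λ t → count S <? 2 * weight t) depth (r , root-heavy)

    t* : Fin m
    t* = proj₁ deepest-heavy

    Child : Fin m → Set
    Child c = parent c ≡ t* × suc (depth t*) ≡ depth c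

    child? : ∀ c → Dec (Child c)
    child? c with parent c ≟ t* | suc (depth t*) ℕ.≟ depth c
    ... | yes p | yes d = yes (p , d)
    ... | no ¬p | _ = no (¬p ∘ proj₁)
    ... | _ | no ¬d = no (¬d ∘ proj₂)

    child-light : ∀ c → Child c → 2 * weight c ≤ count S
    child-light c (_ , dc) = ≮⇒≥ λ heavy → <-irrefl refl (≤-trans (≤-reflexive dc) (proj₂ (proj₂ deepest-heavy) c heavy))

    X : Fin n → Bool
    X v = U v ∧ inBag v t*

    ¬X⇒∉t* : ∀ {v} → T (U v) → ¬ T (X v) → ¬ T (inBag v t*)
    ¬X⇒∉t* uv ¬xv vt* = ¬xv (T-∧-intro uv vt*)

    ∉t*⇒same-child : ∀ {c c′ v} → Child c → Child c′ → T (below c v) → T (below c′ v) → ¬ T (inBag v t*) → c ≡ c′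
    ∉t*⇒same-child {c} {c′} {v} (pc , dc) (_ , dc′) h h′ v∉t* with c ≟ c′
    ... | yes same = same
    ... | no differ with below-elim c v h | below-elim c′ v h′
    ...   | s , cs , vs | s′ , c′s′ , vs′ =
            ⊥-elim (v∉t* (subst (λ z → T (inBag v z)) pc (∈⇒T (proj₂ (walk-exit (skeleton-subtree v s s′ (T⇒∈ vs) (T⇒∈ vs′)) c cs ¬cs′)))))
      where
      ¬cs′ : ¬ Ancestor c s′
      ¬cs′ cs′ = differ (ancestor-unique cs′ c′s′ (trans (sym dc) dc′))

    leaving-below-t* : ∀ {v s} → T (below t* v) → T (inBag v s) → ¬ Ancestor t* s → T (inBag v t*)
    leaving-below-t* {v} {s} h vs ¬t*s with below-elim t* v h
    ... | s′ , t*s′ , vs′ = ∈⇒T (proj₁ (walk-exit (skeleton-subtree v s′ s (T⇒∈ vs′) (T⇒∈ vs)) t* t*s′ ¬t*s))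

    child-below : ∀ {c v} → Child c → T (below c v) → T (below t* v)
    child-below {c} {v} (pc , dc) h with below-elim c v h
    ... | s , cs , vs = below-intro t* s v (subst (λ z → Ancestor z s) pc (ancestor-parent cs (sym dc))) vs

    below-t*⇒below-child : ∀ {v} → ¬ T (X v) → T (U v) → T (below t* v) → Σ (Fin m) λ c → Child c × T (below c v)
    below-t*⇒below-child {v} ¬xv uv h with below-elim t* v h
    ... | s , t*s , vs with s ≟ t*
    ...   | yes refl = ⊥-elim (¬xv (T-∧-intro uv vs))
    ...   | no s≢t* with ancestor-child t*s s≢t*
    ...     | c , pc , dc , cs = c , (pc , dc) , below-intro c s v cs vs

    -- Component 1 + c collects the vertices below the child c of t*, component 0 those not below t*.
    component : Fin n → ℕ
    component v with any? (λ c → child? c ×-dec T? (below c v))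
    ... | yes (c , _) = suc (toℕ c)
    ... | no _ = 0

    component-child : ∀ {c v} → Child c → T (below c v) → ¬ T (inBag v t*) → component v ≡ suc (toℕ c)
    component-child {c} {v} cc h v∉t* with any? (λ c → child? c ×-dec T? (below c v))
    ... | yes (c′ , cc′ , h′) = cong (suc ∘ toℕ) (∉t*⇒same-child cc′ cc h′ h v∉t*)
    ... | no none = ⊥-elim (none (c , cc , h))

    component-outside : ∀ {v} → ¬ T (below t* v) → component v ≡ 0
    component-outside {v} ¬below with any? (λ c → child? c ×-dec T? (below c v))
    ... | yes (c , cc , h) = ⊥-elim (¬below (child-below cc h))
    ... | no _ = refl

    component-suc : ∀ {v j} → component v ≡ suc j → Σ (Fin m) λ c → Child c × toℕ c ≡ j × T (below c v)
    component-suc {v} e with any? (λ c → child? c ×-dec T? (below c v))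
    ... | yes (c , cc , h) = c , cc , suc-injective e , h

    component≤m : ∀ v → component v ≤ m
    component≤m v with any? (λ c → child? c ×-dec T? (below c v))
    ... | yes (c , _) = toℕ<n c
    ... | no _ = z≤n

    shared-bag-component : ∀ {u v s} → T (U u) → T (U v) → ¬ T (X u) → ¬ T (X v) →
      T (inBag u s) → T (inBag v s) → component u ≡ component v
    shared-bag-component {u} {v} {s} uu uv ¬xu ¬xv us vs with ancestor? t* s
    ... | no ¬t*s = trans (component-outside (λ h → ¬X⇒∉t* uu ¬xu (leaving-below-t* h us ¬t*s)))
                          (sym (component-outside (λ h → ¬X⇒∉t* uv ¬xv (leaving-below-t* h vs ¬t*s))))
    ... | yes t*s with s ≟ t*
    ...   | yes refl = ⊥-elim (¬xu (T-∧-intro uu us))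
    ...   | no s≢t* with ancestor-child t*s s≢t*
    ...     | c , pc , dc , cs = trans (component-child (pc , dc) (below-intro c s u cs us) (¬X⇒∉t* uu ¬xu))
                                       (sym (component-child (pc , dc) (below-intro c s v cs vs) (¬X⇒∉t* uv ¬xv)))

    piece : ℕ → Fin n → Bool
    piece j v = S v ∧ not (X v) ∧ does (component v ℕ.≟ j)

    piece-elim : ∀ j v → T (piece j v) → T (S v) × ¬ T (X v) × component v ≡ j
    piece-elim j v h =
      T-∧-proj₁ (S v) _ h ,
      T-not-elim (X v) (T-∧-proj₁ (not (X v)) _ (T-∧-proj₂ (S v) _ h)) ,
      does-sound (component v ℕ.≟ j) (T-∧-proj₂ (not (X v)) _ (T-∧-proj₂ (S v) _ h))

    outer-piece-balanced : 2 * count (piece 0) ≤ count S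
    outer-piece-balanced = ≤-trans (*-monoʳ-≤ 2 piece⊆outside) (subst (2 * count outside ≤_) (sym split) (light-rest (weight t*) (count outside) heavy))
      where
      outside : Fin n → Bool
      outside v = S v ∧ not (below t* v)
      piece⊆outside : count (piece 0) ≤ count outside
      piece⊆outside = count-mono λ v h → let (sv , ¬xv , c0) = piece-elim 0 v h in
        T-∧-intro sv (T-not-intro (below t* v) λ hb →
          let (c , cc , hc) = below-t*⇒below-child ¬xv (S⊆U v sv) hb in
          1+n≢0 (trans (sym (component-child cc hc (¬X⇒∉t* (S⊆U v sv) ¬xv))) c0))
      split : count S ≡ weight t* + count outside
      split = count-split S (below t*)
      heavy : weight t* + count outside < 2 * weight t*
      heavy = subst (_< 2 * weight t*) split (proj₁ (proj₂ deepest-heavy))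
      light-rest : ∀ a b → a + b < 2 * a → 2 * b ≤ a + b
      light-rest a b lt = subst (_≤ a + b) (cong (b +_) (sym (+-identityʳ b))) (+-monoˡ-≤ b (<⇒≤ b<a))
        where
        b<a : b < a
        b<a = +-cancelˡ-< a b a (subst (a + b <_) (cong (a +_) (+-identityʳ a)) lt)

    inner-piece-balanced : ∀ j → 2 * count (piece (suc j)) ≤ count S
    inner-piece-balanced j with any? (λ c → child? c ×-dec (toℕ c ℕ.≟ j))
    ... | yes (c , cc , c≡j) = ≤-trans (*-monoʳ-≤ 2 (count-mono piece⊆c)) (child-light c cc)
      where
      piece⊆c : ∀ v → T (piece (suc j) v) → T (S v ∧ below c v)
      piece⊆c v h with piece-elim (suc j) v h
      ... | sv , _ , cj with component-suc cj
      ...   | c′ , _ , c′≡j , hc′ = T-∧-intro sv (subst (λ z → T (below z v)) (toℕ-injective (trans c′≡j (sym c≡j))) hc′)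
    ... | no none = subst (λ z → 2 * z ≤ count S) (sym (n≤0⇒n≡0 empty)) z≤n
      where
      empty : count (piece (suc j)) ≤ 0
      empty = subst (count (piece (suc j)) ≤_) (count-false {n}) (count-mono λ v h →
        let (_ , _ , cj) = piece-elim (suc j) v h
            (c , cc , c≡j , _) = component-suc cj
        in none (c , cc , c≡j))

    balanced : ∀ j → 2 * count (piece j) ≤ count S
    balanced zero = outer-piece-balanced
    balanced (suc j) = inner-piece-balanced j

    opaque
      separation : BalancedSeparation G k U S
      separation = record
        { X = X
        ; component = component
        ; X⊆U = λ v h → T-∧-proj₁ (U v) _ h
        ; X-size = ≤-trans (count-mono λ v h → T-∧-proj₂ (U v) _ h) (≤-trans (≤-reflexive (sym (∣∣≡count (bag t*)))) (width t*))
        ; component-edge = λ u v uu uv ¬xu ¬xv e → let (s , us , vs) = cover-e u v e in shared-bag-component uu uv ¬xu ¬xv (∈⇒T us) (∈⇒T vs)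
        ; components = m
        ; component-bound = component≤m
        ; balanced = balanced
        }

module RootedPartitions where

  open import Data.Nat.Base using (ℕ; zero; suc; _+_; _≤_; s≤s)
  open import Data.Nat.Properties hiding (_≟_)
  open import Data.Bool.Base using (Bool; true; false; _∧_; _∨_; T; if_then_else_)
  open import Data.Bool.Properties using (T?)
  open import Data.Fin.Base using (Fin; zero; suc; toℕ; inject₁; fromℕ)
  open import Data.Fin.Properties using (_≟_; toℕ-inject₁)
  open import Data.Fin.Relation.Unary.Top using (view; ‵fromℕ; ‵inj₁)
  open import Data.Product.Base using (_×_; _,_; proj₁; proj₂)
  open import Data.Sum.Base using (_⊎_; inj₁; inj₂)
  open import Data.Empty using (⊥; ⊥-elim)
  open import Data.Unit.Base using (tt)
  open import Function.Base using (_∘_)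
  open import Relation.Nullary using (¬_; yes; no; does)
  open import Relation.Nullary.Decidable using (toSum)
  open import Relation.Binary.PropositionalEquality using (_≡_; _≢_; refl; sym; trans; cong; subst)
  open import Defs hiding (sym; m; f)
  open Counting

  Parent : ∀ {m} (up : Fin m → Fin m) (depth : Fin m → ℕ) (a b : Fin m) → Set
  Parent up depth a b = b ≡ up a × depth a ≡ suc (depth b)

  Parent-cong : ∀ {m} (up : Fin m → Fin m) depth {a a′ b b′} → a′ ≡ a → b′ ≡ b → Parent up depth a b → Parent up depth a′ b′
  Parent-cong up depth refl refl p = p

  module _ {m : ℕ} (R : Fin m → Fin m → Set) (up : Fin m → Fin m) (depth : Fin m → ℕ)
    (parent-child : ∀ a b → R a b → Parent up depth a b ⊎ Parent up depth b a) where

    private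
      deeper-right : ∀ {a b} → depth a ≤ depth b → R a b → a ≡ up b
      deeper-right {a} {b} le ab with parent-child a b ab
      ... | inj₁ (_ , e) = ⊥-elim (<-irrefl refl (≤-trans (≤-reflexive (sym e)) le))
      ... | inj₂ (e , _) = e

      deeper-left : ∀ {a b} → depth b ≤ depth a → R a b → b ≡ up a
      deeper-left {a} {b} le ab with parent-child a b ab
      ... | inj₁ (e , _) = e
      ... | inj₂ (_ , e) = ⊥-elim (<-irrefl refl (≤-trans (≤-reflexive (sym e)) le))

    parent-child-acyclic : ¬ HasCycle R
    parent-child-acyclic (l , c , c-inj , steps , closing)
      with argmax {3 + l} (λ _ → yes tt) (depth ∘ c) (zero , tt)
    ... | zero , _ , top = zero≢last (c-inj (trans (deeper-left (top _ tt) (steps zero)) (sym (deeper-right (top _ tt) closing))))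
      where
      zero≢last : suc zero ≢ fromℕ (2 + l)
      zero≢last ()
    ... | suc j , _ , top with view j
    ...   | ‵fromℕ = previous≢zero (c-inj (trans (deeper-right (top _ tt) (steps _)) (sym (deeper-left (top _ tt) closing))))
      where
      previous≢zero : inject₁ (fromℕ (suc l)) ≢ zero
      previous≢zero ()
    ...   | ‵inj₁ {i = j′} _ = previous≢next (c-inj (trans (deeper-right (top _ tt) (steps _)) (sym (deeper-left (top _ tt) (steps (suc j′))))))
      where
      previous≢next : inject₁ (inject₁ j′) ≢ suc (suc j′)
      previous≢next e = <-irrefl (trans (sym (toℕ-inject₁ j′)) (trans (sym (toℕ-inject₁ (inject₁ j′))) (cong toℕ e))) (s≤s (n≤1+n (toℕ j′)))

  module Partitions {n : ℕ} (G : Graph n) where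

    data Link (label up : Fin n → Fin n) (depth : Fin n → ℕ) (u v : Fin n) : Set where
      same-bag : label u ≡ label v → Link label up depth u v
      to-parent : Parent up depth (label u) (label v) → Link label up depth u v
      from-parent : Parent up depth (label v) (label u) → Link label up depth u v

    Link-sym : ∀ {label up depth u v} → Link label up depth u v → Link label up depth v u
    Link-sym (same-bag e) = same-bag (sym e)
    Link-sym (to-parent p) = from-parent p
    Link-sym (from-parent p) = to-parent p

    Link-map : ∀ {label up depth label′ up′ depth′} (g : Fin n → Fin n) {Good : Fin n → Set} {u v} →
      Good (label u) → Good (label v) → label′ u ≡ g (label u) → label′ v ≡ g (label v) →
      (∀ {a b} → Good a → Good b → Parent up depth a b → Parent up′ depth′ (g a) (g b)) →
      Link label up depth u v → Link label′ up′ depth′ u v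
    Link-map {up′ = up′} {depth′ = depth′} g gu gv eu ev lift (same-bag e) = same-bag (trans eu (trans (cong g e) (sym ev)))
    Link-map {up′ = up′} {depth′ = depth′} g gu gv eu ev lift (to-parent p) = to-parent (Parent-cong up′ depth′ eu ev (lift gu gv p))
    Link-map {up′ = up′} {depth′ = depth′} g gu gv eu ev lift (from-parent p) = from-parent (Parent-cong up′ depth′ ev eu (lift gv gu p))

    -- A bag is named by a representative vertex, label v being the bag of v.
    record RootedPartition (U : Fin n → Bool) : Set where
      field
        label : Fin n → Fin n
        up : Fin n → Fin n
        depth : Fin n → ℕ
        root : Fin n
        link : ∀ u v → T (U u) → T (U v) → adj G u v ≡ true → Link label up depth u v
        closed : ∀ v → T (U v) → T (U (label v)) × label (label v) ≡ label v
        depth-root : depth root ≡ 0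

    bagSize : ∀ {U} → RootedPartition U → Fin n → ℕ
    bagSize {U} P l = count (λ v → U v ∧ does (RootedPartition.label P v ≟ l))

    toTreePartition : RootedPartition (λ _ → true) → TreePartition G
    toTreePartition P = record { m = n ; f = label ; forest = parent-child-acyclic (QuotAdj G label) up depth parent-child }
      where
      open RootedPartition P
      parent-child : ∀ a b → QuotAdj G label a b → Parent up depth a b ⊎ Parent up depth b a
      parent-child a b (a≢b , u , v , uv , refl , refl) with link u v tt tt uv
      ... | same-bag e = ⊥-elim (a≢b e)
      ... | to-parent p = inj₁ p
      ... | from-parent p = inj₂ p

    singleBag : (U : Fin n → Bool) (l : Fin n) → (∀ v → T (U v) → T (U l)) → RootedPartition U
    singleBag U l l∈U = record
      { label = λ _ → l ; up = λ x → x ; depth = λ _ → 0 ; root = l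
      ; link = λ _ _ _ _ _ → same-bag refl
      ; closed = λ v v∈U → l∈U v v∈U , refl
      ; depth-root = refl }

    module Attach (S U′ : Fin n → Bool) (disjoint : ∀ v → T (S v) → ¬ T (U′ v))
                  (s₀ : Fin n) (s₀∈S : T (S s₀)) (P : RootedPartition U′)
                  (S-to-root : ∀ u v → T (S u) → T (U′ v) → adj G u v ≡ true → RootedPartition.label P v ≡ RootedPartition.root P) where

      open RootedPartition P renaming (label to label′; up to up′; depth to depth′; root to root′; link to link′; closed to closed′; depth-root to depth-root′)

      U : Fin n → Bool
      U v = S v ∨ U′ v

      label : Fin n → Fin n
      label v = if S v then s₀ else label′ v

      up : Fin n → Fin n
      up l = if does (l ≟ root′) then s₀ else up′ l

      depth : Fin n → ℕ
      depth l = if S l then 0 else suc (depth′ l)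

      label-S : ∀ {v} → T (S v) → label v ≡ s₀
      label-S {v} h with S v
      ... | true = refl

      label-U′ : ∀ {v} → T (U′ v) → label v ≡ label′ v
      label-U′ {v} h with S v in eq
      ... | true = ⊥-elim (disjoint v (subst T (sym eq) tt) h)
      ... | false = refl

      depth-U′ : ∀ {v} → T (U′ v) → depth v ≡ suc (depth′ v)
      depth-U′ {v} h with S v in eq
      ... | true = ⊥-elim (disjoint v (subst T (sym eq) tt) h)
      ... | false = refl

      up-root′ : up root′ ≡ s₀
      up-root′ with root′ ≟ root′
      ... | yes _ = refl
      ... | no ne = ⊥-elim (ne refl)

      up-other : ∀ {l} → l ≢ root′ → up l ≡ up′ l
      up-other {l} ne with l ≟ root′
      ... | yes e = ⊥-elim (ne e)
      ... | no _ = refl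

      depth-S : ∀ {v} → T (S v) → depth v ≡ 0
      depth-S {v} h with S v
      ... | true = refl

      depth-s₀ : depth s₀ ≡ 0
      depth-s₀ = depth-S s₀∈S

      lift : ∀ {a b} → T (U′ a) × label′ a ≡ a → T (U′ b) × label′ b ≡ b → Parent up′ depth′ a b → Parent up depth a b
      lift {a} {b} (a∈U′ , _) (b∈U′ , _) (b≡up′a , da) =
        trans b≡up′a (sym (up-other a≢root′)) , trans (depth-U′ a∈U′) (trans (cong suc da) (cong suc (sym (depth-U′ b∈U′))))
        where
        a≢root′ : a ≢ root′
        a≢root′ refl = 0≢1+n (trans (sym depth-root′) da)

      link-S-U′ : ∀ {u v} → T (S u) → T (U′ v) → adj G u v ≡ true → Link label up depth u v
      link-S-U′ {u} {v} u∈S v∈U′ uv = from-parent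
        (trans (label-S u∈S) (sym (trans (cong up label-v) up-root′)) ,
         trans (cong depth label-v) (trans (depth-U′ root′∈U′) (cong suc (trans depth-root′ (sym (trans (cong depth (label-S u∈S)) depth-s₀))))))
        where
        label-v : label v ≡ root′
        label-v = trans (label-U′ v∈U′) (S-to-root u v u∈S v∈U′ uv)
        root′∈U′ : T (U′ root′)
        root′∈U′ = subst (T ∘ U′) (S-to-root u v u∈S v∈U′ uv) (proj₁ (closed′ v v∈U′))

      link : ∀ u v → T (U u) → T (U v) → adj G u v ≡ true → Link label up depth u v
      link u v hu hv uv with T-∨-elim (S u) _ hu | T-∨-elim (S v) _ hv
      ... | inj₁ u∈S | inj₁ v∈S = same-bag (trans (label-S u∈S) (sym (label-S v∈S)))
      ... | inj₁ u∈S | inj₂ v∈U′ = link-S-U′ u∈S v∈U′ uv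
      ... | inj₂ u∈U′ | inj₁ v∈S = Link-sym (link-S-U′ v∈S u∈U′ (trans (Graph.sym G v u) uv))
      ... | inj₂ u∈U′ | inj₂ v∈U′ =
        Link-map (λ x → x) (closed′ u u∈U′) (closed′ v v∈U′) (label-U′ u∈U′) (label-U′ v∈U′) lift (link′ u v u∈U′ v∈U′ uv)

      closed : ∀ v → T (U v) → T (U (label v)) × label (label v) ≡ label v
      closed v h with T-∨-elim (S v) _ h
      ... | inj₁ v∈S = subst (T ∘ U) (sym (label-S v∈S)) (T-∨-injˡ _ _ s₀∈S) ,
                       trans (cong label (label-S v∈S)) (trans (label-S s₀∈S) (sym (label-S v∈S)))
      ... | inj₂ v∈U′ = subst (T ∘ U) (sym (label-U′ v∈U′)) (T-∨-injʳ (S (label′ v)) _ (proj₁ (closed′ v v∈U′))) ,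
                        trans (cong label (label-U′ v∈U′)) (trans (label-U′ (proj₁ (closed′ v v∈U′))) (trans (proj₂ (closed′ v v∈U′)) (sym (label-U′ v∈U′))))

      attached : RootedPartition U
      attached = record { label = label ; up = up ; depth = depth ; root = s₀ ; link = link ; closed = closed ; depth-root = depth-s₀ }

      attached-root-size : bagSize attached s₀ ≤ count S
      attached-root-size = count-mono λ v h → in-S v (T-∧-proj₁ _ _ h) (does-sound (label v ≟ s₀) (T-∧-proj₂ _ _ h))
        where
        in-S : ∀ v → T (U v) → label v ≡ s₀ → T (S v)
        in-S v hu e with T-∨-elim (S v) _ hu
        ... | inj₁ v∈S = v∈S
        ... | inj₂ v∈U′ = ⊥-elim (disjoint s₀ s₀∈S (subst (T ∘ U′) (trans (sym (label-U′ v∈U′)) e) (proj₁ (closed′ v v∈U′))))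

      attached-other-size : ∀ l → l ≢ s₀ → bagSize attached l ≤ bagSize P l
      attached-other-size l l≢s₀ = count-mono λ v h → in-P v (T-∧-proj₁ _ _ h) (does-sound (label v ≟ l) (T-∧-proj₂ _ _ h))
        where
        in-P : ∀ v → T (U v) → label v ≡ l → T (U′ v ∧ does (label′ v ≟ l))
        in-P v hu e with T-∨-elim (S v) _ hu
        ... | inj₁ v∈S = ⊥-elim (l≢s₀ (trans (sym e) (label-S v∈S)))
        ... | inj₂ v∈U′ = T-∧-intro v∈U′ (does-complete (label′ v ≟ l) (trans (sym (label-U′ v∈U′)) e))

    module Merge (U₁ U₂ : Fin n → Bool) (P₁ : RootedPartition U₁) (P₂ : RootedPartition U₂)
      (shared-at-roots : ∀ v → T (U₁ v) → T (U₂ v) →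
         RootedPartition.label P₁ v ≡ RootedPartition.root P₁ × RootedPartition.label P₂ v ≡ RootedPartition.root P₂)
      (root₁∈U₁ : T (U₁ (RootedPartition.root P₁)))
      (root₁-fixed : RootedPartition.label P₁ (RootedPartition.root P₁) ≡ RootedPartition.root P₁)
      (no-crossing : ∀ u v → T (U₁ u) → ¬ T (U₂ u) → T (U₂ v) → ¬ T (U₁ v) → adj G u v ≡ true → ⊥) where

      open RootedPartition P₁ renaming (label to label₁; up to up₁; depth to depth₁; root to root₁; link to link₁; closed to closed₁; depth-root to depth-root₁)
      open RootedPartition P₂ renaming (label to label₂; up to up₂; depth to depth₂; root to root₂; link to link₂; closed to closed₂; depth-root to depth-root₂)

      U : Fin n → Bool
      U v = U₁ v ∨ U₂ v

      glue : Fin n → Fin n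
      glue l = if does (l ≟ root₂) then root₁ else l

      label : Fin n → Fin n
      label v = if U₁ v then label₁ v else glue (label₂ v)

      up : Fin n → Fin n
      up l = if U₁ l then up₁ l else glue (up₂ l)

      depth : Fin n → ℕ
      depth l = if U₁ l then depth₁ l else depth₂ l

      module _ {v : Fin n} where

        label-1 : T (U₁ v) → label v ≡ label₁ v
        label-1 h with U₁ v
        ... | true = refl

        label-2 : ¬ T (U₁ v) → label v ≡ glue (label₂ v)
        label-2 h with U₁ v
        ... | true = ⊥-elim (h tt)
        ... | false = refl

        up-1 : T (U₁ v) → up v ≡ up₁ v
        up-1 h with U₁ v
        ... | true = refl

        up-2 : ¬ T (U₁ v) → up v ≡ glue (up₂ v)
        up-2 h with U₁ v
        ... | true = ⊥-elim (h tt)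
        ... | false = refl

        depth-1 : T (U₁ v) → depth v ≡ depth₁ v
        depth-1 h with U₁ v
        ... | true = refl

        depth-2 : ¬ T (U₁ v) → depth v ≡ depth₂ v
        depth-2 h with U₁ v
        ... | true = ⊥-elim (h tt)
        ... | false = refl

        U₂-of : T (U v) → ¬ T (U₁ v) → T (U₂ v)
        U₂-of h ¬v₁ with T-∨-elim (U₁ v) _ h
        ... | inj₁ v₁ = ⊥-elim (¬v₁ v₁)
        ... | inj₂ v₂ = v₂

      glue-root₂ : glue root₂ ≡ root₁
      glue-root₂ with root₂ ≟ root₂
      ... | yes _ = refl
      ... | no ne = ⊥-elim (ne refl)

      glue-other : ∀ {l} → l ≢ root₂ → glue l ≡ l
      glue-other {l} ne with l ≟ root₂
      ... | yes e = ⊥-elim (ne e)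
      ... | no _ = refl

      Closed₂ : Fin n → Set
      Closed₂ a = T (U₂ a) × label₂ a ≡ a

      non-root₂-outside-U₁ : ∀ {a} → Closed₂ a → a ≢ root₂ → ¬ T (U₁ a)
      non-root₂-outside-U₁ {a} (a₂ , fixed) a≢root₂ a₁ = a≢root₂ (trans (sym fixed) (proj₂ (shared-at-roots a a₁ a₂)))

      depth-root : depth root₁ ≡ 0
      depth-root = trans (depth-1 root₁∈U₁) depth-root₁

      depth-glue : ∀ {b} → Closed₂ b → depth (glue b) ≡ depth₂ b
      depth-glue {b} cb with toSum (b ≟ root₂)
      ... | inj₁ refl = trans (cong depth glue-root₂) (trans depth-root (sym depth-root₂))
      ... | inj₂ b≢root₂ = trans (cong depth (glue-other b≢root₂)) (depth-2 (non-root₂-outside-U₁ cb b≢root₂))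

      lift₁ : ∀ {a b} → T (U₁ a) × label₁ a ≡ a → T (U₁ b) × label₁ b ≡ b → Parent up₁ depth₁ a b → Parent up depth a b
      lift₁ (a₁ , _) (b₁ , _) (b≡up₁a , da) =
        trans b≡up₁a (sym (up-1 a₁)) , trans (depth-1 a₁) (trans da (cong suc (sym (depth-1 b₁))))

      lift₂ : ∀ {a b} → Closed₂ a → Closed₂ b → Parent up₂ depth₂ a b → Parent up depth (glue a) (glue b)
      lift₂ {a} {b} ca cb (b≡up₂a , da) =
        trans (cong glue b≡up₂a) (trans (sym (up-2 a∉U₁)) (cong up (sym glue-a))) ,
        trans (cong depth glue-a) (trans (depth-2 a∉U₁) (trans da (cong suc (sym (depth-glue cb)))))
        where
        a≢root₂ : a ≢ root₂
        a≢root₂ refl = 0≢1+n (trans (sym depth-root₂) da)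
        a∉U₁ : ¬ T (U₁ a)
        a∉U₁ = non-root₂-outside-U₁ ca a≢root₂
        glue-a : glue a ≡ a
        glue-a = glue-other a≢root₂

      label-via-2 : ∀ {v} → T (U₂ v) → label v ≡ glue (label₂ v)
      label-via-2 {v} v₂ with T? (U₁ v)
      ... | no ¬v₁ = label-2 ¬v₁
      ... | yes v₁ = trans (label-1 v₁) (trans (proj₁ (shared-at-roots v v₁ v₂))
                       (sym (trans (cong glue (proj₂ (shared-at-roots v v₁ v₂))) glue-root₂)))

      partner-in-U₂ : ∀ {u v} → T (U u) → T (U₂ v) → ¬ T (U₁ v) → adj G u v ≡ true → T (U₂ u)
      partner-in-U₂ {u} {v} hu v₂ ¬v₁ uv with T? (U₂ u)
      ... | yes u₂ = u₂
      ... | no ¬u₂ = ⊥-elim (no-crossing u v u₁ ¬u₂ v₂ ¬v₁ uv)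
        where
        u₁ : T (U₁ u)
        u₁ with T-∨-elim (U₁ u) _ hu
        ... | inj₁ h = h
        ... | inj₂ h = ⊥-elim (¬u₂ h)

      link-via-2 : ∀ {u v} → T (U₂ u) → T (U₂ v) → adj G u v ≡ true → Link label up depth u v
      link-via-2 {u} {v} u₂ v₂ uv =
        Link-map glue (closed₂ u u₂) (closed₂ v v₂) (label-via-2 u₂) (label-via-2 v₂) lift₂ (link₂ u v u₂ v₂ uv)

      link : ∀ u v → T (U u) → T (U v) → adj G u v ≡ true → Link label up depth u v
      link u v hu hv uv with T? (U₁ u) | T? (U₁ v)
      ... | yes u₁ | yes v₁ = Link-map (λ x → x) (closed₁ u u₁) (closed₁ v v₁) (label-1 u₁) (label-1 v₁) lift₁ (link₁ u v u₁ v₁ uv)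
      ... | _ | no ¬v₁ = link-via-2 (partner-in-U₂ hu (U₂-of hv ¬v₁) ¬v₁ uv) (U₂-of hv ¬v₁) uv
      ... | no ¬u₁ | _ = link-via-2 (U₂-of hu ¬u₁) (partner-in-U₂ hv (U₂-of hu ¬u₁) ¬u₁ (trans (Graph.sym G v u) uv)) uv

      label-cases : ∀ v → T (U v) →
          T (U₁ v)
        ⊎ (T (U₂ v) × label₂ v ≡ root₂ × label v ≡ root₁)
        ⊎ (T (U₂ v) × label₂ v ≢ root₂ × label v ≡ label₂ v)
      label-cases v h with T? (U₁ v)
      ... | yes v₁ = inj₁ v₁
      ... | no ¬v₁ with toSum (label₂ v ≟ root₂)
      ...   | inj₁ e = inj₂ (inj₁ (U₂-of h ¬v₁ , e , trans (label-2 ¬v₁) (trans (cong glue e) glue-root₂)))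
      ...   | inj₂ ne = inj₂ (inj₂ (U₂-of h ¬v₁ , ne , trans (label-2 ¬v₁) (glue-other ne)))

      closed : ∀ v → T (U v) → T (U (label v)) × label (label v) ≡ label v
      closed v h with label-cases v h
      ... | inj₁ v₁ = subst (T ∘ U) (sym (label-1 v₁)) (T-∨-injˡ _ _ (proj₁ (closed₁ v v₁))) ,
                      trans (cong label (label-1 v₁)) (trans (label-1 (proj₁ (closed₁ v v₁))) (trans (proj₂ (closed₁ v v₁)) (sym (label-1 v₁))))
      ... | inj₂ (inj₁ (_ , _ , lv)) = subst (T ∘ U) (sym lv) (T-∨-injˡ _ _ root₁∈U₁) ,
                                       trans (cong label lv) (trans (label-1 root₁∈U₁) (trans root₁-fixed (sym lv)))
      ... | inj₂ (inj₂ (v₂ , ne , lv)) = subst (T ∘ U) (sym lv) (T-∨-injʳ (U₁ (label₂ v)) _ (proj₁ (closed₂ v v₂))) ,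
                                         trans (cong label lv) (trans (label-2 outside) (trans (cong glue (proj₂ (closed₂ v v₂))) (trans (glue-other ne) (sym lv))))
        where
        outside : ¬ T (U₁ (label₂ v))
        outside = non-root₂-outside-U₁ (closed₂ v v₂) ne

      merged : RootedPartition U
      merged = record { label = label ; up = up ; depth = depth ; root = root₁ ; link = link ; closed = closed ; depth-root = depth-root }

      root-from-1 : ∀ {v} → T (U₁ v) → label₁ v ≡ root₁ → label v ≡ root₁
      root-from-1 v₁ e = trans (label-1 v₁) e

      root-from-2 : ∀ {v} → ¬ T (U₁ v) → label₂ v ≡ root₂ → label v ≡ root₁
      root-from-2 ¬v₁ e = trans (label-2 ¬v₁) (trans (cong glue e) glue-root₂)

      merged-root-size : bagSize merged root₁ + count (λ v → U₁ v ∧ U₂ v) ≤ bagSize P₁ root₁ + bagSize P₂ root₂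
      merged-root-size = subst (bagSize merged root₁ + count (λ v → U₁ v ∧ U₂ v) ≤_) (count-∨-∧ at-root₁ at-root₂) (+-mono-≤ root-bag shared)
        where
        at-root₁ at-root₂ : Fin n → Bool
        at-root₁ v = U₁ v ∧ does (label₁ v ≟ root₁)
        at-root₂ v = U₂ v ∧ does (label₂ v ≟ root₂)
        root-bag : bagSize merged root₁ ≤ count (λ v → at-root₁ v ∨ at-root₂ v)
        root-bag = count-mono λ v h → from-cases v (T-∧-proj₁ _ _ h) (does-sound (label v ≟ root₁) (T-∧-proj₂ _ _ h))
          where
          from-cases : ∀ v → T (U v) → label v ≡ root₁ → T (at-root₁ v ∨ at-root₂ v)
          from-cases v h e with label-cases v h
          ... | inj₁ v₁ = T-∨-injˡ (at-root₁ v) _ (T-∧-intro v₁ (does-complete (label₁ v ≟ root₁) (trans (sym (label-1 v₁)) e)))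
          ... | inj₂ (inj₁ (v₂ , e₂ , _)) = T-∨-injʳ (at-root₁ v) _ (T-∧-intro v₂ (does-complete (label₂ v ≟ root₂) e₂))
          ... | inj₂ (inj₂ (v₂ , ne , lv)) =
            ⊥-elim (non-root₂-outside-U₁ (closed₂ v v₂) ne (subst (T ∘ U₁) (trans (sym e) lv) root₁∈U₁))
        shared : count (λ v → U₁ v ∧ U₂ v) ≤ count (λ v → at-root₁ v ∧ at-root₂ v)
        shared = count-mono λ v h →
          let v₁ = T-∧-proj₁ (U₁ v) (U₂ v) h
              v₂ = T-∧-proj₂ (U₁ v) (U₂ v) h
              (e₁ , e₂) = shared-at-roots v v₁ v₂
          in T-∧-intro {at-root₁ v} {at-root₂ v} (T-∧-intro v₁ (does-complete (label₁ v ≟ root₁) e₁)) (T-∧-intro v₂ (does-complete (label₂ v ≟ root₂) e₂))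

      merged-size₁ : ∀ l → l ≢ root₁ → T (U₁ l) → bagSize merged l ≤ bagSize P₁ l
      merged-size₁ l l≢root₁ l₁ = count-mono λ v h → from-cases v (T-∧-proj₁ _ _ h) (does-sound (label v ≟ l) (T-∧-proj₂ _ _ h))
        where
        from-cases : ∀ v → T (U v) → label v ≡ l → T (U₁ v ∧ does (label₁ v ≟ l))
        from-cases v h e with label-cases v h
        ... | inj₁ v₁ = T-∧-intro v₁ (does-complete (label₁ v ≟ l) (trans (sym (label-1 v₁)) e))
        ... | inj₂ (inj₁ (_ , _ , lv)) = ⊥-elim (l≢root₁ (trans (sym e) lv))
        ... | inj₂ (inj₂ (v₂ , ne , lv)) = ⊥-elim (non-root₂-outside-U₁ (closed₂ v v₂) ne (subst (T ∘ U₁) (trans (sym e) lv) l₁))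

      merged-size₂ : ∀ l → l ≢ root₁ → ¬ T (U₁ l) → bagSize merged l ≤ bagSize P₂ l
      merged-size₂ l l≢root₁ ¬l₁ = count-mono λ v h → from-cases v (T-∧-proj₁ _ _ h) (does-sound (label v ≟ l) (T-∧-proj₂ _ _ h))
        where
        from-cases : ∀ v → T (U v) → label v ≡ l → T (U₂ v ∧ does (label₂ v ≟ l))
        from-cases v h e with label-cases v h
        ... | inj₁ v₁ = ⊥-elim (¬l₁ (subst (T ∘ U₁) (trans (sym (label-1 v₁)) e) (proj₁ (closed₁ v v₁))))
        ... | inj₂ (inj₁ (_ , _ , lv)) = ⊥-elim (l≢root₁ (trans (sym e) lv))
        ... | inj₂ (inj₂ (v₂ , _ , lv)) = T-∧-intro v₂ (does-complete (label₂ v ≟ l) (trans (sym lv) e))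

    reindex : ∀ {U U′} → (∀ v → U v ≡ U′ v) → RootedPartition U′ → RootedPartition U
    reindex {U} {U′} e P = record
      { label = label ; up = up ; depth = depth ; root = root
      ; link = λ u v hu hv → link u v (to hu) (to hv)
      ; closed = λ v h → subst T (sym (e (label v))) (proj₁ (closed v (to h))) , proj₂ (closed v (to h))
      ; depth-root = depth-root }
      where
      open RootedPartition P
      to : ∀ {v} → T (U v) → T (U′ v)
      to {v} = subst T (e v)

    bagSize-reindex : ∀ {U U′} (e : ∀ v → U v ≡ U′ v) (P : RootedPartition U′) l → bagSize {U} (reindex e P) l ≡ bagSize P l
    bagSize-reindex {U} {U′} e P l = count-cong λ v → cong (_∧ does (RootedPartition.label P v ≟ l)) (e v)

module Construction where

  open import Data.Nat.Base using (ℕ; zero; suc; _+_; _*_; _≤_; _<_; z≤n; s≤s)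
  open import Data.Nat using (_≤?_; _<?_)
  open import Data.Nat.Properties hiding (_≟_)
  import Data.Nat.Properties as ℕ
  open import Data.Nat.Solver using (module +-*-Solver)
  open import Data.Bool.Base using (Bool; true; false; _∧_; _∨_; not; T)
  open import Data.Bool.Properties using (T?; ∧-identityʳ; ∧-zeroʳ; ∧-assoc)
  open import Data.Fin.Base using (Fin)
  open import Data.Fin.Properties using (_≟_; any?)
  open import Data.Product.Base using (Σ; _×_; _,_; proj₁; proj₂)
  open import Data.Sum.Base using (_⊎_; inj₁; inj₂)
  open import Data.Empty using (⊥; ⊥-elim)
  open import Data.Unit.Base using (tt)
  open import Function.Base using (_∘_)
  open import Relation.Nullary using (¬_; Dec; yes; no; does)
  open import Relation.Nullary.Decidable using (dec-true; dec-false)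
  open import Relation.Binary.Definitions using (tri<; tri≈; tri>)
  open import Relation.Binary.PropositionalEquality using (_≡_; refl; sym; trans; cong; cong₂; subst)
  open import Defs hiding (sym; m; f)
  open Counting
  open RootedPartitions
  open Separation using (BalancedSeparation; separation)

  module _ where
    open +-*-Solver
    open ≤-Reasoning

    private
      third-of-sum : ∀ s s′ x a → s ≤ s′ + x → s′ ≤ 3 * a → s ≤ 3 * (x + a)
      third-of-sum s s′ x a s≤ s′≤ = begin
        s             ≤⟨ s≤ ⟩
        s′ + x        ≤⟨ +-mono-≤ s′≤ (m≤m+n x (2 * x)) ⟩
        3 * a + 3 * x ≡⟨ solve 2 (λ a x → con 3 :* a :+ con 3 :* x := con 3 :* (x :+ a)) refl a x ⟩
        3 * (x + a)   ∎

      other-side : ∀ s′ a₁ a₂ → a₁ + a₂ ≡ s′ → s′ ≤ 3 * a₁ → 3 * a₂ ≤ 2 * s′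
      other-side s′ a₁ a₂ e h = +-cancelˡ-≤ (3 * a₁) (3 * a₂) (2 * s′) (begin
        3 * a₁ + 3 * a₂  ≡⟨ *-distribˡ-+ 3 a₁ a₂ ⟨
        3 * (a₁ + a₂)    ≡⟨ cong (3 *_) e ⟩
        3 * s′           ≡⟨ solve 1 (λ s → con 3 :* s := s :+ con 2 :* s) refl s′ ⟩
        s′ + 2 * s′      ≤⟨ +-monoˡ-≤ (2 * s′) h ⟩
        3 * a₁ + 2 * s′  ∎)

      positive-third : ∀ s′ a → 0 < s′ → s′ ≤ 3 * a → 0 < a
      positive-third s′ zero pos h = ⊥-elim (<-irrefl refl (≤-trans pos h))
      positive-third s′ (suc a) _ _ = s≤s z≤n

    component-split-sizes : ∀ s s′ x a₁ a₂ K → s ≤ s′ + x → s′ ≤ s → a₁ + a₂ ≡ s′ → s′ ≤ 3 * a₁ →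
      2 * a₁ ≤ s → 0 < s′ → 2 * K < s → x ≤ K →
      s ≤ 3 * (x + a₁) × s ≤ 3 * (x + a₂) × 3 * a₂ ≤ 2 * s × 0 < a₁ × 0 < a₂
    component-split-sizes s s′ x a₁ a₂ K s≤ s′≤s e s′≤3a₁ 2a₁≤s pos 2K<s x≤K =
      third-of-sum s s′ x a₁ s≤ s′≤3a₁ ,
      ≤-trans s≤2[x+a₂] (*-monoˡ-≤ (x + a₂) {2} {3} (s≤s (s≤s z≤n))) ,
      ≤-trans (other-side s′ a₁ a₂ e s′≤3a₁) (*-monoʳ-≤ 2 s′≤s) ,
      positive-third s′ a₁ pos s′≤3a₁ ,
      a₂-pos a₂ s≤2[x+a₂]
      where
      s≤2[x+a₂] : s ≤ 2 * (x + a₂)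
      s≤2[x+a₂] = +-cancelˡ-≤ s s (2 * (x + a₂)) (begin
        s + s                                 ≤⟨ +-mono-≤ s≤′ s≤′ ⟩
        (a₁ + a₂ + x) + (a₁ + a₂ + x)          ≡⟨ solve 3 (λ a b x → (a :+ b :+ x) :+ (a :+ b :+ x) := con 2 :* a :+ con 2 :* (x :+ b)) refl a₁ a₂ x ⟩
        2 * a₁ + 2 * (x + a₂)                  ≤⟨ +-monoˡ-≤ _ 2a₁≤s ⟩
        s + 2 * (x + a₂)                       ∎)
        where
        s≤′ : s ≤ a₁ + a₂ + x
        s≤′ = ≤-trans s≤ (≤-reflexive (cong (_+ x) (sym e)))
      a₂-pos : ∀ b → s ≤ 2 * (x + b) → 0 < b
      a₂-pos zero h = ⊥-elim (<-irrefl refl (≤-trans 2K<s (≤-trans h (*-monoʳ-≤ 2 (≤-trans (≤-reflexive (+-identityʳ x)) x≤K)))))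
      a₂-pos (suc b) _ = s≤s z≤n

    prefix-split-sizes : ∀ s s′ x a₁ a₂ → s ≤ s′ + x → s′ ≤ s → a₁ + a₂ ≡ s′ → s′ ≤ 3 * a₁ → 3 * a₁ < 2 * s′ → 0 < s′ →
      s ≤ 3 * (x + a₁) × s ≤ 3 * (x + a₂) × 3 * a₁ ≤ 2 * s × 3 * a₂ ≤ 2 * s × 0 < a₁ × 0 < a₂
    prefix-split-sizes s s′ x a₁ a₂ s≤ s′≤s e s′≤3a₁ 3a₁<2s′ pos =
      third-of-sum s s′ x a₁ s≤ s′≤3a₁ ,
      third-of-sum s s′ x a₂ s≤ (<⇒≤ s′<3a₂) ,
      ≤-trans (<⇒≤ 3a₁<2s′) (*-monoʳ-≤ 2 s′≤s) ,
      ≤-trans (other-side s′ a₁ a₂ e s′≤3a₁) (*-monoʳ-≤ 2 s′≤s) ,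
      positive-third s′ a₁ pos s′≤3a₁ ,
      positive-third s′ a₂ pos (<⇒≤ s′<3a₂)
      where
      s′<3a₂ : s′ < 3 * a₂
      s′<3a₂ = +-cancelˡ-< (3 * a₁) s′ (3 * a₂) (begin-strict
        3 * a₁ + s′      <⟨ +-monoˡ-< s′ 3a₁<2s′ ⟩
        2 * s′ + s′      ≡⟨ solve 1 (λ s → con 2 :* s :+ s := con 3 :* s) refl s′ ⟩
        3 * s′           ≡⟨ cong (3 *_) (sym e) ⟩
        3 * (a₁ + a₂)    ≡⟨ *-distribˡ-+ 3 a₁ a₂ ⟩
        3 * a₁ + 3 * a₂  ∎)

  sides-cover : ∀ u x q → u ≡ ((u ∧ (x ∨ q)) ∨ (u ∧ (x ∨ not q)))
  sides-cover false x q = refl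
  sides-cover true true q = refl
  sides-cover true false true = refl
  sides-cover true false false = refl

  sides-meet : ∀ u x q → (T x → T u) → ((u ∧ (x ∨ q)) ∧ (u ∧ (x ∨ not q))) ≡ x
  sides-meet true true q _ = refl
  sides-meet true false true _ = refl
  sides-meet true false false _ = refl
  sides-meet false false q _ = refl
  sides-meet false true q h = ⊥-elim (h tt)

  side-on-X : ∀ x s q → ((x ∨ (s ∧ q)) ∧ x) ≡ x
  side-on-X true s q = refl
  side-on-X false true true = refl
  side-on-X false true false = refl
  side-on-X false false q = refl

  side-off-X : ∀ x s q → ((x ∨ (s ∧ q)) ∧ not x) ≡ (s ∧ (not x ∧ q))
  side-off-X true true q = refl
  side-off-X true false q = refl
  side-off-X false true q = ∧-identityʳ q
  side-off-X false false q = refl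

  <-suc-split : ∀ c j → (does (c <? suc j) ∧ does (c <? j)) ≡ does (c <? j)
                      × (does (c <? suc j) ∧ not (does (c <? j))) ≡ does (c ℕ.≟ j)
  <-suc-split c j with <-cmp c j
  ... | tri< c<j _ _ rewrite dec-true (c <? j) c<j | dec-true (c <? suc j) (m<n⇒m<1+n c<j)
                           | dec-false (c ℕ.≟ j) (<⇒≢ c<j) = refl , refl
  ... | tri≈ _ refl _ rewrite dec-false (c <? c) (n≮n c) | dec-true (c <? suc c) (n<1+n c)
                            | dec-true (c ℕ.≟ c) refl = refl , refl
  ... | tri> _ _ c>j rewrite dec-false (c <? j) (<⇒≱ c>j ∘ <⇒≤) | dec-false (c <? suc j) (<⇒≱ c>j ∘ ≤-pred)
                           | dec-false (c ℕ.≟ j) (>⇒≢ c>j) = refl , refl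

  -- The construction uses only these properties of the size conditions; ConcreteBounds
  -- provides the ones of the paper.
  record SizeBounds (K Δ : ℕ) : Set₁ where
    field
      Lower Upper Narrow Large : ℕ → Set
      RootBound : ℕ → ℕ → Set
      large? : ∀ s → Dec (Large s)
      seed : ℕ
      Lower-seed : Lower seed
      Upper-seed : Upper seed
      Narrow-<seed : ∀ t → t < seed → Narrow t
      Lower⇒pos : ∀ s → Lower s → 0 < s
      Lower-mono : ∀ t t′ → t ≤ t′ → Lower t → Lower t′
      RootBound-self : ∀ s → Lower s → RootBound s s
      RootBound⇒Narrow : ∀ b s → Upper s → RootBound b s → Narrow b
      Narrow-≤ : ∀ b b′ → b′ ≤ b → Narrow b → Narrow b′
      RootBound-≤ : ∀ b b′ s → b′ ≤ b → RootBound b s → RootBound b′ s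
      Upper-neighbourhood : ∀ s t → ¬ Large s → t ≤ s * Δ → Upper t
      Large⇒2K< : ∀ s → Large s → 2 * K < s
      Large⇒Lower-third : ∀ s t → Large s → s ≤ 3 * t → Lower t
      Upper-half : ∀ s x a → Upper s → x ≤ K → 2 * a ≤ s → Upper (x + a)
      Upper-two-thirds : ∀ s x a → Upper s → x ≤ K → 3 * a ≤ 2 * s → Upper (x + a)
      RootBound-merge : ∀ s x a₁ a₂ b b₁ b₂ → RootBound b₁ (x + a₁) → RootBound b₂ (x + a₂) →
        b + x ≤ b₁ + b₂ → a₁ + a₂ ≤ s → x ≤ K → Lower s → RootBound b s

  module Build {n : ℕ} (G : Graph n) (k Δ : ℕ) (TD : TreeDecomposition G k)
               (deg : ∀ u → count (adj G u) ≤ Δ) (B : SizeBounds (suc k) Δ) where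

    open SizeBounds B
    open Partitions G

    K : ℕ
    K = suc k

    record Solution (U S : Fin n → Bool) : Set where
      field
        partition : RootedPartition U
      open RootedPartition partition
      field
        S-at-root : ∀ v → T (S v) → label v ≡ root
        root-bound : RootBound (bagSize partition root) (count S)
        narrow : ∀ l → Narrow (bagSize partition l)
        root∈U : T (U root)
        root-fixed : label root ≡ root

    Solvable : ℕ → Set
    Solvable N = ∀ U S → count U ≤ N → (∀ v → T (S v) → T (U v)) → Lower (count S) → Upper (count S) → Solution U S

    module SmallCase (N : ℕ) (solve : Solvable N) (U S : Fin n → Bool) (U≤ : count U ≤ suc N)
                     (S⊆U : ∀ v → T (S v) → T (U v)) (lower : Lower (count S)) (upper : Upper (count S))
                     (¬large : ¬ Large (count S)) where

      s₀ : Fin n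
      s₀ = proj₁ (count-witness S (Lower⇒pos _ lower))

      s₀∈S : T (S s₀)
      s₀∈S = proj₂ (count-witness S (Lower⇒pos _ lower))

      U′ : Fin n → Bool
      U′ v = U v ∧ not (S v)

      disjoint : ∀ v → T (S v) → ¬ T (U′ v)
      disjoint v v∈S h = T-not-elim (S v) (T-∧-proj₂ (U v) _ h) v∈S

      U′≤N : count U′ ≤ N
      U′≤N = ≤-pred (≤-trans (count-strict-mono (λ v h → T-∧-proj₁ (U v) _ h) s₀ (S⊆U s₀ s₀∈S) (disjoint s₀ s₀∈S)) U≤)

      U≗S∪U′ : ∀ v → U v ≡ (S v ∨ U′ v)
      U≗S∪U′ v with S v | U v | S⊆U v
      ... | false | u | _ = sym (∧-identityʳ u)
      ... | true | true | _ = refl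
      ... | true | false | h = ⊥-elim (h tt)

      attach : (P′ : RootedPartition U′) →
        (∀ u v → T (S u) → T (U′ v) → adj G u v ≡ true → RootedPartition.label P′ v ≡ RootedPartition.root P′) →
        (∀ l → Narrow (bagSize P′ l)) → Solution U S
      attach P′ S-to-root narrow′ = record
        { partition = reindex U≗S∪U′ attached
        ; S-at-root = λ v → label-S
        ; root-bound = RootBound-≤ (count S) _ (count S) root-size (RootBound-self _ lower)
        ; narrow = narrow
        ; root∈U = S⊆U s₀ s₀∈S
        ; root-fixed = label-S s₀∈S }
        where
        open Attach S U′ disjoint s₀ s₀∈S P′ S-to-root
        root-size : bagSize (reindex U≗S∪U′ attached) s₀ ≤ count S
        root-size = subst (_≤ count S) (sym (bagSize-reindex U≗S∪U′ attached s₀)) attached-root-size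
        narrow : ∀ l → Narrow (bagSize (reindex U≗S∪U′ attached) l)
        narrow l with l ≟ s₀
        ... | yes refl = Narrow-≤ (count S) _ root-size (RootBound⇒Narrow (count S) (count S) upper (RootBound-self _ lower))
        ... | no l≢s₀ = Narrow-≤ (bagSize P′ l) _
                          (subst (_≤ bagSize P′ l) (sym (bagSize-reindex U≗S∪U′ attached l)) (attached-other-size l l≢s₀)) (narrow′ l)

      neighbours : Fin n → Bool
      neighbours v = any (λ u → S u ∧ adj G u v) ∧ U′ v

      neighbours⊆U′ : ∀ v → T (neighbours v) → T (U′ v)
      neighbours⊆U′ v h = T-∧-proj₂ (any (λ u → S u ∧ adj G u v)) _ h

      attach-to-neighbours : (S′ : Fin n → Bool) → (∀ v → T (neighbours v) → T (S′ v)) → (∀ v → T (S′ v) → T (U′ v)) →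
        Lower (count S′) → Upper (count S′) → Solution U S
      attach-to-neighbours S′ N⊆S′ S′⊆U′ lower′ upper′ = attach partition S-to-root narrow
        where
        open Solution (solve U′ S′ U′≤N S′⊆U′ lower′ upper′)
        S-to-root : ∀ u v → T (S u) → T (U′ v) → adj G u v ≡ true → RootedPartition.label partition v ≡ RootedPartition.root partition
        S-to-root u v u∈S v∈U′ uv = S-at-root v (N⊆S′ v (T-∧-intro (any-intro (λ w → S w ∧ adj G w v) u (T-∧-intro u∈S (subst T (sym uv) tt))) v∈U′))

      some-member : Σ (Fin n) λ l → ∀ v → T (U′ v) → T (U′ l)
      some-member with any? (T? ∘ U′)
      ... | yes (l , l∈U′) = l , λ _ _ → l∈U′
      ... | no none = s₀ , λ v v∈U′ → ⊥-elim (none (v , v∈U′))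

      solution : Solution U S
      solution with count U′ <? seed
      ... | yes small = attach (singleBag U′ (proj₁ some-member) (proj₂ some-member)) (λ _ _ _ _ _ → refl)
                          (λ _ → Narrow-<seed _ (≤-trans (s≤s (count-mono λ v h → T-∧-proj₁ (U′ v) _ h)) small))
      ... | no ¬small with count neighbours ≤? seed
      ...   | yes few = let (S′ , N⊆S′ , S′⊆U′ , size) = count-between neighbours U′ neighbours⊆U′ seed few (≮⇒≥ ¬small) in
                        attach-to-neighbours S′ N⊆S′ S′⊆U′ (subst Lower (sym size) Lower-seed) (subst Upper (sym size) Upper-seed)
      ...   | no many = attach-to-neighbours neighbours (λ _ h → h) neighbours⊆U′
                          (Lower-mono seed _ (<⇒≤ (≰⇒> many)) Lower-seed)
                          (Upper-neighbourhood _ _ ¬large neighbours≤)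
        where
        neighbours≤ : count neighbours ≤ count S * Δ
        neighbours≤ = ≤-trans (count-mono λ v h → T-∧-proj₁ (any (λ u → S u ∧ adj G u v)) _ h)
                              (count-neighbourhood S (adj G) Δ deg)

    module LargeCase (N : ℕ) (solve : Solvable N) (U S : Fin n → Bool) (U≤ : count U ≤ suc N)
                     (S⊆U : ∀ v → T (S v) → T (U v)) (lower : Lower (count S)) (upper : Upper (count S))
                     (large : Large (count S)) where

      open BalancedSeparation (separation TD U S S⊆U (proj₁ (count-witness S (Lower⇒pos _ lower))) (proj₂ (count-witness S (Lower⇒pos _ lower))))

      x : ℕ
      x = count X

      s′ : ℕ
      s′ = count (λ v → S v ∧ not (X v))

      side : (ℕ → Bool) → ℕ
      side q = count (λ v → S v ∧ (not (X v) ∧ q (component v)))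

      sides-sum : ∀ π → side π + side (not ∘ π) ≡ s′
      sides-sum π = sym (trans (count-split (λ v → S v ∧ not (X v)) (π ∘ component))
                               (cong₂ _+_ (count-cong λ v → ∧-assoc (S v) _ _) (count-cong λ v → ∧-assoc (S v) _ _)))

      S≤s′+x : count S ≤ s′ + x
      S≤s′+x = ≤-trans (≤-reflexive (count-split S X))
                 (subst (_≤ s′ + x) (+-comm s′ _) (+-monoʳ-≤ s′ (count-mono λ v h → T-∧-proj₂ (S v) _ h)))

      s′≤S : s′ ≤ count S
      s′≤S = count-mono λ v h → T-∧-proj₁ (S v) _ h

      s′-pos : 0 < s′
      s′-pos with s′ in e
      ... | zero = ⊥-elim (<-irrefl refl (≤-trans (Large⇒2K< _ large) (≤-trans S≤s′+x (≤-trans (≤-reflexive (cong (_+ x) e)) (≤-trans X-size (m≤m+n K (K + 0)))))))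
      ... | suc _ = s≤s z≤n

      module Side (q : ℕ → Bool) where

        U-side : Fin n → Bool
        U-side v = U v ∧ (X v ∨ q (component v))

        S-side : Fin n → Bool
        S-side v = X v ∨ (S v ∧ q (component v))

        S⊆U-side : ∀ v → T (S-side v) → T (U-side v)
        S⊆U-side v h with T-∨-elim (X v) _ h
        ... | inj₁ xv = T-∧-intro (X⊆U v xv) (T-∨-injˡ (X v) _ xv)
        ... | inj₂ sq = T-∧-intro (S⊆U v (T-∧-proj₁ (S v) _ sq)) (T-∨-injʳ (X v) _ (T-∧-proj₂ (S v) _ sq))

        count-S-side : count S-side ≡ x + side q
        count-S-side = trans (count-split S-side X)
          (cong₂ _+_ (count-cong λ v → side-on-X (X v) (S v) (q (component v))) (count-cong λ v → side-off-X (X v) (S v) (q (component v))))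

        U-side≤N : ∀ v → T (S v) → ¬ T (X v) → ¬ T (q (component v)) → count U-side ≤ N
        U-side≤N v v∈S v∉X ¬q = ≤-pred (≤-trans (count-strict-mono (λ w h → T-∧-proj₁ (U w) _ h) v (S⊆U v v∈S) v∉U-side) U≤)
          where
          v∉U-side : ¬ T (U-side v)
          v∉U-side h with T-∨-elim (X v) _ (T-∧-proj₂ (U v) _ h)
          ... | inj₁ xv = v∉X xv
          ... | inj₂ qv = ¬q qv

        on-side : ∀ v → T (U-side v) → ¬ T (X v) → T (q (component v))
        on-side v h v∉X with T-∨-elim (X v) _ (T-∧-proj₂ (U v) _ h)
        ... | inj₁ xv = ⊥-elim (v∉X xv)
        ... | inj₂ qv = qv

        recurse : ∀ v → T (S v) → ¬ T (X v) → ¬ T (q (component v)) →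
          Lower (x + side q) → Upper (x + side q) → Solution U-side S-side
        recurse v v∈S v∉X ¬q lower′ upper′ =
          solve U-side S-side (U-side≤N v v∈S v∉X ¬q) S⊆U-side (subst Lower (sym count-S-side) lower′) (subst Upper (sym count-S-side) upper′)

      witness-of : ∀ q → 0 < side q → Σ (Fin n) λ v → T (S v) × ¬ T (X v) × T (q (component v))
      witness-of q pos with count-witness _ pos
      ... | v , h = v , T-∧-proj₁ (S v) _ h , T-not-elim (X v) (T-∧-proj₁ (not (X v)) _ (T-∧-proj₂ (S v) _ h)) ,
                    T-∧-proj₂ (not (X v)) _ (T-∧-proj₂ (S v) _ h)

      module Split (π : ℕ → Bool)
                   (lower₁ : Lower (x + side π)) (upper₁ : Upper (x + side π))
                   (lower₂ : Lower (x + side (not ∘ π))) (upper₂ : Upper (x + side (not ∘ π)))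
                   (pos₁ : 0 < side π) (pos₂ : 0 < side (not ∘ π)) where

        open Side π using () renaming (U-side to U₁; S-side to S₁; on-side to on-side₁; count-S-side to count-S₁)
        open Side (not ∘ π) using () renaming (U-side to U₂; S-side to S₂; on-side to on-side₂; count-S-side to count-S₂)

        sol₁ : Solution U₁ S₁
        sol₁ with witness-of (not ∘ π) pos₂
        ... | v , v∈S , v∉X , ¬πv = Side.recurse π v v∈S v∉X (T-not-elim _ ¬πv) lower₁ upper₁

        sol₂ : Solution U₂ S₂
        sol₂ with witness-of π pos₁
        ... | v , v∈S , v∉X , πv = Side.recurse (not ∘ π) v v∈S v∉X (λ h → T-not-elim _ h πv) lower₂ upper₂

        open Solution sol₁ renaming (partition to P₁; S-at-root to S₁-at-root; root-bound to root-bound₁; narrow to narrow₁; root∈U to root∈U₁; root-fixed to root-fixed₁)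
        open Solution sol₂ renaming (partition to P₂; S-at-root to S₂-at-root; root-bound to root-bound₂; narrow to narrow₂; root∈U to root∈U₂; root-fixed to root-fixed₂)

        shared⇒X : ∀ v → T (U₁ v) → T (U₂ v) → T (X v)
        shared⇒X v v₁ v₂ with T? (X v)
        ... | yes xv = xv
        ... | no v∉X = ⊥-elim (T-not-elim _ (on-side₂ v v₂ v∉X) (on-side₁ v v₁ v∉X))

        shared-at-roots : ∀ v → T (U₁ v) → T (U₂ v) →
          RootedPartition.label P₁ v ≡ RootedPartition.root P₁ × RootedPartition.label P₂ v ≡ RootedPartition.root P₂
        shared-at-roots v v₁ v₂ = S₁-at-root v (T-∨-injˡ (X v) _ xv) , S₂-at-root v (T-∨-injˡ (X v) _ xv)
          where xv = shared⇒X v v₁ v₂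

        no-crossing : ∀ u v → T (U₁ u) → ¬ T (U₂ u) → T (U₂ v) → ¬ T (U₁ v) → adj G u v ≡ true → ⊥
        no-crossing u v u₁ ¬u₂ v₂ ¬v₁ uv =
          T-not-elim _ (on-side₂ v v₂ v∉X) (subst (T ∘ π) (component-edge u v u∈U v∈U u∉X v∉X uv) (on-side₁ u u₁ u∉X))
          where
          u∈U = T-∧-proj₁ (U u) _ u₁
          v∈U = T-∧-proj₁ (U v) _ v₂
          u∉X : ¬ T (X u)
          u∉X xu = ¬u₂ (T-∧-intro u∈U (T-∨-injˡ (X u) _ xu))
          v∉X : ¬ T (X v)
          v∉X xv = ¬v₁ (T-∧-intro v∈U (T-∨-injˡ (X v) _ xv))

        open Merge U₁ U₂ P₁ P₂ shared-at-roots root∈U₁ root-fixed₁ no-crossing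
          using (merged; root-from-1; root-from-2; merged-root-size; merged-size₁; merged-size₂)

        r : Fin n
        r = RootedPartition.root P₁

        U≗U₁∪U₂ : ∀ v → U v ≡ (U₁ v ∨ U₂ v)
        U≗U₁∪U₂ v = sides-cover (U v) (X v) (π (component v))

        P : RootedPartition U
        P = reindex U≗U₁∪U₂ merged

        S-at-root : ∀ v → T (S v) → RootedPartition.label P v ≡ r
        S-at-root v v∈S = by-side (T? (U₁ v))
          where
          in-S₁ : T (X v) ⊎ T (π (component v)) → T (S₁ v)
          in-S₁ (inj₁ xv) = T-∨-injˡ (X v) _ xv
          in-S₁ (inj₂ πv) = T-∨-injʳ (X v) _ (T-∧-intro v∈S πv)
          by-side : Dec (T (U₁ v)) → RootedPartition.label P v ≡ r
          by-side (yes v₁) = root-from-1 v₁ (S₁-at-root v (in-S₁ (T-∨-elim (X v) _ (T-∧-proj₂ (U v) _ v₁))))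
          by-side (no ¬v₁) = root-from-2 ¬v₁ (S₂-at-root v (T-∨-injʳ (X v) _ (T-∧-intro v∈S (T-not-intro (π (component v)) λ πv →
                               ¬v₁ (T-∧-intro (S⊆U v v∈S) (T-∨-injʳ (X v) _ πv))))))

        root-size : bagSize P r + x ≤ bagSize P₁ r + bagSize P₂ (RootedPartition.root P₂)
        root-size = subst (_≤ bagSize P₁ r + bagSize P₂ (RootedPartition.root P₂)) (cong₂ _+_ (sym (bagSize-reindex U≗U₁∪U₂ merged r))
                                            (count-cong λ v → sides-meet (U v) (X v) (π (component v)) (X⊆U v)))
                          merged-root-size

        root-bound : RootBound (bagSize P r) (count S)
        root-bound = RootBound-merge (count S) x (side π) (side (not ∘ π)) _ _ _
          (subst (RootBound _) count-S₁ root-bound₁) (subst (RootBound _) count-S₂ root-bound₂)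
          root-size (≤-trans (≤-reflexive (sides-sum π)) s′≤S) X-size lower

        narrow : ∀ l → Narrow (bagSize P l)
        narrow l = by-cases (l ≟ r) (T? (U₁ l))
          where
          by-cases : Dec (l ≡ r) → Dec (T (U₁ l)) → Narrow (bagSize P l)
          by-cases (yes l≡r) _ = subst (Narrow ∘ bagSize P) (sym l≡r) (RootBound⇒Narrow _ (count S) upper root-bound)
          by-cases (no l≢r) (yes l₁) =
            Narrow-≤ _ _ (subst (_≤ bagSize P₁ l) (sym (bagSize-reindex U≗U₁∪U₂ merged l)) (merged-size₁ l l≢r l₁)) (narrow₁ l)
          by-cases (no l≢r) (no ¬l₁) =
            Narrow-≤ _ _ (subst (_≤ bagSize P₂ l) (sym (bagSize-reindex U≗U₁∪U₂ merged l)) (merged-size₂ l l≢r ¬l₁)) (narrow₂ l)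

        solution : Solution U S
        solution = record
          { partition = P ; S-at-root = S-at-root ; root-bound = root-bound ; narrow = narrow
          ; root∈U = T-∧-proj₁ (U r) _ root∈U₁ ; root-fixed = root-from-1 root∈U₁ root-fixed₁ }

      prefix : ℕ → ℕ
      prefix j = side (λ c → does (c <? j))

      piece : ℕ → ℕ
      piece j = side (λ c → does (c ℕ.≟ j))

      prefix-zero : prefix 0 ≡ 0
      prefix-zero = trans (count-cong λ v → trans (cong (S v ∧_) (∧-zeroʳ (not (X v)))) (∧-zeroʳ (S v))) (count-false {n})

      prefix-suc : ∀ j → prefix (suc j) ≡ prefix j + piece j
      prefix-suc j = trans (count-split (λ v → S v ∧ (not (X v) ∧ does (component v <? suc j))) (λ v → does (component v <? j)))
        (cong₂ _+_ (count-cong λ v → trans (reassoc v) (cong (λ b → S v ∧ (not (X v) ∧ b)) (proj₁ (<-suc-split (component v) j))))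
                   (count-cong λ v → trans (reassoc v) (cong (λ b → S v ∧ (not (X v) ∧ b)) (proj₂ (<-suc-split (component v) j)))))
        where
        reassoc : ∀ v {b} → ((S v ∧ (not (X v) ∧ does (component v <? suc j))) ∧ b) ≡ (S v ∧ (not (X v) ∧ (does (component v <? suc j) ∧ b)))
        reassoc v {b} = trans (∧-assoc (S v) _ b) (cong (S v ∧_) (∧-assoc (not (X v)) _ b))

      prefix-all : prefix (suc components) ≡ s′
      prefix-all = count-cong λ v → trans (cong (λ b → S v ∧ (not (X v) ∧ b)) (dec-true (component v <? suc components) (s≤s (component-bound v))))
                                          (cong (S v ∧_) (∧-identityʳ (not (X v))))

      first-third : Σ ℕ λ j → s′ ≤ 3 * prefix j × (∀ i → i < j → ¬ s′ ≤ 3 * prefix i)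
      first-third = least (λ j → s′ ≤? 3 * prefix j) (suc components)
                      (subst (λ p → s′ ≤ 3 * p) (sym prefix-all) (m≤m+n s′ (2 * s′)))

      solution : Solution U S
      solution with first-third
      ... | zero , s′≤ , _ = ⊥-elim (<-irrefl refl (≤-trans s′-pos (subst (λ p → s′ ≤ 3 * p) prefix-zero s′≤)))
      ... | suc j , s′≤ , earlier with s′ ≤? 3 * piece j
      ...   | yes heavy-piece =
              let (l₁ , l₂ , h₂ , p₁ , p₂) = component-split-sizes (count S) s′ x (piece j) (side (not ∘ π)) K
                                               S≤s′+x s′≤S (sides-sum π) heavy-piece (balanced j) s′-pos (Large⇒2K< _ large) X-size
              in Split.solution π (Large⇒Lower-third _ _ large l₁) (Upper-half _ x (piece j) upper X-size (balanced j))
                                  (Large⇒Lower-third _ _ large l₂) (Upper-two-thirds _ x _ upper X-size h₂) p₁ p₂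
        where
        π : ℕ → Bool
        π c = does (c ℕ.≟ j)
      ...   | no light-piece =
              let (l₁ , l₂ , h₁ , h₂ , p₁ , p₂) = prefix-split-sizes (count S) s′ x (prefix (suc j)) (side (not ∘ π))
                                                    S≤s′+x s′≤S (sides-sum π) s′≤ prefix<2/3 s′-pos
              in Split.solution π (Large⇒Lower-third _ _ large l₁) (Upper-two-thirds _ x _ upper X-size h₁)
                                  (Large⇒Lower-third _ _ large l₂) (Upper-two-thirds _ x _ upper X-size h₂) p₁ p₂
        where
        π : ℕ → Bool
        π c = does (c <? suc j)
        prefix<2/3 : 3 * prefix (suc j) < 2 * s′
        prefix<2/3 = begin-strict
          3 * prefix (suc j)           ≡⟨ cong (3 *_) (prefix-suc j) ⟩
          3 * (prefix j + piece j)     ≡⟨ *-distribˡ-+ 3 (prefix j) (piece j) ⟩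
          3 * prefix j + 3 * piece j   <⟨ +-mono-< (≰⇒> (earlier j (n<1+n j))) (≰⇒> light-piece) ⟩
          s′ + s′                      ≡⟨ cong (s′ +_) (+-identityʳ s′) ⟨
          2 * s′                       ∎
          where open ≤-Reasoning

    solve : ∀ N → Solvable N
    solve zero U S U≤ S⊆U lower _ = ⊥-elim (<-irrefl refl (≤-trans (Lower⇒pos _ lower) (≤-trans (count-mono S⊆U) U≤)))
    solve (suc N) U S U≤ S⊆U lower upper with large? (count S)
    ... | no ¬large = SmallCase.solution N (solve N) U S U≤ S⊆U lower upper ¬large
    ... | yes large = LargeCase.solution N (solve N) U S U≤ S⊆U lower upper large

module Sqrt2Approximation where

  open import Data.Nat
  open import Data.Nat.Properties
  open import Data.Product using (Σ; _×_; _,_; proj₁; proj₂)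
  open import Data.Empty using (⊥-elim)
  open import Relation.Nullary using (¬_; yes; no)
  open import Relation.Binary.PropositionalEquality using (_≡_; refl; sym; subst)
  open import Data.Nat.Solver using (module +-*-Solver)
  open +-*-Solver
  open import Function.Base using (_|>_)
  open Counting using (least)

  sq : ℕ → ℕ
  sq x = x * x

  sq-mono-≤ : ∀ {a b} → a ≤ b → sq a ≤ sq b
  sq-mono-≤ h = *-mono-≤ h h

  sq-mono-< : ∀ {a b} → a < b → sq a < sq b
  sq-mono-< h = *-mono-< h h

  sq-cancel-≤ : ∀ {a b} → sq a ≤ sq b → a ≤ b
  sq-cancel-≤ {a} {b} h with a ≤? b
  ... | yes p = p
  ... | no p = ⊥-elim (<⇒≱ (sq-mono-< (≰⇒> p)) h)

  sq-cancel-< : ∀ {a b} → sq a < sq b → a < b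
  sq-cancel-< {a} {b} h with a <? b
  ... | yes p = p
  ... | no p = ⊥-elim (<⇒≱ h (sq-mono-≤ (≮⇒≥ p)))

  sq-2* : ∀ a → sq (2 * a) ≡ 2 * (2 * sq a)
  sq-2* = solve 1 (λ a → (con 2 :* a) :* (con 2 :* a) := con 2 :* (con 2 :* (a :* a))) refl

  sq-* : ∀ a b → sq (a * b) ≡ sq a * sq b
  sq-* a b = solve 2 (λ a b → (a :* b) :* (a :* b) := (a :* a) :* (b :* b)) refl a b

  ⌈√2*⌉-exists : ∀ B → Σ ℕ λ t → 2 * sq B ≤ sq t × (∀ j → j < t → ¬ 2 * sq B ≤ sq j)
  ⌈√2*⌉-exists B = least (λ t → 2 * sq B ≤? sq t) (2 * B) (m≤m+n _ _ |> subst (2 * sq B ≤_) (double-sq B))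
    where
    double-sq : ∀ B → 2 * sq B + 2 * sq B ≡ sq (2 * B)
    double-sq = solve 1 (λ B → con 2 :* (B :* B) :+ con 2 :* (B :* B) := (con 2 :* B) :* (con 2 :* B)) refl

  ⌊√2*⌋-exists : ∀ B → Σ ℕ λ t → 2 * sq B < sq (suc t) × (∀ j → j < t → ¬ 2 * sq B < sq (suc j))
  ⌊√2*⌋-exists B = least (λ t → 2 * sq B <? sq (suc t)) (2 * B) (s≤s (m≤m+n _ _ |> subst (2 * sq B ≤_) (expand B)))
    where
    expand : ∀ B → 2 * sq B + (2 * sq B + 4 * B) ≡ 2 * B + 2 * B * (1 + 2 * B)
    expand = solve 1 (λ B → con 2 :* (B :* B) :+ (con 2 :* (B :* B) :+ con 4 :* B) := (con 2 :* B) :+ (con 2 :* B) :* (con 1 :+ con 2 :* B)) refl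

  opaque
    ⌈√2*⌉ : ℕ → ℕ
    ⌈√2*⌉ B = proj₁ (⌈√2*⌉-exists B)

    ⌈√2*⌉-spec : ∀ B → 2 * sq B ≤ sq (⌈√2*⌉ B)
    ⌈√2*⌉-spec B = proj₁ (proj₂ (⌈√2*⌉-exists B))

    ⌈√2*⌉-least : ∀ B t → 2 * sq B ≤ sq t → ⌈√2*⌉ B ≤ t
    ⌈√2*⌉-least B t h = ≮⇒≥ λ t<g → proj₂ (proj₂ (⌈√2*⌉-exists B)) t t<g h

    ⌊√2*⌋ : ℕ → ℕ
    ⌊√2*⌋ B = proj₁ (⌊√2*⌋-exists B)

    ⌊√2*⌋-spec-< : ∀ B → 2 * sq B < sq (suc (⌊√2*⌋ B))
    ⌊√2*⌋-spec-< B = proj₁ (proj₂ (⌊√2*⌋-exists B))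

    ⌊√2*⌋-spec : ∀ B → sq (⌊√2*⌋ B) ≤ 2 * sq B
    ⌊√2*⌋-spec B with ⌊√2*⌋-exists B
    ... | zero , _ = z≤n
    ... | suc t , _ , below = ≮⇒≥ (below t (n<1+n t))

  ⌊√2*⌋-greatest : ∀ B t → sq t ≤ 2 * sq B → t ≤ ⌊√2*⌋ B
  ⌊√2*⌋-greatest B t h with t ≤? ⌊√2*⌋ B
  ... | yes p = p
  ... | no p = ⊥-elim (<⇒≱ (⌊√2*⌋-spec-< B) (≤-trans (sq-mono-≤ (≰⇒> p)) h))

  ⌊√2*⌋-mono : ∀ {x y} → x ≤ y → ⌊√2*⌋ x ≤ ⌊√2*⌋ y
  ⌊√2*⌋-mono {x} {y} h = ⌊√2*⌋-greatest y (⌊√2*⌋ x) (≤-trans (⌊√2*⌋-spec x) (*-monoʳ-≤ 2 (sq-mono-≤ h)))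

  ⌈√2*⌉≤1+⌊√2*⌋ : ∀ x → ⌈√2*⌉ x ≤ suc (⌊√2*⌋ x)
  ⌈√2*⌉≤1+⌊√2*⌋ x = ⌈√2*⌉-least x (suc (⌊√2*⌋ x)) (<⇒≤ (⌊√2*⌋-spec-< x))

  sq-*-≤ : ∀ a b c d → sq a ≤ 2 * sq c → sq b ≤ 2 * sq d → a * b ≤ 2 * (c * d)
  sq-*-≤ a b c d h1 h2 = sq-cancel-≤ (begin
    sq (a * b) ≡⟨ sq-* a b ⟩
    sq a * sq b ≤⟨ *-mono-≤ h1 h2 ⟩
    (2 * sq c) * (2 * sq d) ≡⟨ solve 2 (λ c d → (con 2 :* (c :* c)) :* (con 2 :* (d :* d)) := (con 2 :* (c :* d)) :* (con 2 :* (c :* d))) refl c d ⟩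
    sq (2 * (c * d)) ∎)
    where open ≤-Reasoning

  ⌊√2*⌋-superadditive : ∀ x y → ⌊√2*⌋ x + ⌊√2*⌋ y ≤ ⌊√2*⌋ (x + y)
  ⌊√2*⌋-superadditive x y = ⌊√2*⌋-greatest (x + y) (⌊√2*⌋ x + ⌊√2*⌋ y) (begin
    sq (⌊√2*⌋ x + ⌊√2*⌋ y) ≡⟨ solve 2 (λ a b → (a :+ b) :* (a :+ b) := a :* a :+ b :* b :+ con 2 :* (a :* b)) refl (⌊√2*⌋ x) (⌊√2*⌋ y) ⟩
    sq (⌊√2*⌋ x) + sq (⌊√2*⌋ y) + 2 * (⌊√2*⌋ x * ⌊√2*⌋ y) ≤⟨ +-mono-≤ (+-mono-≤ (⌊√2*⌋-spec x) (⌊√2*⌋-spec y)) (*-monoʳ-≤ 2 (sq-*-≤ (⌊√2*⌋ x) (⌊√2*⌋ y) x y (⌊√2*⌋-spec x) (⌊√2*⌋-spec y))) ⟩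
    2 * sq x + 2 * sq y + 2 * (2 * (x * y)) ≡⟨ solve 2 (λ x y → con 2 :* (x :* x) :+ con 2 :* (y :* y) :+ con 2 :* (con 2 :* (x :* y)) := con 2 :* ((x :+ y) :* (x :+ y))) refl x y ⟩
    2 * sq (x + y) ∎)
    where open ≤-Reasoning

  ⌊√2*⌋-scale : ∀ t x → t * ⌊√2*⌋ x ≤ ⌊√2*⌋ (t * x)
  ⌊√2*⌋-scale t x = ⌊√2*⌋-greatest (t * x) (t * ⌊√2*⌋ x) (begin
    sq (t * ⌊√2*⌋ x) ≡⟨ sq-* t (⌊√2*⌋ x) ⟩
    sq t * sq (⌊√2*⌋ x) ≤⟨ *-monoʳ-≤ (sq t) (⌊√2*⌋-spec x) ⟩
    sq t * (2 * sq x) ≡⟨ solve 2 (λ t x → (t :* t) :* (con 2 :* (x :* x)) := con 2 :* ((t :* x) :* (t :* x))) refl t x ⟩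
    2 * sq (t * x) ∎)
    where open ≤-Reasoning

  ⌈√2*⌉-cancel : ∀ t K u → 0 < t → ⌈√2*⌉ (t * K) ≤ t * u → ⌈√2*⌉ K ≤ u
  ⌈√2*⌉-cancel t K u pos h with ⌈√2*⌉ K ≤? u
  ... | yes p = p
  ... | no p = ⊥-elim (<⇒≱ (sq-cancel-< lt) h)
    where
    su : sq u < 2 * sq K
    su = ≰⇒> (λ q → p (⌈√2*⌉-least K u q))
    lt : sq (t * u) < sq (⌈√2*⌉ (t * K))
    lt = begin-strict
      sq (t * u) ≡⟨ sq-* t u ⟩
      sq t * sq u <⟨ *-monoʳ-< (sq t) {{>-nonZero (*-mono-< pos pos)}} su ⟩
      sq t * (2 * sq K) ≡⟨ solve 2 (λ t x → (t :* t) :* (con 2 :* (x :* x)) := con 2 :* ((t :* x) :* (t :* x))) refl t K ⟩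
      2 * sq (t * K) ≤⟨ ⌈√2*⌉-spec (t * K) ⟩
      sq (⌈√2*⌉ (t * K)) ∎
      where open ≤-Reasoning

  ⌊√2*⌋-double : ∀ x → ⌊√2*⌋ (2 * x) ≤ suc (2 * ⌊√2*⌋ x)
  ⌊√2*⌋-double x with ⌊√2*⌋ (2 * x) ≤? suc (2 * ⌊√2*⌋ x)
  ... | yes p = p
  ... | no p = ⊥-elim (<⇒≱ lt (sq-mono-≤ (≰⇒> p)))
    where
    lt : sq (⌊√2*⌋ (2 * x)) < sq (suc (suc (2 * ⌊√2*⌋ x)))
    lt = begin-strict
      sq (⌊√2*⌋ (2 * x)) ≤⟨ ⌊√2*⌋-spec (2 * x) ⟩
      2 * sq (2 * x) ≡⟨ solve 1 (λ x → con 2 :* ((con 2 :* x) :* (con 2 :* x)) := con 4 :* (con 2 :* (x :* x))) refl x ⟩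
      4 * (2 * sq x) <⟨ *-monoʳ-< 4 (⌊√2*⌋-spec-< x) ⟩
      4 * sq (suc (⌊√2*⌋ x)) ≡⟨ solve 1 (λ a → con 4 :* ((con 1 :+ a) :* (con 1 :+ a)) := (con 2 :+ con 2 :* a) :* (con 2 :+ con 2 :* a)) refl (⌊√2*⌋ x) ⟩
      sq (suc (suc (2 * ⌊√2*⌋ x))) ∎
      where open ≤-Reasoning

  ⌊√2*⌋-nested : ∀ x y → ⌊√2*⌋ (x + ⌊√2*⌋ y) ≤ ⌊√2*⌋ x + 2 * y
  ⌊√2*⌋-nested x y with ⌊√2*⌋ (x + ⌊√2*⌋ y) ≤? ⌊√2*⌋ x + 2 * y
  ... | yes p = p
  ... | no p = ⊥-elim (<⇒≱ lt (sq-mono-≤ (≤-reflexive (sym Feq))))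
    where
    F = ⌊√2*⌋ (x + ⌊√2*⌋ y)
    u = F ∸ 2 * y
    gt : ⌊√2*⌋ x + 2 * y < F
    gt = ≰⇒> p
    Feq : F ≡ u + 2 * y
    Feq = sym (m∸n+n≡m (≤-trans (m≤n+m (2 * y) (⌊√2*⌋ x)) (<⇒≤ gt)))
    ux : ⌊√2*⌋ x < u
    ux = +-cancelʳ-< (2 * y) (⌊√2*⌋ x) u (subst (⌊√2*⌋ x + 2 * y <_) Feq gt)
    sqx : 2 * sq x < sq u
    sqx = <-≤-trans (⌊√2*⌋-spec-< x) (sq-mono-≤ ux)
    cross : x * ⌊√2*⌋ y ≤ u * y
    cross = sq-cancel-≤ (begin
      sq (x * ⌊√2*⌋ y) ≡⟨ sq-* x (⌊√2*⌋ y) ⟩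
      sq x * sq (⌊√2*⌋ y) ≤⟨ *-monoʳ-≤ (sq x) (⌊√2*⌋-spec y) ⟩
      sq x * (2 * sq y) ≡⟨ solve 2 (λ x y → (x :* x) :* (con 2 :* (y :* y)) := (con 2 :* (x :* x)) :* (y :* y)) refl x y ⟩
      (2 * sq x) * sq y ≤⟨ *-monoˡ-≤ (sq y) (<⇒≤ sqx) ⟩
      sq u * sq y ≡⟨ sym (sq-* u y) ⟩
      sq (u * y) ∎)
      where open ≤-Reasoning
    lt : sq F < sq (u + 2 * y)
    lt = begin-strict
      sq F ≤⟨ ⌊√2*⌋-spec (x + ⌊√2*⌋ y) ⟩
      2 * sq (x + ⌊√2*⌋ y) ≡⟨ solve 3 (λ x a y → con 2 :* ((x :+ a) :* (x :+ a)) := con 2 :* (x :* x) :+ (con 4 :* (x :* a) :+ con 2 :* (a :* a))) refl x (⌊√2*⌋ y) y ⟩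
      2 * sq x + (4 * (x * ⌊√2*⌋ y) + 2 * sq (⌊√2*⌋ y)) <⟨ +-mono-<-≤ sqx (+-mono-≤ (*-monoʳ-≤ 4 cross) (*-monoʳ-≤ 2 (⌊√2*⌋-spec y))) ⟩
      sq u + (4 * (u * y) + 2 * (2 * sq y)) ≡⟨ solve 2 (λ u y → u :* u :+ (con 4 :* (u :* y) :+ con 2 :* (con 2 :* (y :* y))) := (u :+ con 2 :* y) :* (u :+ con 2 :* y)) refl u y ⟩
      sq (u + 2 * y) ∎
      where open ≤-Reasoning

module ConcreteBounds where

  open import Data.Nat
  open import Data.Nat.Properties
  open import Data.Product using (_×_; _,_)
  open import Data.Empty using (⊥-elim)
  open import Relation.Nullary using (¬_; Dec; yes; no)
  open import Relation.Binary.PropositionalEquality using (_≡_; refl; sym; cong; cong₂; subst)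
  open import Data.Nat.Solver using (module +-*-Solver)
  open +-*-Solver
  open Sqrt2Approximation
  open Construction using (SizeBounds)

  2*≤1+2*⇒≤ : ∀ a c → 2 * a ≤ suc (2 * c) → a ≤ c
  2*≤1+2*⇒≤ a c h with a ≤? c
  ... | yes p = p
  ... | no p = ⊥-elim (<-irrefl refl (≤-trans (subst (_≤ 2 * a) (*-suc 2 c) (*-monoʳ-≤ 2 (≰⇒> p))) h))

  module Concrete (K Δ : ℕ) (1≤K : 1 ≤ K) (1≤Δ : 1 ≤ Δ) where
    open ≤-Reasoning

    D : ℕ
    D = K * Δ

    K≤D : K ≤ D
    K≤D = subst (_≤ K * Δ) (*-identityʳ K) (*-monoʳ-≤ K 1≤Δ)

    M : ℕ
    M = 6 * D + ⌊√2*⌋ (3 * D)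

    -- With D = KΔ and ⌊√2*⌋ x = ⌊√2 x⌋, these are the paper's conditions
    -- (γ+1)K ≤ s, s ≤ 3(γ+1)KΔ, s ≥ 3(γ+1)K, b ≤ γK(3γΔ−1) and b ≤ αs − γK, multiplied
    -- out (γ² = 3 + 2√2) so that the irrational part is a single multiple of √2.
    Lower Upper Large Narrow : ℕ → Set
    Lower s = 2 * K + ⌈√2*⌉ K ≤ s
    Upper s = s ≤ M
    Large s = 6 * K + ⌈√2*⌉ (3 * K) ≤ s
    Narrow b = b + K ≤ 9 * D + ⌊√2*⌋ (6 * D ∸ K)

    RootBound : ℕ → ℕ → Set
    RootBound b s = 2 * K ≤ s × 2 * b + 2 * K ≤ 2 * s + ⌊√2*⌋ (s ∸ 2 * K)

    2K≤M : 2 * K ≤ M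
    2K≤M = ≤-trans (*-mono-≤ {2} {6} (s≤s (s≤s z≤n)) K≤D) (m≤m+n (6 * D) _)

    Lower-seed : Lower (4 * K)
    Lower-seed = subst (2 * K + ⌈√2*⌉ K ≤_) (solve 1 (λ K → con 2 :* K :+ con 2 :* K := con 4 :* K) refl K)
              (+-monoʳ-≤ (2 * K) (⌈√2*⌉-least K (2 * K) (≤-trans (m≤m+n (2 * sq K) (2 * sq K))
                (≤-reflexive (solve 1 (λ K → con 2 :* (K :* K) :+ con 2 :* (K :* K) := (con 2 :* K) :* (con 2 :* K)) refl K)))))

    Upper-seed : Upper (4 * K)
    Upper-seed = ≤-trans (*-mono-≤ {4} {6} (s≤s (s≤s (s≤s (s≤s z≤n)))) K≤D) (m≤m+n (6 * D) _)

    Narrow-<seed : ∀ t → t < 4 * K → Narrow t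
    Narrow-<seed t lt = ≤-trans (+-monoˡ-≤ K (<⇒≤ lt))
      (≤-trans (≤-reflexive (solve 1 (λ K → con 4 :* K :+ K := con 5 :* K) refl K))
        (≤-trans (*-mono-≤ {5} {9} (s≤s (s≤s (s≤s (s≤s (s≤s z≤n))))) K≤D) (m≤m+n (9 * D) _)))

    Lower⇒pos : ∀ s → Lower s → 0 < s
    Lower⇒pos s h = ≤-trans (≤-trans 1≤K (m≤m+n K (K + 0))) (≤-trans (m≤m+n (2 * K) _) h)

    Lower-mono : ∀ t t′ → t ≤ t′ → Lower t → Lower t′
    Lower-mono t t′ le h = ≤-trans h le

    RootBound-self : ∀ s → Lower s → RootBound s s
    RootBound-self s lo = 2K≤s , +-monoʳ-≤ (2 * s) (⌊√2*⌋-greatest (s ∸ 2 * K) (2 * K) sqle)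
      where
      2K≤s : 2 * K ≤ s
      2K≤s = ≤-trans (m≤m+n (2 * K) _) lo
      gle : ⌈√2*⌉ K ≤ s ∸ 2 * K
      gle = ≤-trans (≤-reflexive (sym (m+n∸m≡n (2 * K) (⌈√2*⌉ K)))) (∸-monoˡ-≤ (2 * K) lo)
      sqle : sq (2 * K) ≤ 2 * sq (s ∸ 2 * K)
      sqle = begin
        sq (2 * K) ≡⟨ sq-2* K ⟩
        2 * (2 * sq K) ≤⟨ *-monoʳ-≤ 2 (⌈√2*⌉-spec K) ⟩
        2 * sq (⌈√2*⌉ K) ≤⟨ *-monoʳ-≤ 2 (sq-mono-≤ gle) ⟩
        2 * sq (s ∸ 2 * K) ∎

    6D : ℕ
    6D = 6 * D

    2K≤6D : 2 * K ≤ 6D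
    2K≤6D = *-mono-≤ {2} {6} (s≤s (s≤s z≤n)) K≤D

    K≤6D : K ≤ 6D
    K≤6D = ≤-trans (m≤m+n K (K + 0)) 2K≤6D

    -- At the largest allowed |S| the root bound is exactly the width: α·3(γ+1)KΔ − γK = γK(3γΔ−1).
    RootBound⇒Narrow : ∀ b s → Upper s → RootBound b s → Narrow b
    RootBound⇒Narrow b s hi (_ , bb) = 2*≤1+2*⇒≤ (b + K) (9 * D + ⌊√2*⌋ y) chain
      where
      x₀ = 6D ∸ 2 * K
      y = 6D ∸ K
      M-2K : M ∸ 2 * K ≡ x₀ + ⌊√2*⌋ (3 * D)
      M-2K = +-∸-comm (⌊√2*⌋ (3 * D)) 2K≤6D
      doubled-y : (3 * D + 3 * D) + x₀ ≡ 2 * y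
      doubled-y = +-cancelʳ-≡ (2 * K) _ _ (begin-equality
        (3 * D + 3 * D) + x₀ + 2 * K ≡⟨ +-assoc (3 * D + 3 * D) x₀ (2 * K) ⟩
        (3 * D + 3 * D) + (x₀ + 2 * K) ≡⟨ cong ((3 * D + 3 * D) +_) (m∸n+n≡m 2K≤6D) ⟩
        (3 * D + 3 * D) + 6D ≡⟨ solve 1 (λ d → (con 3 :* d :+ con 3 :* d) :+ con 6 :* d := con 2 :* (con 6 :* d)) refl D ⟩
        2 * 6D ≡⟨ cong (2 *_) (sym (m∸n+n≡m K≤6D)) ⟩
        2 * (y + K) ≡⟨ *-distribˡ-+ 2 y K ⟩
        2 * y + 2 * K ∎)
      chain : 2 * (b + K) ≤ suc (2 * (9 * D + ⌊√2*⌋ y))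
      chain = begin
        2 * (b + K) ≡⟨ *-distribˡ-+ 2 b K ⟩
        2 * b + 2 * K ≤⟨ bb ⟩
        2 * s + ⌊√2*⌋ (s ∸ 2 * K) ≤⟨ +-mono-≤ (*-monoʳ-≤ 2 hi) (⌊√2*⌋-mono (∸-monoˡ-≤ (2 * K) hi)) ⟩
        2 * M + ⌊√2*⌋ (M ∸ 2 * K) ≡⟨ cong (λ z → 2 * M + ⌊√2*⌋ z) M-2K ⟩
        2 * M + ⌊√2*⌋ (x₀ + ⌊√2*⌋ (3 * D)) ≤⟨ +-monoʳ-≤ (2 * M) (⌊√2*⌋-nested x₀ (3 * D)) ⟩
        2 * M + (⌊√2*⌋ x₀ + 2 * (3 * D)) ≡⟨ solve 3 (λ d a c → con 2 :* (con 6 :* d :+ a) :+ (c :+ con 2 :* (con 3 :* d)) := con 18 :* d :+ ((a :+ a) :+ c)) refl D (⌊√2*⌋ (3 * D)) (⌊√2*⌋ x₀) ⟩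
        18 * D + ((⌊√2*⌋ (3 * D) + ⌊√2*⌋ (3 * D)) + ⌊√2*⌋ x₀) ≤⟨ +-monoʳ-≤ (18 * D) (+-monoˡ-≤ (⌊√2*⌋ x₀) (⌊√2*⌋-superadditive (3 * D) (3 * D))) ⟩
        18 * D + (⌊√2*⌋ (3 * D + 3 * D) + ⌊√2*⌋ x₀) ≤⟨ +-monoʳ-≤ (18 * D) (⌊√2*⌋-superadditive (3 * D + 3 * D) x₀) ⟩
        18 * D + ⌊√2*⌋ ((3 * D + 3 * D) + x₀) ≡⟨ cong (λ z → 18 * D + ⌊√2*⌋ z) doubled-y ⟩
        18 * D + ⌊√2*⌋ (2 * y) ≤⟨ +-monoʳ-≤ (18 * D) (⌊√2*⌋-double y) ⟩
        18 * D + suc (2 * ⌊√2*⌋ y) ≡⟨ solve 2 (λ d a → con 18 :* d :+ (con 1 :+ con 2 :* a) := con 1 :+ con 2 :* (con 9 :* d :+ a)) refl D (⌊√2*⌋ y) ⟩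
        suc (2 * (9 * D + ⌊√2*⌋ y)) ∎

    Narrow-≤ : ∀ b b′ → b′ ≤ b → Narrow b → Narrow b′
    Narrow-≤ b b′ le h = ≤-trans (+-monoˡ-≤ K le) h

    RootBound-≤ : ∀ b b′ s → b′ ≤ b → RootBound b s → RootBound b′ s
    RootBound-≤ b b′ s le (a , h) = a , ≤-trans (+-monoˡ-≤ (2 * K) (*-monoʳ-≤ 2 le)) h

    Upper-neighbourhood : ∀ s t → ¬ Large s → t ≤ s * Δ → Upper t
    Upper-neighbourhood s t ¬large le = begin
      t ≤⟨ le ⟩
      s * Δ ≤⟨ *-monoˡ-≤ Δ s≤ ⟩
      (6 * K + ⌊√2*⌋ (3 * K)) * Δ ≡⟨ solve 3 (λ k a d → (con 6 :* k :+ a) :* d := con 6 :* (k :* d) :+ d :* a) refl K (⌊√2*⌋ (3 * K)) Δ ⟩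
      6 * D + Δ * ⌊√2*⌋ (3 * K) ≤⟨ +-monoʳ-≤ (6 * D) (⌊√2*⌋-scale Δ (3 * K)) ⟩
      6 * D + ⌊√2*⌋ (Δ * (3 * K)) ≡⟨ cong (λ z → 6 * D + ⌊√2*⌋ z) (solve 2 (λ d k → d :* (con 3 :* k) := con 3 :* (k :* d)) refl Δ K) ⟩
      M ∎
      where
      s≤ : s ≤ 6 * K + ⌊√2*⌋ (3 * K)
      s≤ = ≤-pred (≤-trans (≰⇒> ¬large) (≤-trans (+-monoʳ-≤ (6 * K) (⌈√2*⌉≤1+⌊√2*⌋ (3 * K))) (≤-reflexive (+-suc (6 * K) (⌊√2*⌋ (3 * K))))))

    Large⇒2K< : ∀ s → Large s → 2 * K < s
    Large⇒2K< s large = ≤-trans lt (≤-trans (m≤m+n (6 * K) _) large)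
      where
      lt : suc (2 * K) ≤ 6 * K
      lt = subst (suc (2 * K) ≤_) (solve 1 (λ k → con 4 :* k :+ con 2 :* k := con 6 :* k) refl K)
             (+-mono-≤ {1} {4 * K} (≤-trans 1≤K (m≤m+n K _)) (≤-refl {2 * K}))

    Large⇒Lower-third : ∀ s t → Large s → s ≤ 3 * t → Lower t
    Large⇒Lower-third s t large le = subst (2 * K + ⌈√2*⌉ K ≤_) (m+[n∸m]≡n 2K≤t) (+-monoʳ-≤ (2 * K) gK)
      where
      6K≤3t : 3 * (2 * K) ≤ 3 * t
      6K≤3t = ≤-trans (≤-reflexive (solve 1 (λ k → con 3 :* (con 2 :* k) := con 6 :* k) refl K)) (≤-trans (m≤m+n (6 * K) _) (≤-trans large le))
      2K≤t : 2 * K ≤ t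
      2K≤t = *-cancelˡ-≤ 3 6K≤3t
      g3 : ⌈√2*⌉ (3 * K) ≤ 3 * (t ∸ 2 * K)
      g3 = begin
        ⌈√2*⌉ (3 * K) ≡⟨ sym (m+n∸m≡n (6 * K) (⌈√2*⌉ (3 * K))) ⟩
        6 * K + ⌈√2*⌉ (3 * K) ∸ 6 * K ≤⟨ ∸-monoˡ-≤ (6 * K) (≤-trans large le) ⟩
        3 * t ∸ 6 * K ≡⟨ cong (3 * t ∸_) (solve 1 (λ k → con 6 :* k := con 3 :* (con 2 :* k)) refl K) ⟩
        3 * t ∸ 3 * (2 * K) ≡⟨ sym (*-distribˡ-∸ 3 t (2 * K)) ⟩
        3 * (t ∸ 2 * K) ∎
      gK : ⌈√2*⌉ K ≤ t ∸ 2 * K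
      gK = ⌈√2*⌉-cancel 3 K (t ∸ 2 * K) (s≤s z≤n) g3

    6D≤M : 6 * D ≤ M
    6D≤M = m≤m+n (6 * D) _

    Upper-half : ∀ s x a → Upper s → x ≤ K → 2 * a ≤ s → Upper (x + a)
    Upper-half s x a hi hx h = *-cancelˡ-≤ 2 (begin
      2 * (x + a) ≡⟨ *-distribˡ-+ 2 x a ⟩
      2 * x + 2 * a ≤⟨ +-mono-≤ (*-monoʳ-≤ 2 hx) (≤-trans h hi) ⟩
      2 * K + M ≤⟨ +-monoˡ-≤ M 2K≤M ⟩
      M + M ≡⟨ cong (M +_) (sym (+-identityʳ M)) ⟩
      2 * M ∎)

    Upper-two-thirds : ∀ s x a → Upper s → x ≤ K → 3 * a ≤ 2 * s → Upper (x + a)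
    Upper-two-thirds s x a hi hx h = *-cancelˡ-≤ 3 (begin
      3 * (x + a) ≡⟨ *-distribˡ-+ 3 x a ⟩
      3 * x + 3 * a ≤⟨ +-mono-≤ (*-monoʳ-≤ 3 hx) (≤-trans h (*-monoʳ-≤ 2 hi)) ⟩
      3 * K + 2 * M ≤⟨ +-monoˡ-≤ (2 * M) 3K≤M ⟩
      M + 2 * M ≡⟨ solve 1 (λ m → m :+ con 2 :* m := con 3 :* m) refl M ⟩
      3 * M ∎)
      where
      3K≤M : 3 * K ≤ M
      3K≤M = ≤-trans (*-mono-≤ {3} {6} (s≤s (s≤s (s≤s z≤n))) K≤D) 6D≤M

    RootBound-merge : ∀ s x a₁ a₂ b b₁ b₂ → RootBound b₁ (x + a₁) → RootBound b₂ (x + a₂) → b + x ≤ b₁ + b₂ → a₁ + a₂ ≤ s → x ≤ K → Lower s → RootBound b s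
    RootBound-merge s x a₁ a₂ b b₁ b₂ (c₁ , h₁) (c₂ , h₂) le sm hx lo = 2K≤s , +-cancelʳ-≤ (2 * x + 2 * K) _ _ chain
      where
      2K≤s : 2 * K ≤ s
      2K≤s = ≤-trans (m≤m+n (2 * K) _) lo
      e₁ = x + a₁ ∸ 2 * K
      e₂ = x + a₂ ∸ 2 * K
      E₁ : e₁ + 2 * K ≡ x + a₁
      E₁ = m∸n+n≡m c₁
      E₂ : e₂ + 2 * K ≡ x + a₂
      E₂ = m∸n+n≡m c₂
      esum : e₁ + e₂ ≤ s ∸ 2 * K
      esum = +-cancelʳ-≤ (2 * K) _ _ (+-cancelʳ-≤ (2 * K) _ _ (begin
        e₁ + e₂ + 2 * K + 2 * K ≡⟨ solve 3 (λ a b k → a :+ b :+ k :+ k := (a :+ k) :+ (b :+ k)) refl e₁ e₂ (2 * K) ⟩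
        (e₁ + 2 * K) + (e₂ + 2 * K) ≡⟨ cong₂ _+_ E₁ E₂ ⟩
        (x + a₁) + (x + a₂) ≡⟨ solve 3 (λ x a b → (x :+ a) :+ (x :+ b) := x :+ x :+ (a :+ b)) refl x a₁ a₂ ⟩
        x + x + (a₁ + a₂) ≤⟨ +-mono-≤ (+-mono-≤ hx hx) sm ⟩
        K + K + s ≡⟨ solve 2 (λ k s → k :+ k :+ s := s :+ con 2 :* k) refl K s ⟩
        s + 2 * K ≡⟨ cong (_+ 2 * K) (sym (m∸n+n≡m 2K≤s)) ⟩
        s ∸ 2 * K + 2 * K + 2 * K ∎))
      fsum : ⌊√2*⌋ e₁ + ⌊√2*⌋ e₂ ≤ ⌊√2*⌋ (s ∸ 2 * K)
      fsum = ≤-trans (⌊√2*⌋-superadditive e₁ e₂) (⌊√2*⌋-mono esum)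
      chain : 2 * b + 2 * K + (2 * x + 2 * K) ≤ 2 * s + ⌊√2*⌋ (s ∸ 2 * K) + (2 * x + 2 * K)
      chain = begin
        2 * b + 2 * K + (2 * x + 2 * K) ≡⟨ solve 3 (λ b x k → con 2 :* b :+ con 2 :* k :+ (con 2 :* x :+ con 2 :* k) := con 2 :* (b :+ x) :+ con 4 :* k) refl b x K ⟩
        2 * (b + x) + 4 * K ≤⟨ +-monoˡ-≤ (4 * K) (*-monoʳ-≤ 2 le) ⟩
        2 * (b₁ + b₂) + 4 * K ≡⟨ solve 3 (λ a b k → con 2 :* (a :+ b) :+ con 4 :* k := (con 2 :* a :+ con 2 :* k) :+ (con 2 :* b :+ con 2 :* k)) refl b₁ b₂ K ⟩
        (2 * b₁ + 2 * K) + (2 * b₂ + 2 * K) ≤⟨ +-mono-≤ h₁ h₂ ⟩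
        (2 * (x + a₁) + ⌊√2*⌋ e₁) + (2 * (x + a₂) + ⌊√2*⌋ e₂) ≡⟨ solve 5 (λ x a b p q → (con 2 :* (x :+ a) :+ p) :+ (con 2 :* (x :+ b) :+ q) := (con 2 :* x :+ con 2 :* x :+ con 2 :* (a :+ b)) :+ (p :+ q)) refl x a₁ a₂ (⌊√2*⌋ e₁) (⌊√2*⌋ e₂) ⟩
        (2 * x + 2 * x + 2 * (a₁ + a₂)) + (⌊√2*⌋ e₁ + ⌊√2*⌋ e₂) ≤⟨ +-mono-≤ (+-mono-≤ (+-monoˡ-≤ (2 * x) (*-monoʳ-≤ 2 hx)) (*-monoʳ-≤ 2 sm)) fsum ⟩
        (2 * K + 2 * x + 2 * s) + ⌊√2*⌋ (s ∸ 2 * K) ≡⟨ solve 4 (λ k x s p → (con 2 :* k :+ con 2 :* x :+ con 2 :* s) :+ p := con 2 :* s :+ p :+ (con 2 :* x :+ con 2 :* k)) refl K x s (⌊√2*⌋ (s ∸ 2 * K)) ⟩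
        2 * s + ⌊√2*⌋ (s ∸ 2 * K) + (2 * x + 2 * K) ∎

    large? : ∀ s → Dec (Large s)
    large? s = 6 * K + ⌈√2*⌉ (3 * K) ≤? s

    bounds : SizeBounds K Δ
    bounds = record
      { Lower = Lower ; Upper = Upper ; Narrow = Narrow ; Large = Large ; RootBound = RootBound ; large? = large? ; seed = 4 * K
      ; Lower-seed = Lower-seed ; Upper-seed = Upper-seed ; Narrow-<seed = Narrow-<seed ; Lower⇒pos = Lower⇒pos ; Lower-mono = Lower-mono
      ; RootBound-self = RootBound-self ; RootBound⇒Narrow = RootBound⇒Narrow ; Narrow-≤ = Narrow-≤ ; RootBound-≤ = RootBound-≤ ; Upper-neighbourhood = Upper-neighbourhood ; Large⇒2K< = Large⇒2K<
      ; Large⇒Lower-third = Large⇒Lower-third ; Upper-half = Upper-half ; Upper-two-thirds = Upper-two-thirds ; RootBound-merge = RootBound-merge }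

module IntegerEmbedding where

  open import Data.Nat.Base as ℕ using (ℕ; z≤n)
  open import Data.Integer as ℤ using (ℤ; +_; -[1+_]; +≤+; +<+)
  import Data.Integer.Properties as ℤP
  open import Data.Rational as ℚ using (ℚ; _/_; 0ℚ; ½; toℚᵘ)
  import Data.Rational.Properties as ℚP
  open import Data.Rational.Unnormalised as ℚᵘ using (ℚᵘ; mkℚᵘ; *≡*; *≤*; *<*)
  import Data.Rational.Unnormalised.Properties as ℚᵘP
  open import Data.Product.Base using (_×_; _,_)
  open import Data.Sum.Base using (_⊎_; inj₁; inj₂)
  open import Relation.Binary.PropositionalEquality using (_≡_; refl; sym; trans; cong; cong₂; subst; subst₂)
  open import Defs using (_+_√2; NonNeg)
  open import Data.Rational.Solver using (module +-*-Solver)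

  ι : ℤ → ℚ
  ι z = z / 1

  ιᵘ : ℤ → ℚᵘ
  ιᵘ z = mkℚᵘ z 0

  toℚᵘ-ι : ∀ z → toℚᵘ (ι z) ℚᵘ.≃ ιᵘ z
  toℚᵘ-ι z = ℚP.toℚᵘ-fromℚᵘ (ιᵘ z)

  *1 : ∀ z → z ℤ.* + 1 ≡ z
  *1 = ℤP.*-identityʳ

  ι-+ : ∀ a b → ι a ℚ.+ ι b ≡ ι (a ℤ.+ b)
  ι-+ a b = ℚP.toℚᵘ-injective (ℚᵘP.≃-trans (ℚP.toℚᵘ-homo-+ (ι a) (ι b))
             (ℚᵘP.≃-trans (ℚᵘP.+-cong (toℚᵘ-ι a) (toℚᵘ-ι b)) (ℚᵘP.≃-trans ueq (ℚᵘP.≃-sym (toℚᵘ-ι (a ℤ.+ b))))))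
    where
    ueq : ιᵘ a ℚᵘ.+ ιᵘ b ℚᵘ.≃ ιᵘ (a ℤ.+ b)
    ueq = *≡* (trans (*1 _) (trans (cong₂ ℤ._+_ (*1 a) (*1 b)) (sym (*1 _))))

  ι-* : ∀ a b → ι a ℚ.* ι b ≡ ι (a ℤ.* b)
  ι-* a b = ℚP.toℚᵘ-injective (ℚᵘP.≃-trans (ℚP.toℚᵘ-homo-* (ι a) (ι b))
             (ℚᵘP.≃-trans (ℚᵘP.*-cong (toℚᵘ-ι a) (toℚᵘ-ι b)) (ℚᵘP.≃-sym (toℚᵘ-ι (a ℤ.* b)))))

  ι-neg : ∀ a → ℚ.- ι a ≡ ι (ℤ.- a)
  ι-neg a = ℚP.toℚᵘ-injective (ℚᵘP.≃-trans (ℚP.toℚᵘ-homo‿- (ι a))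
             (ℚᵘP.≃-trans (ℚᵘP.-‿cong (toℚᵘ-ι a)) (ℚᵘP.≃-sym (toℚᵘ-ι (ℤ.- a)))))

  ι-sub : ∀ a b → ι a ℚ.- ι b ≡ ι (a ℤ.- b)
  ι-sub a b = trans (cong (ι a ℚ.+_) (ι-neg b)) (ι-+ a (ℤ.- b))

  ι-≤⁻ : ∀ {a b} → ι a ℚ.≤ ι b → a ℤ.≤ b
  ι-≤⁻ {a} {b} h = subst₂ ℤ._≤_ (*1 a) (*1 b) (ℚᵘP.drop-*≤* (ℚᵘP.≤-respʳ-≃ (toℚᵘ-ι b) (ℚᵘP.≤-respˡ-≃ (toℚᵘ-ι a) (ℚP.toℚᵘ-mono-≤ h))))

  ι-≤ : ∀ {a b} → a ℤ.≤ b → ι a ℚ.≤ ι b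
  ι-≤ {a} {b} h = ℚP.toℚᵘ-cancel-≤ (ℚᵘP.≤-respʳ-≃ (ℚᵘP.≃-sym (toℚᵘ-ι b)) (ℚᵘP.≤-respˡ-≃ (ℚᵘP.≃-sym (toℚᵘ-ι a))
                    (*≤* (subst₂ ℤ._≤_ (sym (*1 a)) (sym (*1 b)) h))))

  ι-<⁻ : ∀ {a b} → ι a ℚ.< ι b → a ℤ.< b
  ι-<⁻ {a} {b} h = subst₂ ℤ._<_ (*1 a) (*1 b) (ℚᵘP.drop-*<* (ℚᵘP.<-respʳ-≃ (toℚᵘ-ι b) (ℚᵘP.<-respˡ-≃ (toℚᵘ-ι a) (ℚP.toℚᵘ-mono-< h))))

  ι-< : ∀ {a b} → a ℤ.< b → ι a ℚ.< ι b
  ι-< {a} {b} h = ℚP.toℚᵘ-cancel-< (ℚᵘP.<-respʳ-≃ (ℚᵘP.≃-sym (toℚᵘ-ι b)) (ℚᵘP.<-respˡ-≃ (ℚᵘP.≃-sym (toℚᵘ-ι a))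
                    (*<* (subst₂ ℤ._<_ (sym (*1 a)) (sym (*1 b)) h))))

  module _ where
    open +-*-Solver
    two : ℚ
    two = + 2 / 1

    ι-square : ∀ A → ι A ℚ.* ι A ≡ ι (A ℤ.* A)
    ι-square A = ι-* A A

    ι-two-square : ∀ B → two ℚ.* (ι B ℚ.* ι B) ≡ ι (+ 2 ℤ.* (B ℤ.* B))
    ι-two-square B = trans (cong (two ℚ.*_) (ι-* B B)) (ι-* (+ 2) (B ℤ.* B))

    NonNeg⇒≤-pos : ∀ A r → NonNeg (ι A + ι (+ r) √2) → (+ 0 ℤ.≤ A) ⊎ (A ℤ.< + 0 × A ℤ.* A ℤ.≤ + 2 ℤ.* (+ r ℤ.* + r))
    NonNeg⇒≤-pos A r (inj₁ (h , _)) = inj₁ (ι-≤⁻ {+ 0} {A} h)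
    NonNeg⇒≤-pos A r (inj₂ (inj₁ (_ , neg , _))) with ι-<⁻ {+ r} {+ 0} neg
    ... | +<+ ()
    NonNeg⇒≤-pos A r (inj₂ (inj₂ (neg , _ , sq))) = inj₂ (ι-<⁻ {A} {+ 0} neg , ι-≤⁻ {A ℤ.* A} {+ 2 ℤ.* (+ r ℤ.* + r)} (subst₂ ℚ._≤_ (ι-square A) (ι-two-square (+ r)) sq))

    NonNeg⇒≥-neg : ∀ A r → NonNeg (ι A + ι (-[1+ r ]) √2) → (+ 0 ℤ.≤ A) × (+ 2 ℤ.* (-[1+ r ] ℤ.* -[1+ r ]) ℤ.≤ A ℤ.* A)
    NonNeg⇒≥-neg A r (inj₁ (_ , h)) with ι-≤⁻ {+ 0} { -[1+ r ]} h
    ... | ()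
    NonNeg⇒≥-neg A r (inj₂ (inj₁ (h0 , _ , sq))) = ι-≤⁻ {+ 0} {A} h0 , ι-≤⁻ {+ 2 ℤ.* (-[1+ r ] ℤ.* -[1+ r ])} {A ℤ.* A} (subst₂ ℚ._≤_ (ι-two-square -[1+ r ]) (ι-square A) sq)
    NonNeg⇒≥-neg A r (inj₂ (inj₂ (_ , pos , _))) with ι-<⁻ {+ 0} { -[1+ r ]} pos
    ... | ()

    ≤-pos⇒NonNeg : ∀ A r → (+ 0 ℤ.≤ A) ⊎ (A ℤ.< + 0 × 0 ℕ.< r × A ℤ.* A ℤ.≤ + 2 ℤ.* (+ r ℤ.* + r)) → NonNeg (ι A + ι (+ r) √2)
    ≤-pos⇒NonNeg A r (inj₁ h) = inj₁ (ι-≤ {+ 0} {A} h , ι-≤ {+ 0} {+ r} (+≤+ z≤n))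
    ≤-pos⇒NonNeg A r (inj₂ (neg , pos , sq)) = inj₂ (inj₂ (ι-< {A} {+ 0} neg , ι-< {+ 0} {+ r} (+<+ pos) , subst₂ ℚ._≤_ (sym (ι-square A)) (sym (ι-two-square (+ r))) (ι-≤ {A ℤ.* A} {+ 2 ℤ.* (+ r ℤ.* + r)} sq)))

    two*half-square : ∀ x → two ℚ.* ((½ ℚ.* x) ℚ.* (½ ℚ.* x)) ≡ ½ ℚ.* (x ℚ.* x)
    two*half-square x = solve 1 (λ x → con two :* ((con ½ :* x) :* (con ½ :* x)) := con ½ :* (x :* x)) refl x

    half*two : ∀ y → ½ ℚ.* (two ℚ.* y) ≡ y
    half*two y = solve 1 (λ y → con ½ :* (con two :* y) := y) refl y

    ≤-half⇒NonNeg : ∀ A r → (+ 0 ℤ.≤ A) ⊎ (A ℤ.< + 0 × 0 ℕ.< r × + 2 ℤ.* (A ℤ.* A) ℤ.≤ + r ℤ.* + r) → NonNeg (ι A + (½ ℚ.* ι (+ r)) √2)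
    ≤-half⇒NonNeg A r (inj₁ h) = inj₁ (ι-≤ {+ 0} {A} h , subst (ℚ._≤ ½ ℚ.* ι (+ r)) (ℚP.*-zeroʳ ½) (ℚP.*-monoˡ-≤-nonNeg ½ {0ℚ} {ι (+ r)} (ι-≤ {+ 0} {+ r} (+≤+ z≤n))))
    ≤-half⇒NonNeg A r (inj₂ (neg , pos , sq)) = inj₂ (inj₂ (ι-< {A} {+ 0} neg ,
      subst (ℚ._< ½ ℚ.* ι (+ r)) (ℚP.*-zeroʳ ½) (ℚP.*-monoʳ-<-pos ½ {0ℚ} {ι (+ r)} (ι-< {+ 0} {+ r} (+<+ pos))) ,
      subst₂ ℚ._≤_ (half*two (ι A ℚ.* ι A)) (sym (two*half-square (ι (+ r)))) (ℚP.*-monoˡ-≤-nonNeg ½ {two ℚ.* (ι A ℚ.* ι A)} {ι (+ r) ℚ.* ι (+ r)} (subst₂ ℚ._≤_ (sym (trans (cong (two ℚ.*_) (ι-square A)) (ι-* (+ 2) (A ℤ.* A)))) (sym (ι-square (+ r))) (ι-≤ {+ 2 ℤ.* (A ℤ.* A)} {+ r ℤ.* + r} sq)))))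

module Conversion where

  open import Data.Nat as ℕ using (ℕ; zero; suc; z≤n; s≤s; _≤?_)
  import Data.Nat.Properties as ℕP
  open import Data.Integer as ℤ using (ℤ; +_; -[1+_]; +≤+; -<+)
  import Data.Integer.Properties as ℤP
  open import Data.Rational as ℚ using (ℚ; _/_; 0ℚ; 1ℚ; ½)
  open import Data.Product using (_×_; _,_)
  open import Data.Sum using (_⊎_; inj₁; inj₂)
  open import Data.Empty using (⊥-elim)
  open import Relation.Nullary using (¬_; Dec; yes; no)
  open import Relation.Binary.PropositionalEquality using (_≡_; refl; sym; trans; cong; subst; subst₂)
  open import Defs using (ℚ√2; _+_√2; NonNeg; _≤√_; nat; γ; α; _⊕_; _⊖_; _⊗_)
  open IntegerEmbedding
  open Sqrt2Approximation
  open import Data.Rational.Solver using (module +-*-Solver)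
  open +-*-Solver

  -- a + b√2 with a, b polynomials for the rational ring solver; the operations mirror those of
  -- ℚ√2, so that re and im of a concrete expression can be normalised by solve.
  record Poly√2 (n : ℕ) : Set where
    constructor _,,_
    field
      reP : Polynomial n
      imP : Polynomial n
  open Poly√2

  mulP : ∀ {n} → Poly√2 n → Poly√2 n → Poly√2 n
  mulP (a ,, b) (c ,, d) = ((a :* c) :+ (con two :* (b :* d))) ,, ((a :* d) :+ (b :* c))
  subP : ∀ {n} → Poly√2 n → Poly√2 n → Poly√2 n
  subP (a ,, b) (c ,, d) = (a :- c) ,, (b :- d)
  addP : ∀ {n} → Poly√2 n → Poly√2 n → Poly√2 n
  addP (a ,, b) (c ,, d) = (a :+ c) ,, (b :+ d)
  natP : ∀ {n} → Polynomial n → Poly√2 n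
  natP x = x ,, con 0ℚ
  γP : ∀ {n} → Poly√2 n
  γP = con 1ℚ ,, con 1ℚ
  αP : ∀ {n} → Poly√2 n
  αP = con 1ℚ ,, con ½
  cP : ∀ {n} → ℕ → Poly√2 n
  cP c = con (+ c / 1) ,, con 0ℚ

  re-Lower : ∀ s K → ℚ√2.re (nat s ⊖ (γ ⊕ nat 1) ⊗ nat K) ≡ ι (+ s) ℚ.- two ℚ.* ι (+ K)
  re-Lower s K = solve 2 (λ s K → reP (subP (natP s) (mulP (addP γP (cP 1)) (natP K))) := s :- con two :* K) refl (ι (+ s)) (ι (+ K))

  im-Lower : ∀ s K → ℚ√2.im (nat s ⊖ (γ ⊕ nat 1) ⊗ nat K) ≡ ℚ.- ι (+ K)
  im-Lower s K = solve 2 (λ s K → imP (subP (natP s) (mulP (addP γP (cP 1)) (natP K))) := :- K) refl (ι (+ s)) (ι (+ K))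

  neg-square : ∀ a → (ℤ.- (+ a)) ℤ.* (ℤ.- (+ a)) ≡ + (a ℕ.* a)
  neg-square zero = refl
  neg-square (suc a) = refl

  pos-square : ∀ a → + a ℤ.* + a ≡ + (a ℕ.* a)
  pos-square a = sym (ℤP.pos-* a a)

  pos-double : ∀ x → + 2 ℤ.* + x ≡ + (2 ℕ.* x)
  pos-double x = sym (ℤP.pos-* 2 x)

  neg≱0 : ∀ {a} → 0 ℕ.< a → ¬ (+ 0 ℤ.≤ ℤ.- (+ a))
  neg≱0 {suc a} _ ()

  neg<0 : ∀ {a} → 0 ℕ.< a → ℤ.- (+ a) ℤ.< + 0
  neg<0 {suc a} _ = -<+

  ⌊√2*⌋-zero : ⌊√2*⌋ 0 ≡ 0
  ⌊√2*⌋-zero = ℕP.n≤0⇒n≡0 (sq-cancel-≤ {⌊√2*⌋ 0} {0} (⌊√2*⌋-spec 0))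

  module _ (k Δ : ℕ) where
    K : ℕ
    K = suc k
    D : ℕ
    D = K ℕ.* Δ

    ι-sub-2K : ∀ s → ι (+ s) ℚ.- two ℚ.* ι (+ K) ≡ ι (s ℤ.⊖ (2 ℕ.* K))
    ι-sub-2K s = trans (cong (λ z → ι (+ s) ℚ.- z) (ι-* (+ 2) (+ K)))
             (trans (ι-sub (+ s) (+ 2 ℤ.* + K)) (cong ι (trans (cong (λ z → + s ℤ.- z) (pos-double K)) (ℤP.m-n≡m⊖n s (2 ℕ.* K)))))

    Lower-NonNeg : ∀ s → (γ ⊕ nat 1) ⊗ nat K ≤√ nat s → NonNeg (ι (s ℤ.⊖ (2 ℕ.* K)) + ι -[1+ k ] √2)
    Lower-NonNeg s h = subst₂ (λ a b → NonNeg (a + b √2)) (trans (re-Lower s K) (ι-sub-2K s)) (trans (im-Lower s K) (ι-neg (+ K))) h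

    Lower-from-ℚ√2 : ∀ s → (γ ⊕ nat 1) ⊗ nat K ≤√ nat s → 2 ℕ.* K ℕ.+ ⌈√2*⌉ K ℕ.≤ s
    Lower-from-ℚ√2 s h = by-sign (NonNeg⇒≥-neg (s ℤ.⊖ (2 ℕ.* K)) k (Lower-NonNeg s h)) (2 ℕ.* K ℕ.≤? s)
      where
      by-sign : (+ 0 ℤ.≤ s ℤ.⊖ (2 ℕ.* K)) × (+ 2 ℤ.* (-[1+ k ] ℤ.* -[1+ k ]) ℤ.≤ (s ℤ.⊖ (2 ℕ.* K)) ℤ.* (s ℤ.⊖ (2 ℕ.* K))) →
               Dec (2 ℕ.* K ℕ.≤ s) → 2 ℕ.* K ℕ.+ ⌈√2*⌉ K ℕ.≤ s
      by-sign (nonneg , square-bound) (no p) = ⊥-elim (neg≱0 (ℕP.m<n⇒0<n∸m (ℕP.≰⇒> p)) (subst (+ 0 ℤ.≤_) (ℤP.⊖-< (ℕP.≰⇒> p)) nonneg))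
      by-sign (nonneg , square-bound) (yes p) = subst (2 ℕ.* K ℕ.+ ⌈√2*⌉ K ℕ.≤_) (ℕP.m+[n∸m]≡n p) (ℕP.+-monoʳ-≤ (2 ℕ.* K) ⌈√2K⌉≤)
        where
        squares : + (2 ℕ.* (K ℕ.* K)) ℤ.≤ + ((s ℕ.∸ 2 ℕ.* K) ℕ.* (s ℕ.∸ 2 ℕ.* K))
        squares = subst₂ ℤ._≤_ (pos-double (K ℕ.* K)) (trans (cong (λ z → z ℤ.* z) (ℤP.⊖-≥ p)) (pos-square (s ℕ.∸ 2 ℕ.* K))) square-bound
        ⌈√2K⌉≤ : ⌈√2*⌉ K ℕ.≤ s ℕ.∸ 2 ℕ.* K
        ⌈√2K⌉≤ = ⌈√2*⌉-least K (s ℕ.∸ 2 ℕ.* K) (ℤP.drop‿+≤+ squares)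

    re-Upper : ∀ s → ℚ√2.re (nat 3 ⊗ (γ ⊕ nat 1) ⊗ nat K ⊗ nat Δ ⊖ nat s) ≡ (+ 6 / 1) ℚ.* ι (+ K) ℚ.* ι (+ Δ) ℚ.- ι (+ s)
    re-Upper s = solve 3 (λ s K d → reP (subP (mulP (mulP (mulP (cP 3) (addP γP (cP 1))) (natP K)) (natP d)) (natP s)) := con (+ 6 / 1) :* K :* d :- s) refl (ι (+ s)) (ι (+ K)) (ι (+ Δ))

    im-Upper : ∀ s → ℚ√2.im (nat 3 ⊗ (γ ⊕ nat 1) ⊗ nat K ⊗ nat Δ ⊖ nat s) ≡ (+ 3 / 1) ℚ.* ι (+ K) ℚ.* ι (+ Δ)
    im-Upper s = solve 3 (λ s K d → imP (subP (mulP (mulP (mulP (cP 3) (addP γP (cP 1))) (natP K)) (natP d)) (natP s)) := con (+ 3 / 1) :* K :* d) refl (ι (+ s)) (ι (+ K)) (ι (+ Δ))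

    ι-*D : ∀ c → (+ c / 1) ℚ.* ι (+ K) ℚ.* ι (+ Δ) ≡ ι (+ (c ℕ.* D))
    ι-*D c = trans (cong (ℚ._* ι (+ Δ)) (ι-* (+ c) (+ K))) (trans (ι-* (+ c ℤ.* + K) (+ Δ))
             (cong ι (trans (cong (ℤ._* + Δ) (sym (ℤP.pos-* c K))) (trans (sym (ℤP.pos-* (c ℕ.* K) Δ)) (cong +_ (ℕP.*-assoc c K Δ))))))

    Upper-from-ℚ√2 : ∀ s → nat s ≤√ nat 3 ⊗ (γ ⊕ nat 1) ⊗ nat K ⊗ nat Δ → s ℕ.≤ 6 ℕ.* D ℕ.+ ⌊√2*⌋ (3 ℕ.* D)
    Upper-from-ℚ√2 s h = by-sign (NonNeg⇒≤-pos ((6 ℕ.* D) ℤ.⊖ s) (3 ℕ.* D) Upper-NonNeg) (s ℕ.≤? 6 ℕ.* D)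
      where
      Upper-NonNeg : NonNeg (ι ((6 ℕ.* D) ℤ.⊖ s) + ι (+ (3 ℕ.* D)) √2)
      Upper-NonNeg = subst₂ (λ a b → NonNeg (a + b √2))
             (trans (re-Upper s) (trans (cong (λ z → z ℚ.- ι (+ s)) (ι-*D 6)) (trans (ι-sub (+ (6 ℕ.* D)) (+ s)) (cong ι (ℤP.m-n≡m⊖n (6 ℕ.* D) s)))))
             (trans (im-Upper s) (ι-*D 3)) h
      A : ℤ
      A = (6 ℕ.* D) ℤ.⊖ s
      by-sign : (+ 0 ℤ.≤ A) ⊎ (A ℤ.< + 0 × A ℤ.* A ℤ.≤ + 2 ℤ.* (+ (3 ℕ.* D) ℤ.* + (3 ℕ.* D))) → Dec (s ℕ.≤ 6 ℕ.* D) →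
               s ℕ.≤ 6 ℕ.* D ℕ.+ ⌊√2*⌋ (3 ℕ.* D)
      by-sign _ (yes p) = ℕP.≤-trans p (ℕP.m≤m+n (6 ℕ.* D) (⌊√2*⌋ (3 ℕ.* D)))
      by-sign (inj₁ nonneg) (no p) = ⊥-elim (neg≱0 (ℕP.m<n⇒0<n∸m (ℕP.≰⇒> p)) (subst (+ 0 ℤ.≤_) (ℤP.⊖-< (ℕP.≰⇒> p)) nonneg))
      by-sign (inj₂ (neg , square-bound)) (no p) = subst (ℕ._≤ 6 ℕ.* D ℕ.+ ⌊√2*⌋ (3 ℕ.* D)) (ℕP.m+[n∸m]≡n (ℕP.<⇒≤ (ℕP.≰⇒> p))) (ℕP.+-monoʳ-≤ (6 ℕ.* D) excess≤)
        where
        squares : + ((s ℕ.∸ 6 ℕ.* D) ℕ.* (s ℕ.∸ 6 ℕ.* D)) ℤ.≤ + (2 ℕ.* ((3 ℕ.* D) ℕ.* (3 ℕ.* D)))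
        squares = subst₂ ℤ._≤_ (trans (cong (λ z → z ℤ.* z) (ℤP.⊖-< (ℕP.≰⇒> p))) (neg-square (s ℕ.∸ 6 ℕ.* D)))
                           (trans (cong (+ 2 ℤ.*_) (pos-square (3 ℕ.* D))) (pos-double ((3 ℕ.* D) ℕ.* (3 ℕ.* D)))) square-bound
        excess≤ : s ℕ.∸ 6 ℕ.* D ℕ.≤ ⌊√2*⌋ (3 ℕ.* D)
        excess≤ = ⌊√2*⌋-greatest (3 ℕ.* D) (s ℕ.∸ 6 ℕ.* D) (ℤP.drop‿+≤+ squares)

    re-RootBound : ∀ s b → ℚ√2.re (α ⊗ nat s ⊖ γ ⊗ nat K ⊖ nat b) ≡ ι (+ s) ℚ.- (ι (+ K) ℚ.+ ι (+ b))
    re-RootBound s b = solve 3 (λ s K b → reP (subP (subP (mulP αP (natP s)) (mulP γP (natP K))) (natP b)) := s :- (K :+ b)) refl (ι (+ s)) (ι (+ K)) (ι (+ b))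

    im-RootBound : ∀ s b → ℚ√2.im (α ⊗ nat s ⊖ γ ⊗ nat K ⊖ nat b) ≡ ½ ℚ.* (ι (+ s) ℚ.- two ℚ.* ι (+ K))
    im-RootBound s b = solve 3 (λ s K b → imP (subP (subP (mulP αP (natP s)) (mulP γP (natP K))) (natP b)) := con ½ :* (s :- con two :* K)) refl (ι (+ s)) (ι (+ K)) (ι (+ b))

    sub-ι : ∀ p q r → ι (+ p) ℚ.- (ι (+ q) ℚ.+ ι (+ r)) ≡ ι (p ℤ.⊖ (q ℕ.+ r))
    sub-ι p q r = trans (cong (λ z → ι (+ p) ℚ.- z) (trans (ι-+ (+ q) (+ r)) (cong ι (sym (ℤP.pos-+ q r)))))
                    (trans (ι-sub (+ p) (+ (q ℕ.+ r))) (cong ι (ℤP.m-n≡m⊖n p (q ℕ.+ r))))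

    RootBound-to-ℚ√2 : ∀ b s → 2 ℕ.* K ℕ.≤ s → 2 ℕ.* b ℕ.+ 2 ℕ.* K ℕ.≤ 2 ℕ.* s ℕ.+ ⌊√2*⌋ (s ℕ.∸ 2 ℕ.* K) →
              nat b ≤√ α ⊗ nat s ⊖ γ ⊗ nat K
    RootBound-to-ℚ√2 b s c h = subst₂ (λ a b → NonNeg (a + b √2)) (sym (trans (re-RootBound s b) (sub-ι s K b))) (sym (trans (im-RootBound s b) im-eq))
                        (≤-half⇒NonNeg A r (by-sign (K ℕ.+ b ℕ.≤? s)))
      where
      A : ℤ
      A = s ℤ.⊖ (K ℕ.+ b)
      r : ℕ
      r = s ℕ.∸ 2 ℕ.* K
      im-eq : ½ ℚ.* (ι (+ s) ℚ.- two ℚ.* ι (+ K)) ≡ ½ ℚ.* ι (+ r)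
      im-eq = cong (½ ℚ.*_) (trans (ι-sub-2K s) (cong ι (ℤP.⊖-≥ c)))
      by-sign : Dec (K ℕ.+ b ℕ.≤ s) → (+ 0 ℤ.≤ A) ⊎ (A ℤ.< + 0 × 0 ℕ.< r × + 2 ℤ.* (A ℤ.* A) ℤ.≤ + r ℤ.* + r)
      by-sign (yes p) = inj₁ (subst (+ 0 ℤ.≤_) (sym (ℤP.⊖-≥ p)) (+≤+ z≤n))
      by-sign (no p) = inj₂ (subst (ℤ._< + 0) (sym (ℤP.⊖-< (ℕP.≰⇒> p))) (neg<0 (ℕP.m<n⇒0<n∸m (ℕP.≰⇒> p))) , r-pos ,
                         subst₂ ℤ._≤_ (sym (trans (cong (λ z → + 2 ℤ.* (z ℤ.* z)) (ℤP.⊖-< (ℕP.≰⇒> p))) (trans (cong (+ 2 ℤ.*_) (neg-square a)) (pos-double (a ℕ.* a)))))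
                                      (sym (pos-square r)) (+≤+ squares≤))
        where
        a = (K ℕ.+ b) ℕ.∸ s
        open ℕP.≤-Reasoning
        2a≤⌊√2r⌋ : 2 ℕ.* a ℕ.≤ ⌊√2*⌋ r
        2a≤⌊√2r⌋ = ℕP.+-cancelʳ-≤ (2 ℕ.* s) (2 ℕ.* a) (⌊√2*⌋ r) (begin
          2 ℕ.* a ℕ.+ 2 ℕ.* s ≡⟨ sym (ℕP.*-distribˡ-+ 2 a s) ⟩
          2 ℕ.* (a ℕ.+ s) ≡⟨ cong (2 ℕ.*_) (ℕP.m∸n+n≡m (ℕP.<⇒≤ (ℕP.≰⇒> p))) ⟩
          2 ℕ.* (K ℕ.+ b) ≡⟨ trans (ℕP.*-distribˡ-+ 2 K b) (ℕP.+-comm (2 ℕ.* K) (2 ℕ.* b)) ⟩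
          2 ℕ.* b ℕ.+ 2 ℕ.* K ≤⟨ h ⟩
          2 ℕ.* s ℕ.+ ⌊√2*⌋ r ≡⟨ ℕP.+-comm (2 ℕ.* s) (⌊√2*⌋ r) ⟩
          ⌊√2*⌋ r ℕ.+ 2 ℕ.* s ∎)
        a-pos : 0 ℕ.< a
        a-pos = ℕP.m<n⇒0<n∸m (ℕP.≰⇒> p)
        r-pos : 0 ℕ.< r
        r-pos = ℕP.n≢0⇒n>0 λ r≡0 →
          ℕP.<⇒≱ (ℕP.*-monoʳ-< 2 a-pos) (ℕP.≤-trans 2a≤⌊√2r⌋ (ℕP.≤-reflexive (trans (cong ⌊√2*⌋ r≡0) ⌊√2*⌋-zero)))
        squares≤ : 2 ℕ.* (a ℕ.* a) ℕ.≤ r ℕ.* r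
        squares≤ = ℕP.*-cancelˡ-≤ 2 (begin
          2 ℕ.* (2 ℕ.* (a ℕ.* a)) ≡⟨ sq-2* a ⟨
          sq (2 ℕ.* a) ≤⟨ sq-mono-≤ 2a≤⌊√2r⌋ ⟩
          sq (⌊√2*⌋ r) ≤⟨ ⌊√2*⌋-spec r ⟩
          2 ℕ.* (r ℕ.* r) ∎)

    re-Narrow : ∀ b → ℚ√2.re (γ ⊗ nat K ⊗ (nat 3 ⊗ γ ⊗ nat Δ ⊖ nat 1) ⊖ nat b) ≡ (+ 9 / 1) ℚ.* ι (+ K) ℚ.* ι (+ Δ) ℚ.- (ι (+ K) ℚ.+ ι (+ b))
    re-Narrow b = solve 3 (λ K d b → reP (subP (mulP (mulP γP (natP K)) (subP (mulP (mulP (cP 3) γP) (natP d)) (cP 1))) (natP b)) := con (+ 9 / 1) :* K :* d :- (K :+ b)) refl (ι (+ K)) (ι (+ Δ)) (ι (+ b))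

    im-Narrow : ∀ b → ℚ√2.im (γ ⊗ nat K ⊗ (nat 3 ⊗ γ ⊗ nat Δ ⊖ nat 1) ⊖ nat b) ≡ (+ 6 / 1) ℚ.* ι (+ K) ℚ.* ι (+ Δ) ℚ.- ι (+ K)
    im-Narrow b = solve 3 (λ K d b → imP (subP (mulP (mulP γP (natP K)) (subP (mulP (mulP (cP 3) γP) (natP d)) (cP 1))) (natP b)) := con (+ 6 / 1) :* K :* d :- K) refl (ι (+ K)) (ι (+ Δ)) (ι (+ b))

    Narrow-to-ℚ√2 : 1 ℕ.≤ Δ → ∀ b → b ℕ.+ K ℕ.≤ 9 ℕ.* D ℕ.+ ⌊√2*⌋ (6 ℕ.* D ℕ.∸ K) →
              nat b ≤√ γ ⊗ nat K ⊗ (nat 3 ⊗ γ ⊗ nat Δ ⊖ nat 1)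
    Narrow-to-ℚ√2 1≤Δ b h = subst₂ (λ a b → NonNeg (a + b √2))
                    (sym (trans (re-Narrow b) (trans (cong (λ z → z ℚ.- (ι (+ K) ℚ.+ ι (+ b))) (ι-*D 9)) (sub-ι (9 ℕ.* D) K b))))
                    (sym (trans (im-Narrow b) (trans (cong (λ z → z ℚ.- ι (+ K)) (ι-*D 6))
                         (trans (ι-sub (+ (6 ℕ.* D)) (+ K)) (cong ι (trans (ℤP.m-n≡m⊖n (6 ℕ.* D) K) (ℤP.⊖-≥ K≤6D)))))))
                    (≤-pos⇒NonNeg ((9 ℕ.* D) ℤ.⊖ (K ℕ.+ b)) (6 ℕ.* D ℕ.∸ K) (by-sign (K ℕ.+ b ℕ.≤? 9 ℕ.* D)))
      where
      K≤D : K ℕ.≤ D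
      K≤D = subst (ℕ._≤ K ℕ.* Δ) (ℕP.*-identityʳ K) (ℕP.*-monoʳ-≤ K 1≤Δ)
      K≤6D : K ℕ.≤ 6 ℕ.* D
      K≤6D = ℕP.≤-trans K≤D (ℕP.m≤m+n D (5 ℕ.* D))
      r = 6 ℕ.* D ℕ.∸ K
      by-sign : Dec (K ℕ.+ b ℕ.≤ 9 ℕ.* D) → (+ 0 ℤ.≤ (9 ℕ.* D) ℤ.⊖ (K ℕ.+ b)) ⊎ ((9 ℕ.* D) ℤ.⊖ (K ℕ.+ b) ℤ.< + 0 × 0 ℕ.< r ×
                ((9 ℕ.* D) ℤ.⊖ (K ℕ.+ b)) ℤ.* ((9 ℕ.* D) ℤ.⊖ (K ℕ.+ b)) ℤ.≤ + 2 ℤ.* (+ r ℤ.* + r))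
      by-sign (yes p) = inj₁ (subst (+ 0 ℤ.≤_) (sym (ℤP.⊖-≥ p)) (+≤+ z≤n))
      by-sign (no p) = inj₂ (subst (ℤ._< + 0) (sym (ℤP.⊖-< (ℕP.≰⇒> p))) (neg<0 (ℕP.m<n⇒0<n∸m (ℕP.≰⇒> p))) , r-pos ,
                         subst₂ ℤ._≤_ (sym (trans (cong (λ z → z ℤ.* z) (ℤP.⊖-< (ℕP.≰⇒> p))) (neg-square a)))
                                      (sym (trans (cong (+ 2 ℤ.*_) (pos-square r)) (pos-double (r ℕ.* r)))) (+≤+ squares≤))
        where
        a = (K ℕ.+ b) ℕ.∸ 9 ℕ.* D
        open ℕP.≤-Reasoning
        a≤⌊√2r⌋ : a ℕ.≤ ⌊√2*⌋ r
        a≤⌊√2r⌋ = ℕP.+-cancelʳ-≤ (9 ℕ.* D) _ _ (begin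
          a ℕ.+ 9 ℕ.* D ≡⟨ ℕP.m∸n+n≡m (ℕP.<⇒≤ (ℕP.≰⇒> p)) ⟩
          K ℕ.+ b ≡⟨ ℕP.+-comm K b ⟩
          b ℕ.+ K ≤⟨ h ⟩
          9 ℕ.* D ℕ.+ ⌊√2*⌋ r ≡⟨ ℕP.+-comm (9 ℕ.* D) (⌊√2*⌋ r) ⟩
          ⌊√2*⌋ r ℕ.+ 9 ℕ.* D ∎)
        r-pos : 0 ℕ.< r
        r-pos = ℕP.m<n⇒0<n∸m (ℕP.<-≤-trans (ℕP.m<m+n K {5 ℕ.* K} (s≤s z≤n)) (ℕP.*-monoʳ-≤ 6 K≤D))
        squares≤ : a ℕ.* a ℕ.≤ 2 ℕ.* (r ℕ.* r)
        squares≤ = ℕP.≤-trans (sq-mono-≤ a≤⌊√2r⌋) (⌊√2*⌋-spec r)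

open import Data.Nat.Base using (ℕ; zero; suc; _≤_; _<_; z≤n; s≤s)
open import Data.Nat using (_≤?_)
open import Data.Nat.Properties using (≤-trans; ≤-reflexive; <-≤-trans; ≰⇒>)
open import Data.Bool.Base using (Bool; true; false; T)
open import Data.Fin.Base using (Fin; zero)
open import Data.Fin.Properties using (_≟_)
open import Data.Fin.Subset using (Subset; _⊆_; ∣_∣)
open import Data.Fin.Subset.Properties using (∣p∣≤n)
open import Data.Vec.Base using (lookup)
open import Data.Vec.Properties using (lookup∘tabulate)
open import Data.Product.Base using (Σ; ∃; _×_; _,_; proj₁; proj₂)
open import Relation.Nullary using (Dec; yes; no)
open import Relation.Binary.PropositionalEquality using (_≡_; sym; trans; subst)
open import Data.Unit.Base using (tt)
open import Defs hiding (sym)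
open Counting
open RootedPartitions
open Construction
open ConcreteBounds
open Conversion

Width : ℕ → ℕ → ℚ√2
Width k Δ = γ ⊗ nat (suc k) ⊗ (nat 3 ⊗ γ ⊗ nat Δ ⊖ nat 1)

module Partitioning {n : ℕ} (k Δ : ℕ) (1≤Δ : 1 ≤ Δ) (G : Graph n) (TD : TreeWidth≤ G k) (deg : MaxDegree≤ G Δ) where

  open Concrete (suc k) Δ (s≤s z≤n) 1≤Δ using (bounds)
  open SizeBounds bounds
  open Build G k Δ TD deg bounds
  open Partitions G

  everything : Fin n → Bool
  everything _ = true

  narrow-tree-partition : ∀ {S} → Solution everything S →
    Σ (TreePartition G) λ P → ∀ i → nat ∣ Bag P i ∣ ≤√ Width k Δ
  narrow-tree-partition sol = toTreePartition partition , λ i → Narrow-to-ℚ√2 k Δ 1≤Δ (bagSize partition i) (narrow i)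
    where open Solution sol

  single-bag : n < seed → Σ (TreePartition G) λ P → ∀ i → nat ∣ Bag P i ∣ ≤√ Width k Δ
  single-bag small = P , λ i → Narrow-to-ℚ√2 k Δ 1≤Δ ∣ Bag P i ∣ (Narrow-<seed _ (<-≤-trans (s≤s (∣p∣≤n (Bag P i))) small))
    where
    P : TreePartition G
    P = record { m = 1 ; f = λ _ → zero ; forest = λ { (_ , _ , _ , _ , (c≢c′ , _ , _ , _ , e , e′)) → c≢c′ (trans (sym e) e′) } }

  narrow-partition : Σ (TreePartition G) λ P → ∀ i → nat ∣ Bag P i ∣ ≤√ Width k Δ
  narrow-partition = by-size (seed ≤? n)
    where
    by-size : Dec (seed ≤ n) → Σ (TreePartition G) λ P → ∀ i → nat ∣ Bag P i ∣ ≤√ Width k Δ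
    by-size (no small) = single-bag (≰⇒> small)
    by-size (yes fits) = from-seed (count-between (λ _ → false) everything (λ _ ()) seed
                                      (≤-trans (≤-reflexive (count-false {n})) z≤n) (≤-trans fits (≤-reflexive (sym (count-true {n})))))
      where
      from-seed : Σ (Fin n → Bool) (λ S → _ × _ × count S ≡ seed) → Σ (TreePartition G) λ P → ∀ i → nat ∣ Bag P i ∣ ≤√ Width k Δ
      from-seed (S , _ , _ , size) = narrow-tree-partition (solve n everything S (count≤n everything) (λ _ _ → tt)
                                       (subst Lower (sym size) Lower-seed) (subst Upper (sym size) Upper-seed))

  narrow-partition-containing : (S : Subset n) →
    (γ ⊕ nat 1) ⊗ nat (suc k) ≤√ nat ∣ S ∣ →
    nat ∣ S ∣ ≤√ nat 3 ⊗ (γ ⊕ nat 1) ⊗ nat (suc k) ⊗ nat Δ →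
    Σ (TreePartition G) λ P → (∀ i → nat ∣ Bag P i ∣ ≤√ Width k Δ)
      × ∃ λ i → S ⊆ Bag P i × nat ∣ Bag P i ∣ ≤√ α ⊗ nat ∣ S ∣ ⊖ γ ⊗ nat (suc k)
  narrow-partition-containing S lower upper = with-root (solve n everything (lookup S) (count≤n everything) (λ _ _ → tt)
                                       (subst Lower (∣∣≡count S) (Lower-from-ℚ√2 k Δ ∣ S ∣ lower))
                                       (subst Upper (∣∣≡count S) (Upper-from-ℚ√2 k Δ ∣ S ∣ upper)))
    where
    with-root : Solution everything (lookup S) → _
    with-root sol = toTreePartition partition , proj₂ (narrow-tree-partition sol) , root , (λ {x} → S⊆root {x}) , root-bag
      where
      open Solution sol
      open RootedPartition partition
      S⊆root : S ⊆ Bag (toTreePartition partition) root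
      S⊆root {x} x∈S = T⇒∈ (subst T (sym (lookup∘tabulate _ x)) (does-complete (label x ≟ root) (S-at-root x (∈⇒T x∈S))))
      root-bag : nat ∣ Bag (toTreePartition partition) root ∣ ≤√ α ⊗ nat ∣ S ∣ ⊖ γ ⊗ nat (suc k)
      root-bag = subst (λ s → nat (bagSize partition root) ≤√ α ⊗ nat s ⊖ γ ⊗ nat (suc k)) (sym (∣∣≡count S))
                   (RootBound-to-ℚ√2 k Δ (bagSize partition root) (count (lookup S)) (proj₁ root-bound) (proj₂ root-bound))

lemma4 : (k Δ : ℕ) → 1 ≤ k → 1 ≤ Δ →
  ∀ {n} (G : Graph n) → TreeWidth≤ G k → MaxDegree≤ G Δ →
    -- tpw(G) ≤ γ(k+1)(3γΔ-1)
    (Σ (TreePartition G) λ P →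
       ∀ i → nat ∣ Bag P i ∣ ≤√ γ ⊗ nat (suc k) ⊗ (nat 3 ⊗ γ ⊗ nat Δ ⊖ nat 1))
  × ((S : Subset n) →
       (γ ⊕ nat 1) ⊗ nat (suc k) ≤√ nat ∣ S ∣ →
       nat ∣ S ∣ ≤√ nat 3 ⊗ (γ ⊕ nat 1) ⊗ nat (suc k) ⊗ nat Δ →
       Σ (TreePartition G) λ P →
           (∀ i → nat ∣ Bag P i ∣ ≤√ γ ⊗ nat (suc k) ⊗ (nat 3 ⊗ γ ⊗ nat Δ ⊖ nat 1))
         × ∃ λ i → S ⊆ Bag P i
                 × nat ∣ Bag P i ∣ ≤√ α ⊗ nat ∣ S ∣ ⊖ γ ⊗ nat (suc k))
lemma4 k Δ _ 1≤Δ G TD deg = narrow-partition , narrow-partition-containing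
  where open Partitioning k Δ 1≤Δ G TD deg
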